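{- The cycle index sum of oriented outer-edge rooted dissections is $$Z(\mathcal E_o^o)=\frac{s_1}4\Big(s_1+1-\sqrt{s_1^2-6s_1+1}\Big).$$ The cycle index sum of reflective outer-edge rooted dissections is $Z(\mathcal E_o^r)=\frac12\big(Z^+(\mathcal E_o^r)+Z^-(\mathcal E_o^r)\big)$, where $$Z^+(\mathcal E_o^r)=\frac{1+s_1-3s_1^2+s_1^3-(1+s_1)\sqrt{s_1^4-6s_1^2+1}}{4s_1},\qquad Z^-(\mathcal E_o^r)=\frac{s_2^2-3s_1s_2+s_2+s_1-(s_2+s_1)\sqrt{s_2^2-6s_2+1}}{4s_2}.$$
   Context: A dissection is a two-connected outerplanar graph with at least three vertices; it has a unique Hamiltonian cycle and embeds uniquely as a convex polygon (the Hamiltonian cycle) with non-crossing diagonals; edges on the Hamiltonian cycle are outer-edges. By convention the single edge $K_2$ is also an (outer-)edge rooted dissection. Cycle index: for a permutation group $A$, $Z(A)=\frac1{|A|}\sum_{\alpha\in A}\prod_k s_k^{j_k(\alpha)}$, $j_k(\alpha)$ the number of $k$-cycles of $\alpha$ on the vertices; for a class of unlabeled structures, the cycle index sum is the sum of the cycle indices of their automorphism groups over isomorphism classes. An outer-edge rooted dissection is a dissection with a distinguished outer-edge (automorphisms must map the root edge to itself, possibly swapping its ends). An oriented dissection carries an orientation of its Hamiltonian cycle, and only orientation-preserving automorphisms are allowed; an oriented outer-edge rooted dissection has trivial automorphism group, so $Z(\mathcal E_o^o)=\sum s_1^{|D|}$ over isomorphism classes of oriented outer-edge rooted dissections $D$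 ($|D|$ the number of vertices). An outer-edge rooted dissection is reflective if its automorphism group contains a nontrivial element (a reflection $\sigma_D$ swapping the ends of the root edge); $\mathcal E_o^r$ is the class of these, including $K_2$. Then $Z^+(\mathcal E_o^r)=\sum_{D\in\mathcal E_o^r}s_1^{|D|}$ (contribution of identities) and $Z^-(\mathcal E_o^r)=\sum_{D\in\mathcal E_o^r}\prod_ks_k^{j_k(\sigma_D)}$ (contribution of reflections). -}

module Defs where

open import Data.Nat.Base as ℕ using (ℕ; zero; suc; _≡ᵇ_; _<ᵇ_; _≤ᵇ_; _∸_)
open import Data.Bool.Base using (Bool; true; false; _∧_; _∨_; not; if_then_else_)
open import Data.List.Base using (List; []; _∷_; _++_; map; concatMap; length; filterᵇ; upTo; foldr)
open import Data.Bool.ListAction using (all; any)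
open import Data.Product.Base using (_×_; _,_)
open import Data.Integer.Base using (+_; -[1+_])
open import Data.Rational.Base as ℚ using (ℚ; 0ℚ; 1ℚ; ½; _+_; _*_; _-_)
open import Relation.Binary.PropositionalEquality using (_≡_)

-- A dissection on n ≥ 3 vertices is the n-gon with vertices 0,1,…,n-1
-- (in this cyclic order along the Hamiltonian cycle) together with a set
-- of pairwise non-crossing diagonals.  The root outer-edge is {0 , n-1};
-- the orientation of the Hamiltonian cycle is 0 → 1 → … → n-1 → 0.
-- Once root edge and orientation are fixed the labelling is forced, so
-- isomorphism classes of oriented outer-edge rooted dissections with n
-- vertices are exactly the sets of pairwise non-crossing diagonals of the
-- labelled n-gon.  For n = 2 the only set is the empty one: this is K₂.

Diag : Set
Diag = ℕ × ℕ     -- a diagonal (i , j) with i < j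

isDiag : ℕ → Diag → Bool
isDiag n (i , j) = (i <ᵇ j) ∧ (j <ᵇ n) ∧ (2 ≤ᵇ (j ∸ i)) ∧ not ((i ≡ᵇ 0) ∧ (j ≡ᵇ (n ∸ 1)))

diagonals : ℕ → List Diag
diagonals n = filterᵇ (isDiag n) (concatMap (λ j → map (λ i → (i , j)) (upTo n)) (upTo n))

crosses : Diag → Diag → Bool
crosses (a , b) (c , d) = ((a <ᵇ c) ∧ (c <ᵇ b) ∧ (b <ᵇ d)) ∨ ((c <ᵇ a) ∧ (a <ᵇ d) ∧ (d <ᵇ b))

nonCrossing : List Diag → Bool
nonCrossing [] = true
nonCrossing (d ∷ ds) = all (λ e → not (crosses d e)) ds ∧ nonCrossing ds

subsets : {A : Set} → List A → List (List A)
subsets [] = [] ∷ []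
subsets (x ∷ xs) = map (x ∷_) (subsets xs) ++ subsets xs

dissections : ℕ → List (List Diag)
dissections n = if n <ᵇ 2 then [] else filterᵇ nonCrossing (subsets (diagonals n))

-- The only non-identity automorphism of the polygon fixing
-- the root edge {0 , n-1} setwise is ρ i = n-1-i (swapping the root ends).
-- Unoriented outer-edge rooted dissections are diagonal sets up to ρ;
-- a class is reflective iff its diagonal set is ρ-invariant, and then
-- the class consists of that single set, with Aut = {id , ρ}.

ρ : ℕ → ℕ → ℕ
ρ n i = n ∸ 1 ∸ i

reflectDiag : ℕ → Diag → Diag
reflectDiag n (i , j) = (ρ n j , ρ n i)

eqDiag : Diag → Diag → Bool
eqDiag (a , b) (c , d) = (a ≡ᵇ c) ∧ (b ≡ᵇ d)

symmetric : ℕ → List Diag → Bool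
symmetric n D = all (λ d → any (eqDiag (reflectDiag n d)) D) D

reflDissections : ℕ → List (List Diag)
reflDissections n = filterᵇ (symmetric n) (dissections n)

countᵇ : ℕ → (ℕ → Bool) → ℕ
countᵇ n p = length (filterᵇ p (upTo n))

-- cycle type of the reflection ρ on the n vertices:
-- j₁ = number of fixed points, j₂ = number of 2-cycles
-- (ρ is an involution, so j_k = 0 for k ≥ 3)
j₁ : ℕ → ℕ
j₁ n = countᵇ n (λ i → ρ n i ≡ᵇ i)

j₂ : ℕ → ℕ
j₂ n = countᵇ n (λ i → not (ρ n i ≡ᵇ i) ∧ (ρ n (ρ n i) ≡ᵇ i)) ℕ./ 2

-- Formal power series over ℚ: univariate in s₁, bivariate in (s₁ , s₂)
-- (coefficient of s₁^a s₂^b at a b).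

Series : Set
Series = ℕ → ℚ

Series2 : Set
Series2 = ℕ → ℕ → ℚ

Σ< : ℕ → (ℕ → ℚ) → ℚ
Σ< zero f = 0ℚ
Σ< (suc n) f = Σ< n f + f n

sumℚ : List ℚ → ℚ
sumℚ = foldr _+_ 0ℚ

infixl 7 _⊛_ _⊛₂_
infixl 6 _⊖_ _⊖₂_
infix 4 _≈_ _≈₂_

_⊛_ : Series → Series → Series
(f ⊛ g) n = Σ< (suc n) (λ k → f k * g (n ∸ k))

_⊖_ : Series → Series → Series
(f ⊖ g) n = f n - g n

scale : ℚ → Series → Series
scale c f n = c * f n

_≈_ : Series → Series → Set
f ≈ g = ∀ n → f n ≡ g n

_⊛₂_ : Series2 → Series2 → Series2
(f ⊛₂ g) a b = Σ< (suc a) (λ i → Σ< (suc b) (λ j → f i j * g (a ∸ i) (b ∸ j)))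

_⊖₂_ : Series2 → Series2 → Series2
(f ⊖₂ g) a b = f a b - g a b

_≈₂_ : Series2 → Series2 → Set
f ≈₂ g = ∀ a b → f a b ≡ g a b

poly : List ℚ → Series
poly [] n = 0ℚ
poly (c ∷ cs) zero = c
poly (c ∷ cs) (suc n) = poly cs n

-- bivariate polynomial from a list of terms (c , i , j) meaning c s₁^i s₂^j
poly2 : List (ℚ × ℕ × ℕ) → Series2
poly2 ts a b = sumℚ (map (λ { (c , i , j) → if (i ≡ᵇ a) ∧ (j ≡ᵇ b) then c else 0ℚ }) ts)

ℚ+ : ℕ → ℚ
ℚ+ k = + k ℚ./ 1

ℚ- : ℕ → ℚ
ℚ- zero = 0ℚ
ℚ- (suc k) = -[1+ k ] ℚ./ 1

-- Z(E_o^o) = Σ_D s₁^{|D|}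
Z-Eoo : Series
Z-Eoo n = ℚ+ (length (dissections n))

-- Z⁺(E_o^r) = Σ_{D reflective} s₁^{|D|}
Z⁺-Eor : Series2
Z⁺-Eor a b = if b ≡ᵇ 0 then ℚ+ (length (reflDissections a)) else 0ℚ

-- Z⁻(E_o^r) = Σ_{D reflective} s₁^{j₁(σ_D)} s₂^{j₂(σ_D)}
-- (a D with n vertices has j₁ + 2 j₂ = n, so only n ≤ a + 2b contribute)
Z⁻-Eor : Series2
Z⁻-Eor a b = Σ< (suc (a ℕ.+ 2 ℕ.* b)) (λ n →
  sumℚ (map (λ D → if (j₁ n ≡ᵇ a) ∧ (j₂ n ≡ᵇ b) then 1ℚ else 0ℚ) (reflDissections n)))

-- Z(E_o^r) = Σ_{D reflective} Z(Aut D),  Aut D = {id , σ_D},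
-- Z(Aut D) = ½ (s₁^{|D|} + s₁^{j₁(σ_D)} s₂^{j₂(σ_D)})
Z-Eor : Series2
Z-Eor a b = Σ< (suc (a ℕ.+ 2 ℕ.* b)) (λ n →
  sumℚ (map (λ D → ½ * ((if (n ≡ᵇ a) ∧ (b ≡ᵇ 0) then 1ℚ else 0ℚ)
                      + (if (j₁ n ≡ᵇ a) ∧ (j₂ n ≡ᵇ b) then 1ℚ else 0ℚ)))
            (reflDissections n)))

-- Square roots of formal power series: √P is the unique series with
-- constant term 1 whose square is P.

IsSqrt : Series → Series → Set
IsSqrt R P = (R 0 ≡ 1ℚ) × (R ⊛ R ≈ P)

IsSqrt2 : Series2 → Series2 → Set
IsSqrt2 R P = (R 0 0 ≡ 1ℚ) × (R ⊛₂ R ≈₂ P)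

s₁ : Series
s₁ = poly (0ℚ ∷ 1ℚ ∷ [])

P-oo : Series
P-oo = poly (1ℚ ∷ ℚ- 6 ∷ 1ℚ ∷ [])

s₁+1 : Series
s₁+1 = poly (1ℚ ∷ 1ℚ ∷ [])

P⁺ : Series2
P⁺ = poly2 ((1ℚ , 0 , 0) ∷ (ℚ- 6 , 2 , 0) ∷ (1ℚ , 4 , 0) ∷ [])

N⁺ : Series2
N⁺ = poly2 ((1ℚ , 0 , 0) ∷ (1ℚ , 1 , 0) ∷ (ℚ- 3 , 2 , 0) ∷ (1ℚ , 3 , 0) ∷ [])

one+s₁ : Series2
one+s₁ = poly2 ((1ℚ , 0 , 0) ∷ (1ℚ , 1 , 0) ∷ [])

4s₁ : Series2
4s₁ = poly2 ((ℚ+ 4 , 1 , 0) ∷ [])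

P⁻ : Series2
P⁻ = poly2 ((1ℚ , 0 , 0) ∷ (ℚ- 6 , 0 , 1) ∷ (1ℚ , 0 , 2) ∷ [])

N⁻ : Series2
N⁻ = poly2 ((1ℚ , 0 , 2) ∷ (ℚ- 3 , 1 , 1) ∷ (1ℚ , 0 , 1) ∷ (1ℚ , 1 , 0) ∷ [])

s₂+s₁ : Series2
s₂+s₁ = poly2 ((1ℚ , 0 , 1) ∷ (1ℚ , 1 , 0) ∷ [])

4s₂ : Series2
4s₂ = poly2 ((ℚ+ 4 , 0 , 1) ∷ [])

¼ : ℚ
¼ = + 1 ℚ./ 4

-- Let f m be the number of dissections of the polygon with m + 1 vertices (f 1 = 1 counts K₂, f 0 = 0).
-- Removing the chords at the last vertex one at a time cuts a dissection into two smaller ones and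
-- gives the little Schröder recurrence f (n+2) + f (n+1) = 2 Σₖ f k f (n+2-k); with F = Σ f m x^m this
-- says exactly that (1 + x - 4 F)² = 1 - 6 x + x², and Z(E_o^o) = s₁ F(s₁).
-- A reflective dissection is a union of orbits of the reflection. Keeping its diagonals on one side
-- of the axis and sending the diagonals (i , c - i) that cross the axis to chords (i , v) ending at a
-- single new vertex v identifies the reflective dissections of a polygon with n vertices with the
-- dissections of a polygon with ⌈n/2⌉ + 1 vertices. The reflection fixes one vertex when n is odd and
-- none when n is even, so up to their first coefficients Z⁺ = (1 + s₁) F(s₁²) / s₁ and
-- Z⁻ = (s₂ + s₁) F(s₂) / s₂, and the last two formulas follow from the first.
{-# OPTIONS --safe #-}
module Submission where

open import Defs
open import Data.Nat.Base as Nat using (ℕ)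

module Polygon where

  open import Data.Bool.Base using (Bool; true; false; T)
  open import Data.Nat.Base using (ℕ; zero; suc; _+_; _<_; _≤_; _≡ᵇ_; _∸_; z≤n; s≤s)
  open import Data.Nat.Properties
    using (<ᵇ-reflects-<; ≤ᵇ-reflects-≤; ≡ᵇ⇒≡; ≡⇒≡ᵇ; ≤-pred; ≤-trans; n≤1+n; +-suc; m+n≤o⇒m≤o∸n)
  open import Data.Product.Base using (_×_; _,_)
  open import Data.Sum.Base using (_⊎_)
  open import Function.Base using (_∘_)
  open import Relation.Nullary.Negation using (¬_)
  open import Relation.Nullary.Reflects
    using (Reflects; ofʸ; ofⁿ; invert; det; fromEquivalence; _×-reflects_; _⊎-reflects_; ¬-reflects)
  open import Relation.Binary.PropositionalEquality using (_≡_; refl; sym; cong₂; subst)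

  private variable
    A B : Set
    b b′ : Bool

  from-true : Reflects A b → b ≡ true → A
  from-true r refl = invert r

  from-false : Reflects A b → b ≡ false → ¬ A
  from-false r refl = invert r

  to-true : Reflects A b → A → b ≡ true
  to-true r a = det r (ofʸ a)

  to-false : Reflects A b → ¬ A → b ≡ false
  to-false r ¬a = det r (ofⁿ ¬a)

  Reflects-map : (A → B) → (B → A) → Reflects A b → Reflects B b
  Reflects-map f g (ofʸ a)  = ofʸ (f a)
  Reflects-map f g (ofⁿ ¬a) = ofⁿ (¬a ∘ g)

  T⇔ : Reflects A b → (T b → A) × (A → T b)
  T⇔ (ofʸ a)  = (λ _ → a) , _
  T⇔ (ofⁿ ¬a) = (λ ()) , ¬a

  reflects-≡ : Reflects A b → Reflects B b′ → (A → B) → (B → A) → b ≡ b′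
  reflects-≡ r r′ f g = det (Reflects-map f g r) r′

  ≡ᵇ-reflects-≡ : ∀ m n → Reflects (m ≡ n) (m ≡ᵇ n)
  ≡ᵇ-reflects-≡ m n = fromEquivalence (≡ᵇ⇒≡ m n) (≡⇒≡ᵇ m n)

  Cross : Diag → Diag → Set
  Cross (a , b) (c , d) = (a < c × c < b × b < d) ⊎ (c < a × a < d × d < b)

  crosses-reflects : ∀ x y → Reflects (Cross x y) (crosses x y)
  crosses-reflects (a , b) (c , d) =
    (<ᵇ-reflects-< a c ×-reflects (<ᵇ-reflects-< c b ×-reflects <ᵇ-reflects-< b d))
    ⊎-reflects (<ᵇ-reflects-< c a ×-reflects (<ᵇ-reflects-< a d ×-reflects <ᵇ-reflects-< d b))

  eqDiag-reflects : ∀ x y → Reflects (x ≡ y) (eqDiag x y)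
  eqDiag-reflects (a , b) (c , d) =
    Reflects-map (λ (p , q) → cong₂ _,_ p q) (λ { refl → refl , refl })
      (≡ᵇ-reflects-≡ a c ×-reflects ≡ᵇ-reflects-≡ b d)

  -- the chords (i , j), i + 2 ≤ j, of the convex polygon with vertices a, a+1, …, b; its side (a , b) is one of them
  Chord : ℕ → ℕ → Diag → Set
  Chord a b (i , j) = a ≤ i × 2 + i ≤ j × j ≤ b

  Diagonal : ℕ → ℕ → Diag → Set
  Diagonal a b (i , j) = Chord a b (i , j) × ¬ (i ≡ a × j ≡ b)

  2≤∸⇒2+≤ : ∀ {i j} → 2 ≤ j ∸ i → 2 + i ≤ j
  2≤∸⇒2+≤ {zero}          2≤j   = 2≤j
  2≤∸⇒2+≤ {suc i} {suc j} 2≤j-i = subst (_≤ suc j) (sym (+-suc 2 i)) (s≤s (2≤∸⇒2+≤ 2≤j-i))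

  2+≤⇒2≤∸ : ∀ {i j} → 2 + i ≤ j → 2 ≤ j ∸ i
  2+≤⇒2≤∸ = m+n≤o⇒m≤o∸n 2

  isDiag-reflects : ∀ k d → Reflects (Diagonal 0 k d) (isDiag (suc k) d)
  isDiag-reflects k (i , j) =
    Reflects-map (λ (_ , j≤k , 2≤j-i , ¬root) → (z≤n , 2≤∸⇒2+≤ 2≤j-i , ≤-pred j≤k) , ¬root)
                 (λ ((_ , 2+i≤j , j≤k) , ¬root) → ≤-trans (n≤1+n _) 2+i≤j , s≤s j≤k , 2+≤⇒2≤∸ 2+i≤j , ¬root)
      (<ᵇ-reflects-< i j ×-reflects (<ᵇ-reflects-< j (suc k) ×-reflects
        (≤ᵇ-reflects-≤ 2 (j ∸ i) ×-reflects ¬-reflects (≡ᵇ-reflects-≡ i 0 ×-reflects ≡ᵇ-reflects-≡ j k))))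

module Counting where

  open import Data.Bool.Base using (Bool; true; false; _∧_; if_then_else_)
  open import Data.Bool.ListAction using (all)
  open import Data.List.Base using (List; []; _∷_; _++_; map; length; filterᵇ)
  open import Data.List.Relation.Binary.Permutation.Propositional using (_↭_; prep; swap)
    renaming (refl to ↭-refl; trans to ↭-trans)
  open import Data.List.Relation.Binary.Subset.Propositional using (_⊆_)
  open import Data.List.Relation.Binary.Subset.Propositional.Properties using (∷⁺ʳ; xs⊆x∷xs)
  open import Data.Nat.Base using (ℕ; suc; _+_; _*_)
  open import Data.Nat.Properties using (+-assoc; +-identityʳ; *-distribʳ-+)
  open import Data.Nat.Solver using (module +-*-Solver)
  open import Relation.Binary.PropositionalEquality
  open +-*-Solver using (solve; _:=_; _:+_)

  private variable
    A B : Set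

  count : (A → Bool) → List A → ℕ
  count p []       = 0
  count p (x ∷ xs) = (if p x then 1 else 0) + count p xs

  length-filterᵇ : (p : A → Bool) (xs : List A) → length (filterᵇ p xs) ≡ count p xs
  length-filterᵇ p [] = refl
  length-filterᵇ p (x ∷ xs) with p x
  ... | true  = cong suc (length-filterᵇ p xs)
  ... | false = length-filterᵇ p xs

  count-filterᵇ : (p q : A → Bool) (xs : List A) → count p (filterᵇ q xs) ≡ count (λ x → q x ∧ p x) xs
  count-filterᵇ p q [] = refl
  count-filterᵇ p q (x ∷ xs) with q x
  ... | true  = cong ((if p x then 1 else 0) +_) (count-filterᵇ p q xs)
  ... | false = count-filterᵇ p q xs

  count-++ : (p : A → Bool) (xs ys : List A) → count p (xs ++ ys) ≡ count p xs + count p ys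
  count-++ p []       ys = refl
  count-++ p (x ∷ xs) ys =
    trans (cong (_ +_) (count-++ p xs ys)) (sym (+-assoc (if p x then 1 else 0) (count p xs) (count p ys)))

  count-map : (p : B → Bool) (f : A → B) (xs : List A) → count p (map f xs) ≡ count (λ x → p (f x)) xs
  count-map p f []       = refl
  count-map p f (x ∷ xs) = cong (_ +_) (count-map p f xs)

  #subsets : (List A → Bool) → List A → ℕ
  #subsets q L = count q (subsets L)

  #subsets-∷ : ∀ (q : List A → Bool) x L → #subsets q (x ∷ L) ≡ #subsets (λ S → q (x ∷ S)) L + #subsets q L
  #subsets-∷ q x L =
    trans (count-++ q (map (x ∷_) (subsets L)) (subsets L)) (cong (_+ #subsets q L) (count-map q (x ∷_) (subsets L)))

  #subsets-false : (L : List A) → #subsets (λ _ → false) L ≡ 0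
  #subsets-false []      = refl
  #subsets-false (x ∷ L) = trans (#subsets-∷ _ x L) (cong₂ _+_ (#subsets-false L) (#subsets-false L))

  #subsets-if : ∀ b (q : List A → Bool) L → #subsets (λ S → b ∧ q S) L ≡ (if b then #subsets q L else 0)
  #subsets-if true  q L = refl
  #subsets-if false q L = #subsets-false L

  #subsets-cong : ∀ L (q q′ : List A → Bool) → (∀ S → S ⊆ L → q S ≡ q′ S) → #subsets q L ≡ #subsets q′ L
  #subsets-cong []      q q′ q≗q′ = cong (λ b → (if b then 1 else 0) + 0) (q≗q′ [] (λ ()))
  #subsets-cong (x ∷ L) q q′ q≗q′ = begin
    #subsets q (x ∷ L)                                       ≡⟨ #subsets-∷ q x L ⟩
    #subsets (λ S → q (x ∷ S)) L + #subsets q L              ≡⟨ cong₂ _+_ with-x without-x ⟩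
    #subsets (λ S → q′ (x ∷ S)) L + #subsets q′ L            ≡⟨ #subsets-∷ q′ x L ⟨
    #subsets q′ (x ∷ L)                                      ∎
    where
    open ≡-Reasoning
    with-x : #subsets (λ S → q (x ∷ S)) L ≡ #subsets (λ S → q′ (x ∷ S)) L
    with-x = #subsets-cong L _ _ (λ S S⊆L → q≗q′ (x ∷ S) (∷⁺ʳ x S⊆L))
    without-x : #subsets q L ≡ #subsets q′ L
    without-x = #subsets-cong L q q′ (λ S S⊆L → q≗q′ S (λ m → xs⊆x∷xs L x (S⊆L m)))

  #subsets-all : ∀ (p : A → Bool) L q → #subsets (λ S → all p S ∧ q S) L ≡ #subsets q (filterᵇ p L)
  #subsets-all p []      q = refl
  #subsets-all p (x ∷ L) q with p x in px
  ... | true = trans (#subsets-∷ _ x L) (trans (cong₂ _+_ with-x (#subsets-all p L q)) (sym (#subsets-∷ q x (filterᵇ p L))))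
    where
    with-x : #subsets (λ S → all p (x ∷ S) ∧ q (x ∷ S)) L ≡ #subsets (λ S → q (x ∷ S)) (filterᵇ p L)
    with-x = trans (#subsets-cong L _ (λ S → all p S ∧ q (x ∷ S)) (λ S _ → cong (λ b → (b ∧ all p S) ∧ q (x ∷ S)) px))
                   (#subsets-all p L (λ S → q (x ∷ S)))
  ... | false = trans (#subsets-∷ _ x L) (cong₂ _+_ with-x (#subsets-all p L q))
    where
    with-x : #subsets (λ S → all p (x ∷ S) ∧ q (x ∷ S)) L ≡ 0
    with-x = trans (#subsets-cong L _ (λ _ → false) (λ S _ → cong (λ b → (b ∧ all p S) ∧ q (x ∷ S)) px)) (#subsets-false L)

  #subsets-↭ : ∀ (q : List A → Bool) → (∀ {S S′} → S ↭ S′ → q S ≡ q S′) →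
               ∀ {L L′} → L ↭ L′ → #subsets q L ≡ #subsets q L′
  #subsets-↭ q q-↭ ↭-refl = refl
  #subsets-↭ q q-↭ (prep {L} {L′} x L↭L′) =
    trans (#subsets-∷ q x L)
      (trans (cong₂ _+_ (#subsets-↭ _ (λ s → q-↭ (prep x s)) L↭L′) (#subsets-↭ q q-↭ L↭L′)) (sym (#subsets-∷ q x L′)))
  #subsets-↭ q q-↭ (swap {L} {L′} x y L↭L′) = begin
    #subsets q (x ∷ y ∷ L)
      ≡⟨ trans (#subsets-∷ q x (y ∷ L)) (cong₂ _+_ (#subsets-∷ _ y L) (#subsets-∷ q y L)) ⟩
    (#subsets (λ S → q (x ∷ y ∷ S)) L + #subsets (λ S → q (x ∷ S)) L) + (#subsets (λ S → q (y ∷ S)) L + #subsets q L)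
      ≡⟨ cong₂ _+_ (cong₂ _+_ with-xy with-x) (cong₂ _+_ with-y (#subsets-↭ q q-↭ L↭L′)) ⟩
    (#subsets (λ S → q (y ∷ x ∷ S)) L′ + #subsets (λ S → q (x ∷ S)) L′) + (#subsets (λ S → q (y ∷ S)) L′ + #subsets q L′)
      ≡⟨ middle-swap (#subsets (λ S → q (y ∷ x ∷ S)) L′) (#subsets (λ S → q (x ∷ S)) L′)
                     (#subsets (λ S → q (y ∷ S)) L′) (#subsets q L′) ⟩
    (#subsets (λ S → q (y ∷ x ∷ S)) L′ + #subsets (λ S → q (y ∷ S)) L′) + (#subsets (λ S → q (x ∷ S)) L′ + #subsets q L′)
      ≡⟨ trans (#subsets-∷ q y (x ∷ L′)) (cong₂ _+_ (#subsets-∷ _ x L′) (#subsets-∷ q x L′)) ⟨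
    #subsets q (y ∷ x ∷ L′) ∎
    where
    open ≡-Reasoning
    with-xy : #subsets (λ S → q (x ∷ y ∷ S)) L ≡ #subsets (λ S → q (y ∷ x ∷ S)) L′
    with-xy = trans (#subsets-↭ _ (λ s → q-↭ (prep x (prep y s))) L↭L′) (#subsets-cong L′ _ _ (λ S _ → q-↭ (swap x y ↭-refl)))
    with-x : #subsets (λ S → q (x ∷ S)) L ≡ #subsets (λ S → q (x ∷ S)) L′
    with-x = #subsets-↭ _ (λ s → q-↭ (prep x s)) L↭L′
    with-y : #subsets (λ S → q (y ∷ S)) L ≡ #subsets (λ S → q (y ∷ S)) L′
    with-y = #subsets-↭ _ (λ s → q-↭ (prep y s)) L↭L′
    middle-swap : ∀ a b c d → (a + b) + (c + d) ≡ (a + c) + (b + d)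
    middle-swap = solve 4 (λ a b c d → (a :+ b) :+ (c :+ d) := (a :+ c) :+ (b :+ d)) refl
  #subsets-↭ q q-↭ (↭-trans L↭L″ L″↭L′) = trans (#subsets-↭ q q-↭ L↭L″) (#subsets-↭ q q-↭ L″↭L′)

  #subsets-map : ∀ (f : A → B) q L → #subsets q (map f L) ≡ #subsets (λ S → q (map f S)) L
  #subsets-map f q []      = refl
  #subsets-map f q (x ∷ L) =
    trans (#subsets-∷ q (f x) (map f L))
      (trans (cong₂ _+_ (#subsets-map f (λ S → q (f x ∷ S)) L) (#subsets-map f q L)) (sym (#subsets-∷ _ x L)))

  #subsets-++ : ∀ (L₁ L₂ : List A) q q₁ q₂ → (∀ S₁ S₂ → S₁ ⊆ L₁ → S₂ ⊆ L₂ → q (S₁ ++ S₂) ≡ q₁ S₁ ∧ q₂ S₂) →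
                #subsets q (L₁ ++ L₂) ≡ #subsets q₁ L₁ * #subsets q₂ L₂
  #subsets-++ [] L₂ q q₁ q₂ split with q₁ [] in q₁[]
  ... | true  = trans (#subsets-cong L₂ q q₂ (λ S₂ S₂⊆L₂ → trans (split [] S₂ (λ ()) S₂⊆L₂) (cong (_∧ q₂ S₂) q₁[])))
                      (sym (+-identityʳ _))
  ... | false = trans (#subsets-cong L₂ q (λ _ → false)
                        (λ S₂ S₂⊆L₂ → trans (split [] S₂ (λ ()) S₂⊆L₂) (cong (_∧ q₂ S₂) q₁[])))
                      (#subsets-false L₂)
  #subsets-++ (x ∷ L₁) L₂ q q₁ q₂ split = begin
    #subsets q (x ∷ L₁ ++ L₂)
      ≡⟨ #subsets-∷ q x (L₁ ++ L₂) ⟩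
    #subsets (λ S → q (x ∷ S)) (L₁ ++ L₂) + #subsets q (L₁ ++ L₂)
      ≡⟨ cong₂ _+_ (#subsets-++ L₁ L₂ _ _ q₂ (λ S₁ S₂ S₁⊆L₁ → split (x ∷ S₁) S₂ (∷⁺ʳ x S₁⊆L₁)))
                   (#subsets-++ L₁ L₂ q q₁ q₂ (λ S₁ S₂ S₁⊆L₁ → split S₁ S₂ (λ m → xs⊆x∷xs L₁ x (S₁⊆L₁ m)))) ⟩
    #subsets (λ S → q₁ (x ∷ S)) L₁ * #subsets q₂ L₂ + #subsets q₁ L₁ * #subsets q₂ L₂
      ≡⟨ *-distribʳ-+ (#subsets q₂ L₂) (#subsets (λ S → q₁ (x ∷ S)) L₁) (#subsets q₁ L₁) ⟨
    (#subsets (λ S → q₁ (x ∷ S)) L₁ + #subsets q₁ L₁) * #subsets q₂ L₂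
      ≡⟨ cong (_* #subsets q₂ L₂) (#subsets-∷ q₁ x L₁) ⟨
    #subsets q₁ (x ∷ L₁) * #subsets q₂ L₂ ∎
    where open ≡-Reasoning

module ListTests where

  open import Data.Bool.Base using (Bool; true; false; T; _∧_)
  open import Data.Bool.ListAction using (all; any)
  open import Data.Bool.Properties using (∧-assoc)
  open import Data.List.Base using ([]; _∷_; _++_; map; filterᵇ)
  open import Data.List.Membership.Propositional using (_∈_)
  open import Data.List.Relation.Binary.Permutation.Propositional using (_↭_; ↭-sym)
  open import Data.List.Relation.Binary.Permutation.Propositional.Properties using (All-resp-↭; Any-resp-↭)
  open import Data.List.Relation.Unary.All using (All)
  open import Data.List.Relation.Unary.All.Properties using (all⁺; all⁻)
  open import Data.List.Relation.Unary.Any using (Any; here; there)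
  open import Data.List.Relation.Unary.Any.Properties using (any⁺; any⁻)
  open import Function.Base using (_∘_)
  open import Relation.Nullary.Reflects using (Reflects; fromEquivalence)
  open import Relation.Binary.PropositionalEquality using (_≡_; refl; sym; trans; cong; cong₂)
  open Polygon using (reflects-≡)

  private variable
    A B : Set

  all-reflects : ∀ (p : A → Bool) xs → Reflects (All (T ∘ p) xs) (all p xs)
  all-reflects p xs = fromEquivalence (all⁺ p xs) (all⁻ p)

  any-reflects : ∀ (p : A → Bool) xs → Reflects (Any (T ∘ p) xs) (any p xs)
  any-reflects p xs = fromEquivalence (any⁻ p xs) (any⁺ p)

  all-↭ : ∀ (p : A → Bool) {xs ys} → xs ↭ ys → all p xs ≡ all p ys
  all-↭ p {xs} {ys} xs↭ys =
    reflects-≡ (all-reflects p xs) (all-reflects p ys) (All-resp-↭ xs↭ys) (All-resp-↭ (↭-sym xs↭ys))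

  any-↭ : ∀ (p : A → Bool) {xs ys} → xs ↭ ys → any p xs ≡ any p ys
  any-↭ p {xs} {ys} xs↭ys =
    reflects-≡ (any-reflects p xs) (any-reflects p ys) (Any-resp-↭ xs↭ys) (Any-resp-↭ (↭-sym xs↭ys))

  all-cong : ∀ (p q : A → Bool) xs → (∀ x → x ∈ xs → p x ≡ q x) → all p xs ≡ all q xs
  all-cong p q []       p≗q = refl
  all-cong p q (x ∷ xs) p≗q = cong₂ _∧_ (p≗q x (here refl)) (all-cong p q xs (λ y y∈xs → p≗q y (there y∈xs)))

  all-true : ∀ (p : A → Bool) xs → (∀ x → x ∈ xs → p x ≡ true) → all p xs ≡ true
  all-true p []       px = refl
  all-true p (x ∷ xs) px = cong₂ _∧_ (px x (here refl)) (all-true p xs (λ y y∈xs → px y (there y∈xs)))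

  all-map : ∀ (p : B → Bool) (f : A → B) xs → all p (map f xs) ≡ all (λ x → p (f x)) xs
  all-map p f []       = refl
  all-map p f (x ∷ xs) = cong (p (f x) ∧_) (all-map p f xs)

  all-++ : ∀ (p : A → Bool) xs ys → all p (xs ++ ys) ≡ all p xs ∧ all p ys
  all-++ p []       ys = refl
  all-++ p (x ∷ xs) ys = trans (cong (p x ∧_) (all-++ p xs ys)) (sym (∧-assoc (p x) _ _))

  all-∧ : ∀ (p q : A → Bool) xs → all (λ x → p x ∧ q x) xs ≡ all p xs ∧ all q xs
  all-∧ p q []       = refl
  all-∧ p q (x ∷ xs) = trans (cong ((p x ∧ q x) ∧_) (all-∧ p q xs)) (middle-swap (p x) (q x) (all p xs) (all q xs))
    where
    middle-swap : ∀ a b c d → (a ∧ b) ∧ (c ∧ d) ≡ (a ∧ c) ∧ (b ∧ d)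
    middle-swap true  true  c     d = refl
    middle-swap true  false true  d = refl
    middle-swap true  false false d = refl
    middle-swap false b     c     d = refl

  filterᵇ-accept : ∀ (p : A → Bool) {x} xs → p x ≡ true → filterᵇ p (x ∷ xs) ≡ x ∷ filterᵇ p xs
  filterᵇ-accept p {x} xs px with p x
  ... | true = refl

  filterᵇ-reject : ∀ (p : A → Bool) {x} xs → p x ≡ false → filterᵇ p (x ∷ xs) ≡ filterᵇ p xs
  filterᵇ-reject p {x} xs px with p x
  ... | false = refl

  filterᵇ-cong : ∀ (p q : A → Bool) xs → (∀ x → x ∈ xs → p x ≡ q x) → filterᵇ p xs ≡ filterᵇ q xs
  filterᵇ-cong p q []       p≗q = refl
  filterᵇ-cong p q (x ∷ xs) p≗q with p x | q x | p≗q x (here refl)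
  ... | true  | true  | _ = cong (x ∷_) (filterᵇ-cong p q xs (λ y y∈xs → p≗q y (there y∈xs)))
  ... | false | false | _ = filterᵇ-cong p q xs (λ y y∈xs → p≗q y (there y∈xs))

  filterᵇ-map : ∀ (p : B → Bool) (f : A → B) xs → filterᵇ p (map f xs) ≡ map f (filterᵇ (λ x → p (f x)) xs)
  filterᵇ-map p f [] = refl
  filterᵇ-map p f (x ∷ xs) with p (f x)
  ... | true  = cong (f x ∷_) (filterᵇ-map p f xs)
  ... | false = filterᵇ-map p f xs

  filterᵇ-comm : ∀ (p q : A → Bool) xs → filterᵇ p (filterᵇ q xs) ≡ filterᵇ q (filterᵇ p xs)
  filterᵇ-comm p q [] = refl
  filterᵇ-comm p q (x ∷ xs) with p x in px | q x in qx
  ... | true  | true  = trans (filterᵇ-accept p _ px)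
                          (trans (cong (x ∷_) (filterᵇ-comm p q xs)) (sym (filterᵇ-accept q _ qx)))
  ... | true  | false = trans (filterᵇ-comm p q xs) (sym (filterᵇ-reject q _ qx))
  ... | false | true  = trans (filterᵇ-reject p _ px) (filterᵇ-comm p q xs)
  ... | false | false = filterᵇ-comm p q xs

  filterᵇ-all : ∀ (p : A → Bool) xs → (∀ x → x ∈ xs → p x ≡ true) → filterᵇ p xs ≡ xs
  filterᵇ-all p []       px = refl
  filterᵇ-all p (x ∷ xs) px =
    trans (filterᵇ-accept p xs (px x (here refl))) (cong (x ∷_) (filterᵇ-all p xs (λ y y∈xs → px y (there y∈xs))))

module NonCrossing where

  open import Data.Bool.Base using (Bool; true; false; not; _∧_)
  open import Data.Bool.ListAction using (all)
  open import Data.List.Base using (List; []; _∷_; _++_; map; filterᵇ)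
  open import Data.List.Membership.Propositional using (_∈_; _∉_)
  open import Data.Empty using (⊥-elim)
  open import Data.List.Membership.Propositional.Properties.WithK using (unique∧set⇒bag)
  open import Data.List.Relation.Binary.BagAndSetEquality using (∼bag⇒↭)
  open import Data.List.Relation.Binary.Permutation.Propositional using (_↭_; prep; swap)
    renaming (refl to ↭-refl; trans to ↭-trans)
  open import Data.List.Relation.Binary.Subset.Propositional using (_⊆_)
  open import Data.List.Relation.Unary.Any using (here; there)
  open import Data.List.Relation.Unary.Unique.Propositional using (Unique)
  open import Data.Nat.Base using (ℕ; _+_; _*_)
  open import Data.Sum.Base using (inj₁; inj₂)
  open import Function.Bundles using (mk⇔)
  open import Relation.Nullary.Negation using (¬_)
  open import Relation.Nullary.Reflects using (Reflects; ¬-reflects)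
  open import Relation.Binary.PropositionalEquality using (_≡_; refl; trans; cong; cong₂)
  open Polygon
  open Counting
  open ListTests

  avoids : Diag → Diag → Bool
  avoids x y = not (crosses x y)

  Cross-sym : ∀ {x y} → Cross x y → Cross y x
  Cross-sym (inj₁ c) = inj₂ c
  Cross-sym (inj₂ c) = inj₁ c

  crosses-comm : ∀ x y → crosses x y ≡ crosses y x
  crosses-comm x y = reflects-≡ (crosses-reflects x y) (crosses-reflects y x) Cross-sym Cross-sym

  avoids-reflects : ∀ x y → Reflects (¬ Cross x y) (avoids x y)
  avoids-reflects x y = ¬-reflects (crosses-reflects x y)

  nonCrossing-↭ : ∀ {S S′} → S ↭ S′ → nonCrossing S ≡ nonCrossing S′
  nonCrossing-↭ ↭-refl = refl
  nonCrossing-↭ (prep x S↭S′) = cong₂ _∧_ (all-↭ (avoids x) S↭S′) (nonCrossing-↭ S↭S′)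
  nonCrossing-↭ (swap {S} {S′} x y S↭S′) =
    trans (middle-swap (avoids x y) (all (avoids x) S) (all (avoids y) S) (nonCrossing S))
      (cong₂ _∧_ (cong₂ _∧_ (cong not (crosses-comm x y)) (all-↭ (avoids y) S↭S′))
                 (cong₂ _∧_ (all-↭ (avoids x) S↭S′) (nonCrossing-↭ S↭S′)))
    where
    middle-swap : ∀ u a b n → (u ∧ a) ∧ (b ∧ n) ≡ (u ∧ b) ∧ (a ∧ n)
    middle-swap true  true  b     n = refl
    middle-swap true  false true  n = refl
    middle-swap true  false false n = refl
    middle-swap false a     b     n = refl
  nonCrossing-↭ (↭-trans S↭S″ S″↭S′) = trans (nonCrossing-↭ S↭S″) (nonCrossing-↭ S″↭S′)

  nonCrossing-map : ∀ f → (∀ a b → crosses (f a) (f b) ≡ crosses a b) → ∀ S → nonCrossing (map f S) ≡ nonCrossing S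
  nonCrossing-map f f-crosses []      = refl
  nonCrossing-map f f-crosses (x ∷ S) =
    cong₂ _∧_ (trans (all-map (avoids (f x)) f S) (all-cong _ _ S (λ e _ → cong not (f-crosses x e))))
              (nonCrossing-map f f-crosses S)

  nonCrossing-++ : ∀ S₁ S₂ → (∀ a b → a ∈ S₁ → b ∈ S₂ → crosses a b ≡ false) →
                   nonCrossing (S₁ ++ S₂) ≡ nonCrossing S₁ ∧ nonCrossing S₂
  nonCrossing-++ []       S₂ apart = refl
  nonCrossing-++ (x ∷ S₁) S₂ apart =
    trans (cong₂ _∧_ (all-++ (avoids x) S₁ S₂) (nonCrossing-++ S₁ S₂ (λ a b a∈S₁ → apart a b (there a∈S₁))))
      (trans (cong (λ t → (all (avoids x) S₁ ∧ t) ∧ (nonCrossing S₁ ∧ nonCrossing S₂))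
                   (all-true (avoids x) S₂ (λ b b∈S₂ → cong not (apart x b (here refl) b∈S₂))))
             (regroup (all (avoids x) S₁) (nonCrossing S₁) (nonCrossing S₂)))
    where
    regroup : ∀ a n m → (a ∧ true) ∧ (n ∧ m) ≡ (a ∧ n) ∧ m
    regroup true  n m = refl
    regroup false n m = refl

  #nc : List Diag → ℕ
  #nc = #subsets nonCrossing

  #nc-∷ : ∀ x L → #nc (x ∷ L) ≡ #nc (filterᵇ (avoids x) L) + #nc L
  #nc-∷ x L = trans (#subsets-∷ nonCrossing x L) (cong (_+ #nc L) (#subsets-all (avoids x) L nonCrossing))

  #nc-↭ : ∀ {L L′} → L ↭ L′ → #nc L ≡ #nc L′
  #nc-↭ = #subsets-↭ nonCrossing nonCrossing-↭

  #nc-ext : ∀ {L L′} → Unique L → Unique L′ → L ⊆ L′ → L′ ⊆ L → #nc L ≡ #nc L′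
  #nc-ext L! L′! L⊆L′ L′⊆L = #nc-↭ (∼bag⇒↭ (unique∧set⇒bag L! L′! (mk⇔ L⊆L′ L′⊆L)))

  #nc-empty : ∀ {L} → (∀ {z} → z ∉ L) → #nc L ≡ 1
  #nc-empty {[]}    _    = refl
  #nc-empty {x ∷ L} none = ⊥-elim (none (here refl))

  #nc-map : ∀ f → (∀ a b → crosses (f a) (f b) ≡ crosses a b) → ∀ L → #nc (map f L) ≡ #nc L
  #nc-map f f-crosses L =
    trans (#subsets-map f nonCrossing L) (#subsets-cong L _ _ (λ S _ → nonCrossing-map f f-crosses S))

  #nc-++ : ∀ L₁ L₂ → (∀ a b → a ∈ L₁ → b ∈ L₂ → crosses a b ≡ false) → #nc (L₁ ++ L₂) ≡ #nc L₁ * #nc L₂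
  #nc-++ L₁ L₂ apart = #subsets-++ L₁ L₂ nonCrossing nonCrossing nonCrossing
    (λ S₁ S₂ S₁⊆L₁ S₂⊆L₂ → nonCrossing-++ S₁ S₂ (λ a b a∈S₁ b∈S₂ → apart a b (S₁⊆L₁ a∈S₁) (S₂⊆L₂ b∈S₂)))

module Chords where

  open import Data.Bool.Base using (true)
  open import Data.Bool.Properties using (T?)
  open import Data.List.Base using (List; []; _∷_; map; concatMap; upTo; cartesianProductWith; filter; filterᵇ; _++_)
  open import Data.List.Membership.Propositional using (_∈_; _∉_)
  open import Data.List.Membership.Propositional.Properties
    using (∈-filter⁺; ∈-filter⁻; ∈-map⁺; ∈-map⁻; ∈-upTo⁺; ∈-cartesianProductWith⁺)
  open import Data.List.Properties using (filter-≐)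
  open import Data.List.Relation.Binary.Subset.Propositional using (_⊆_)
  open import Data.List.Relation.Unary.Any using (here; there)
  open import Data.List.Relation.Unary.Unique.Propositional using (Unique)
  import Data.List.Relation.Unary.Unique.Propositional.Properties as Unique
  open import Data.List.Relation.Unary.AllPairs using (AllPairs)
  open import Data.List.Relation.Unary.All as All using ()
  open import Data.Nat.Base using (ℕ; zero; suc; _+_; _*_; _∸_; _<_; _≤_; z≤n; s≤s)
  open import Data.Nat.Properties
  open import Data.Product.Base using (_,_; proj₁; proj₂)
  open import Data.Sum.Base using (inj₁; inj₂)
  open import Function.Base using (_∘_)
  open import Level using (0ℓ)
  open import Relation.Nullary.Decidable using (yes; no; _×-dec_; ¬?)
  open import Relation.Nullary.Negation using (¬_)
  open import Relation.Unary using (Pred; Decidable)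
  open import Relation.Binary.PropositionalEquality
  open Polygon
  open NonCrossing
  open ListTests using (filterᵇ-all)

  private
    concatMap≡cartesianProductWith : ∀ (xs ys : List ℕ) →
      concatMap (λ j → map (λ i → (i , j)) ys) xs ≡ cartesianProductWith (λ j i → (i , j)) xs ys
    concatMap≡cartesianProductWith []       ys = refl
    concatMap≡cartesianProductWith (x ∷ xs) ys = cong (map (λ i → (i , x)) ys ++_) (concatMap≡cartesianProductWith xs ys)

  -- opaque so that M can be inferred from a membership proof in pairs M
  opaque
    pairs : ℕ → List Diag
    pairs M = concatMap (λ j → map (λ i → (i , j)) (upTo M)) (upTo M)

    pairs-unique : ∀ M → Unique (pairs M)
    pairs-unique M = subst Unique (sym (concatMap≡cartesianProductWith (upTo M) (upTo M)))
      (Unique.cartesianProductWith⁺ (λ j i → (i , j)) (λ { refl → refl , refl }) (Unique.upTo⁺ M) (Unique.upTo⁺ M))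

    ∈pairs⁺ : ∀ {M i j} → i < M → j < M → (i , j) ∈ pairs M
    ∈pairs⁺ {M} i<M j<M = subst ((_ , _) ∈_) (sym (concatMap≡cartesianProductWith (upTo M) (upTo M)))
      (∈-cartesianProductWith⁺ (λ j i → (i , j)) (∈-upTo⁺ j<M) (∈-upTo⁺ i<M))

  unique-∷ : ∀ {x : Diag} {xs} → x ∉ xs → Unique xs → Unique (x ∷ xs)
  unique-∷ {xs = xs} x∉xs xs! = AllPairs._∷_ (All.tabulate λ y∈xs x≡y → x∉xs (subst (_∈ xs) (sym x≡y) y∈xs)) xs!

  pairsWith : {P : Pred Diag 0ℓ} → Decidable P → ℕ → List Diag
  pairsWith P? M = filter P? (pairs M)

  pairsWith-unique : ∀ {P : Pred Diag 0ℓ} (P? : Decidable P) M → Unique (pairsWith P? M)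
  pairsWith-unique P? M = Unique.filter⁺ P? (pairs-unique M)

  module _ {P : Pred Diag 0ℓ} (P? : Decidable P) {M : ℕ} where

    ∈pairsWith⁺ : ∀ {i j} → i < j → j < M → P (i , j) → (i , j) ∈ pairsWith P? M
    ∈pairsWith⁺ i<j j<M = ∈-filter⁺ P? (∈pairs⁺ (<-trans i<j j<M) j<M)

    ∈pairsWith⁻ : ∀ {z} → z ∈ pairsWith P? M → P z
    ∈pairsWith⁻ z∈ = proj₂ (∈-filter⁻ P? {xs = pairs M} z∈)

    ∈pairsWith-transfer : ∀ {Q : Pred Diag 0ℓ} (Q? : Decidable Q) {z} → z ∈ pairsWith P? M → (P z → Q z) → z ∈ pairsWith Q? M
    ∈pairsWith-transfer Q? z∈ P⇒Q = let z∈pairs , Pz = ∈-filter⁻ P? {xs = pairs M} z∈ in ∈-filter⁺ Q? z∈pairs (P⇒Q Pz)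

  #nc-pairsWith-≐ : ∀ {P Q : Pred Diag 0ℓ} (P? : Decidable P) (Q? : Decidable Q) M →
                    (∀ {z} → P z → Q z) → (∀ {z} → Q z → P z) → #nc (pairsWith P? M) ≡ #nc (pairsWith Q? M)
  #nc-pairsWith-≐ P? Q? M P⇒Q Q⇒P = #nc-ext (pairsWith-unique P? M) (pairsWith-unique Q? M)
    (λ z∈ → ∈pairsWith-transfer P? Q? z∈ P⇒Q) (λ z∈ → ∈pairsWith-transfer Q? P? z∈ Q⇒P)

  Chord? : ∀ a b → Decidable (Chord a b)
  Chord? a b (i , j) = (a ≤? i) ×-dec ((2 + i ≤? j) ×-dec (j ≤? b))

  Diagonal? : ∀ a b → Decidable (Diagonal a b)
  Diagonal? a b (i , j) = Chord? a b (i , j) ×-dec ¬? ((i ≟ a) ×-dec (j ≟ b))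

  Chord⇒< : ∀ {a b i j} → Chord a b (i , j) → i < j
  Chord⇒< (_ , 2+i≤j , _) = ≤-trans (n≤1+n _) 2+i≤j

  Chord⇒≤ : ∀ {a b i j} → Chord a b (i , j) → i ≤ b
  Chord⇒≤ c@(_ , _ , j≤b) = ≤-trans (<⇒≤ (Chord⇒< c)) j≤b

  opaque
    unfolding pairs
    diagonals≡pairsWith : ∀ k → diagonals (suc k) ≡ pairsWith (Diagonal? 0 k) (suc k)
    diagonals≡pairsWith k = filter-≐ (T? ∘ isDiag (suc k)) (Diagonal? 0 k)
      ((λ {d} → proj₁ (T⇔ (isDiag-reflects k d))) , (λ {d} → proj₂ (T⇔ (isDiag-reflects k d)))) (pairs (suc k))

  diagonals-unique : ∀ k → Unique (diagonals (suc k))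
  diagonals-unique k = subst Unique (sym (diagonals≡pairsWith k)) (pairsWith-unique (Diagonal? 0 k) (suc k))

  ∈diagonals⁺ : ∀ {k d} → Diagonal 0 k d → d ∈ diagonals (suc k)
  ∈diagonals⁺ {k} {_ , _} D@(c , _) = subst (_ ∈_) (sym (diagonals≡pairsWith k))
    (∈pairsWith⁺ (Diagonal? 0 k) (Chord⇒< c) (s≤s (proj₂ (proj₂ c))) D)

  ∈diagonals⁻ : ∀ {k d} → d ∈ diagonals (suc k) → Diagonal 0 k d
  ∈diagonals⁻ {k} d∈ = ∈pairsWith⁻ (Diagonal? 0 k) (subst (_ ∈_) (diagonals≡pairsWith k) d∈)

  -- the number of dissections of the polygon with vertices 0, 1, …, k
  #dissections : ℕ → ℕ
  #dissections k = #nc (diagonals (suc k))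

  side-¬Cross : ∀ {a b z} → Chord a b z → ¬ Cross (a , b) z
  side-¬Cross (_   , _ , y≤b) (inj₁ (_ , _ , b<y)) = <⇒≱ b<y y≤b
  side-¬Cross (a≤x , _ , _)   (inj₂ (x<a , _ , _)) = <⇒≱ x<a a≤x

  side-avoids : ∀ {a b z} → Chord a b z → avoids (a , b) z ≡ true
  side-avoids c = to-true (avoids-reflects _ _) (side-¬Cross c)

  shift : ℕ → Diag → Diag
  shift a (i , j) = (a + i , a + j)

  crosses-shift : ∀ a x y → crosses (shift a x) (shift a y) ≡ crosses x y
  crosses-shift zero    x y = refl
  crosses-shift (suc a) x y = crosses-shift a x y

  shift-injective : ∀ a {x y} → shift a x ≡ shift a y → x ≡ y
  shift-injective a {i , j} {i′ , j′} eq =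
    cong₂ _,_ (+-cancelˡ-≡ a i i′ (cong proj₁ eq)) (+-cancelˡ-≡ a j j′ (cong proj₂ eq))

  Diagonal-shift : ∀ {a k u v} → Diagonal 0 k (u , v) → Diagonal a (a + k) (shift a (u , v))
  Diagonal-shift {a} {k} {u} {v} ((_ , 2+u≤v , v≤k) , ¬side) =
    (m≤m+n a u , subst (_≤ a + v) (trans (+-suc a (suc u)) (cong suc (+-suc a u))) (+-monoʳ-≤ a 2+u≤v) , +-monoʳ-≤ a v≤k) ,
    λ (a+u≡a , a+v≡a+k) → ¬side (+-cancelˡ-≡ a u 0 (trans a+u≡a (sym (+-identityʳ a))) , +-cancelˡ-≡ a v k a+v≡a+k)

  Diagonal-unshift : ∀ {a k x y} → Diagonal a (a + k) (x , y) → Diagonal 0 k (x ∸ a , y ∸ a)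
  Diagonal-unshift {a} {k} {x} {y} ((a≤x , 2+x≤y , y≤a+k) , ¬side) =
    (z≤n , subst (_≤ y ∸ a) (+-∸-assoc 2 a≤x) (∸-monoˡ-≤ a 2+x≤y) , subst (y ∸ a ≤_) (m+n∸m≡n a k) (∸-monoˡ-≤ a y≤a+k)) ,
    λ (x-a≡0 , y-a≡k) → ¬side ( trans (sym (m+[n∸m]≡n a≤x)) (trans (cong (a +_) x-a≡0) (+-identityʳ a))
                              , trans (sym (m+[n∸m]≡n a≤y)) (cong (a +_) y-a≡k))
    where
    a≤y : a ≤ y
    a≤y = ≤-trans a≤x (<⇒≤ (Chord⇒< (a≤x , 2+x≤y , y≤a+k)))

  #nc-diagonals : ∀ a k M → a + k < M → #nc (pairsWith (Diagonal? a (a + k)) M) ≡ #dissections k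
  #nc-diagonals a k M a+k<M =
    trans (#nc-ext (pairsWith-unique D? M) (Unique.map⁺ (shift-injective a) (diagonals-unique k)) to from)
          (#nc-map (shift a) (crosses-shift a) (diagonals (suc k)))
    where
    D? : Decidable (Diagonal a (a + k))
    D? = Diagonal? a (a + k)
    to : pairsWith D? M ⊆ map (shift a) (diagonals (suc k))
    to {x , y} xy∈ with ∈pairsWith⁻ D? xy∈
    ... | D@((a≤x , _ , _) , _) =
      subst (_∈ map (shift a) (diagonals (suc k)))
            (cong₂ _,_ (m+[n∸m]≡n a≤x) (m+[n∸m]≡n (≤-trans a≤x (<⇒≤ (Chord⇒< (proj₁ D))))))
            (∈-map⁺ (shift a) (∈diagonals⁺ (Diagonal-unshift D)))
    from : map (shift a) (diagonals (suc k)) ⊆ pairsWith D? M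
    from xy∈ with ∈-map⁻ (shift a) xy∈
    ... | (u , v) , uv∈ , refl with Diagonal-shift {a} (∈diagonals⁻ uv∈)
    ...   | D@((_ , _ , a+v≤a+k) , _) = ∈pairsWith⁺ D? (Chord⇒< (proj₁ D)) (≤-<-trans a+v≤a+k a+k<M) D

  -- a non-crossing set of chords either contains the side (a , b) or not, and the side crosses nothing
  #nc-chords : ∀ a k M → a + k < M → 2 ≤ k → #nc (pairsWith (Chord? a (a + k)) M) ≡ 2 * #dissections k
  #nc-chords a k M a+k<M 2≤k = begin
    #nc (pairsWith C? M)                               ≡⟨ #nc-ext (pairsWith-unique C? M) side∷diagonals! to from ⟩
    #nc (side ∷ pairsWith D? M)                        ≡⟨ #nc-∷ side (pairsWith D? M) ⟩
    #nc (filterᵇ (avoids side) (pairsWith D? M)) + #nc (pairsWith D? M)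
      ≡⟨ cong (λ L → #nc L + #nc (pairsWith D? M)) (filterᵇ-all _ _ (λ z z∈ → side-avoids (proj₁ (∈pairsWith⁻ D? z∈)))) ⟩
    #nc (pairsWith D? M) + #nc (pairsWith D? M)        ≡⟨ cong (λ n → n + n) (#nc-diagonals a k M a+k<M) ⟩
    #dissections k + #dissections k                    ≡⟨ cong (#dissections k +_) (+-identityʳ (#dissections k)) ⟨
    2 * #dissections k                                 ∎
    where
    open ≡-Reasoning
    C? : Decidable (Chord a (a + k))
    C? = Chord? a (a + k)
    D? : Decidable (Diagonal a (a + k))
    D? = Diagonal? a (a + k)
    side : Diag
    side = (a , a + k)
    side∉ : side ∉ pairsWith D? M
    side∉ side∈ = proj₂ (∈pairsWith⁻ D? side∈) (refl , refl)
    side∷diagonals! : Unique (side ∷ pairsWith D? M)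
    side∷diagonals! = unique-∷ side∉ (pairsWith-unique D? M)
    to : pairsWith C? M ⊆ side ∷ pairsWith D? M
    to {x , y} xy∈ with x ≟ a | y ≟ a + k
    ... | yes refl | yes refl = here refl
    ... | no x≢a   | _        = there (∈pairsWith-transfer C? D? xy∈ (_, λ (x≡a , _) → x≢a x≡a))
    ... | yes _    | no y≢a+k = there (∈pairsWith-transfer C? D? xy∈ (_, λ (_ , y≡a+k) → y≢a+k y≡a+k))
    from : side ∷ pairsWith D? M ⊆ pairsWith C? M
    from (here refl) = ∈pairsWith⁺ C? (≤-trans (n≤1+n _) side-chord-length) a+k<M (≤-refl , side-chord-length , ≤-refl)
      where
      side-chord-length : 2 + a ≤ a + k
      side-chord-length = subst (_≤ a + k) (+-comm a 2) (+-monoʳ-≤ a 2≤k)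
    from (there z∈) = ∈pairsWith-transfer D? C? z∈ proj₁

module SchröderRecurrence where

  open import Data.Bool.Base using (false)
  open import Data.List.Base using (List; _∷_; _++_; filterᵇ; length)
  open import Data.Nat.Solver using (module +-*-Solver)
  open import Data.List.Membership.Propositional using (_∈_; _∉_)
  open import Data.List.Membership.Propositional.Properties using (∈-++⁺ˡ; ∈-++⁺ʳ; ∈-++⁻; ∈-filter⁻; ∈-filter⁺)
  open import Data.List.Relation.Binary.Subset.Propositional using (_⊆_)
  open import Data.List.Relation.Unary.Any using (here; there)
  import Data.List.Relation.Unary.Unique.Propositional.Properties as Unique
  open import Data.Bool.Properties using (T?)
  open import Data.Nat.Base
  open import Data.Nat.Properties
  open import Data.Product.Base using (_×_; _,_; proj₁; proj₂)
  open import Data.Sum.Base using (_⊎_; inj₁; inj₂)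
  open import Data.Empty using (⊥-elim)
  open import Function.Base using (_∘_)
  open import Relation.Nullary.Decidable using (yes; no; _×-dec_; _⊎-dec_)
  open import Relation.Nullary.Negation using (¬_)
  open import Relation.Unary using (Decidable)
  open import Relation.Binary.PropositionalEquality
  open Polygon
  open Counting using (length-filterᵇ)
  open NonCrossing
  open Chords

  chords-apart : ∀ {a b c x y} → Chord a b x → Chord b c y → crosses x y ≡ false
  chords-apart {x = u , v} {y = u′ , v′} (_ , _ , v≤b) c′@(b≤u′ , _ , _) = to-false (crosses-reflects _ _) λ
    { (inj₁ (_ , u′<v , _)) → <⇒≱ u′<v (≤-trans v≤b b≤u′)
    ; (inj₂ (_ , _ , v′<v)) → <⇒≱ v′<v (≤-trans v≤b (≤-trans b≤u′ (<⇒≤ (Chord⇒< c′)))) }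

  FanFrom : ℕ → ℕ → Diag → Set
  FanFrom p i (x , y) = Chord 0 p (x , y) ⊎ (i ≤ x × 2 + x ≤ suc p × y ≡ suc p)

  FanFrom? : ∀ p i → Decidable (FanFrom p i)
  FanFrom? p i (x , y) = Chord? 0 p (x , y) ⊎-dec ((i ≤? x) ×-dec ((2 + x ≤? suc p) ×-dec (y ≟ suc p)))

  module _ (p : ℕ) where

    chordsIn : ℕ → ℕ → List Diag
    chordsIn a b = pairsWith (Chord? a b) (2 + p)

    diagonalsIn : ℕ → ℕ → List Diag
    diagonalsIn a b = pairsWith (Diagonal? a b) (2 + p)

    fanFrom : ℕ → List Diag
    fanFrom i = pairsWith (FanFrom? p i) (2 + p)

    #dissections≡#nc-fanFrom1 : #dissections (suc p) ≡ #nc (fanFrom 1)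
    #dissections≡#nc-fanFrom1 =
      trans (cong #nc (diagonals≡pairsWith (suc p))) (#nc-pairsWith-≐ (Diagonal? 0 (suc p)) (FanFrom? p 1) (2 + p) to from)
      where
      to : ∀ {z} → Diagonal 0 (suc p) z → FanFrom p 1 z
      to {x , y} ((_ , 2+x≤y , y≤1+p) , ¬side) with y ≤? p | x
      ... | yes y≤p | _     = inj₁ (z≤n , 2+x≤y , y≤p)
      ... | no  y≰p | zero  = ⊥-elim (¬side (refl , ≤-antisym y≤1+p (≰⇒> y≰p)))
      ... | no  y≰p | suc _ = inj₂ (s≤s z≤n , subst (2 + _ ≤_) y≡1+p 2+x≤y , y≡1+p)
        where
        y≡1+p : y ≡ suc p
        y≡1+p = ≤-antisym y≤1+p (≰⇒> y≰p)
      from : ∀ {z} → FanFrom p 1 z → Diagonal 0 (suc p) z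
      from (inj₁ (_ , 2+x≤y , y≤p))    = (z≤n , 2+x≤y , m≤n⇒m≤1+n y≤p) , λ (_ , y≡1+p) → 1+n≰n (subst (_≤ p) y≡1+p y≤p)
      from (inj₂ (1≤x , 2+x≤y , refl)) = (z≤n , 2+x≤y , ≤-refl) , λ (x≡0 , _) → 1+n≰n (subst (1 ≤_) x≡0 1≤x)

    #nc-fanFrom-p : #nc (fanFrom p) ≡ #nc (chordsIn 0 p)
    #nc-fanFrom-p = #nc-pairsWith-≐ (FanFrom? p p) (Chord? 0 p) (2 + p) to inj₁
      where
      to : ∀ {z} → FanFrom p p z → Chord 0 p z
      to (inj₁ c)               = c
      to (inj₂ (p≤x , 2+x≤1+p , _)) = ⊥-elim (1+n≰n (≤-trans (s≤s (s≤s p≤x)) 2+x≤1+p))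

    -- either the fan chord (i , p+1) is absent, or it is present and the other chords avoid it
    #nc-fanFrom-peel : ∀ i → 2 + i ≤ suc p →
      #nc (fanFrom i) ≡ #nc (filterᵇ (avoids (i , suc p)) (fanFrom (suc i))) + #nc (fanFrom (suc i))
    #nc-fanFrom-peel i 2+i≤1+p =
      trans (#nc-ext (pairsWith-unique (FanFrom? p i) (2 + p)) (unique-∷ fan∉ (pairsWith-unique (FanFrom? p (suc i)) (2 + p))) to from)
            (#nc-∷ fan (fanFrom (suc i)))
      where
      fan : Diag
      fan = (i , suc p)
      fan∉ : fan ∉ fanFrom (suc i)
      fan∉ fan∈ with ∈pairsWith⁻ (FanFrom? p (suc i)) fan∈
      ... | inj₁ (_ , _ , 1+p≤p) = 1+n≰n 1+p≤p
      ... | inj₂ (1+i≤i , _)     = 1+n≰n 1+i≤i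
      to : fanFrom i ⊆ fan ∷ fanFrom (suc i)
      to {x , y} xy∈ with ∈pairsWith⁻ (FanFrom? p i) xy∈ | x ≟ i
      ... | inj₁ c                    | _        = there (∈pairsWith-transfer (FanFrom? p i) (FanFrom? p (suc i)) xy∈ λ _ → inj₁ c)
      ... | inj₂ (_ , _ , refl)       | yes refl = here refl
      ... | inj₂ (i≤x , 2+x≤1+p , y≡) | no x≢i   =
        there (∈pairsWith-transfer (FanFrom? p i) (FanFrom? p (suc i)) xy∈
                 λ _ → inj₂ (≤∧≢⇒< i≤x (x≢i ∘ sym) , 2+x≤1+p , y≡))
      from : fan ∷ fanFrom (suc i) ⊆ fanFrom i
      from (here refl) = ∈pairsWith⁺ (FanFrom? p i) (≤-trans (n≤1+n _) 2+i≤1+p) ≤-refl (inj₂ (≤-refl , 2+i≤1+p , refl))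
      from (there z∈)  = ∈pairsWith-transfer (FanFrom? p (suc i)) (FanFrom? p i) z∈ weaken
        where
        weaken : ∀ {z} → FanFrom p (suc i) z → FanFrom p i z
        weaken (inj₁ c)               = inj₁ c
        weaken (inj₂ (1+i≤x , rest)) = inj₂ (≤-trans (n≤1+n i) 1+i≤x , rest)

    -- a chord avoiding the fan chord (i , p+1) lies on one of its two sides
    #nc-avoiding-fan : ∀ i → 2 + i ≤ suc p →
      #nc (filterᵇ (avoids (i , suc p)) (fanFrom (suc i))) ≡ #nc (chordsIn 0 i) * #nc (diagonalsIn i (suc p))
    #nc-avoiding-fan i 2+i≤1+p =
      trans (#nc-ext (Unique.filter⁺ (T? ∘ avoids fan) (pairsWith-unique (FanFrom? p (suc i)) (2 + p)))
                     (Unique.++⁺ (pairsWith-unique (Chord? 0 i) (2 + p)) (pairsWith-unique (Diagonal? i (suc p)) (2 + p)) disjoint)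
                     to from)
            (#nc-++ (chordsIn 0 i) (diagonalsIn i (suc p))
               (λ a b a∈ b∈ → chords-apart (∈pairsWith⁻ (Chord? 0 i) a∈) (proj₁ (∈pairsWith⁻ (Diagonal? i (suc p)) b∈))))
      where
      fan : Diag
      fan = (i , suc p)
      fan-chord : Chord i (suc p) fan
      fan-chord = ≤-refl , 2+i≤1+p , ≤-refl
      disjoint : ∀ {z} → ¬ (z ∈ chordsIn 0 i × z ∈ diagonalsIn i (suc p))
      disjoint (z∈ , z∈′) with ∈pairsWith⁻ (Chord? 0 i) z∈ | ∈pairsWith⁻ (Diagonal? i (suc p)) z∈′
      ... | c@(_ , _ , y≤i) | ((i≤x , _ , _) , _) = <⇒≱ (Chord⇒< c) (≤-trans y≤i i≤x)
      to : filterᵇ (avoids fan) (fanFrom (suc i)) ⊆ chordsIn 0 i ++ diagonalsIn i (suc p)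
      to {x , y} xy∈ with ∈-filter⁻ (T? ∘ avoids fan) {xs = fanFrom (suc i)} xy∈
      ... | xy∈fan , avoid with ∈pairsWith⁻ (FanFrom? p (suc i)) xy∈fan
      ...   | inj₂ (1+i≤x , 2+x≤1+p , refl) =
        ∈-++⁺ʳ (chordsIn 0 i) (∈pairsWith-transfer (FanFrom? p (suc i)) (Diagonal? i (suc p)) xy∈fan
                λ _ → (≤-trans (n≤1+n i) 1+i≤x , 2+x≤1+p , ≤-refl) , λ (x≡i , _) → 1+n≰n (subst (suc i ≤_) x≡i 1+i≤x))
      ...   | inj₁ (_ , 2+x≤y , y≤p) with y ≤? i | x <? i
      ...     | yes y≤i | _       = ∈-++⁺ˡ (∈pairsWith-transfer (FanFrom? p (suc i)) (Chord? 0 i) xy∈fan λ _ → z≤n , 2+x≤y , y≤i)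
      ...     | no  y≰i | yes x<i = ⊥-elim (proj₁ (T⇔ (avoids-reflects fan (x , y))) avoid (inj₂ (x<i , ≰⇒> y≰i , s≤s y≤p)))
      ...     | no  _   | no  x≮i = ∈-++⁺ʳ (chordsIn 0 i) (∈pairsWith-transfer (FanFrom? p (suc i)) (Diagonal? i (suc p)) xy∈fan
                λ _ → (≮⇒≥ x≮i , 2+x≤y , m≤n⇒m≤1+n y≤p) , λ (_ , y≡1+p) → 1+n≰n (subst (_≤ p) y≡1+p y≤p))
      from : chordsIn 0 i ++ diagonalsIn i (suc p) ⊆ filterᵇ (avoids fan) (fanFrom (suc i))
      from {x , y} xy∈ with ∈-++⁻ (chordsIn 0 i) xy∈
      ... | inj₁ xy∈C = ∈-filter⁺ (T? ∘ avoids fan)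
              (∈pairsWith-transfer (Chord? 0 i) (FanFrom? p (suc i)) xy∈C
                 λ (_ , 2+x≤y , y≤i) → inj₁ (z≤n , 2+x≤y , ≤-trans y≤i i≤p))
              (proj₂ (T⇔ (avoids-reflects fan (x , y)))
                 (from-false (crosses-reflects _ _) (chords-apart (∈pairsWith⁻ (Chord? 0 i) xy∈C) fan-chord) ∘ Cross-sym))
        where
        i≤p : i ≤ p
        i≤p = ≤-pred (≤-trans (n≤1+n _) 2+i≤1+p)
      ... | inj₂ xy∈D = ∈-filter⁺ (T? ∘ avoids fan)
              (∈pairsWith-transfer (Diagonal? i (suc p)) (FanFrom? p (suc i)) xy∈D in-fanFrom)
              (proj₂ (T⇔ (avoids-reflects fan (x , y))) (side-¬Cross (proj₁ (∈pairsWith⁻ (Diagonal? i (suc p)) xy∈D))))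
        where
        in-fanFrom : Diagonal i (suc p) (x , y) → FanFrom p (suc i) (x , y)
        in-fanFrom ((i≤x , 2+x≤y , y≤1+p) , ¬side) with y ≤? p
        ... | yes y≤p = inj₁ (z≤n , 2+x≤y , y≤p)
        ... | no  y≰p with ≤-antisym y≤1+p (≰⇒> y≰p)
        ...   | refl = inj₂ (≤∧≢⇒< i≤x (λ i≡x → ¬side (sym i≡x , refl)) , 2+x≤y , refl)

    #nc-fanFrom-step : ∀ i → 2 + i ≤ suc p →
      #nc (fanFrom i) ≡ #nc (chordsIn 0 i) * #nc (diagonalsIn i (suc p)) + #nc (fanFrom (suc i))
    #nc-fanFrom-step i 2+i≤1+p =
      trans (#nc-fanFrom-peel i 2+i≤1+p) (cong (_+ #nc (fanFrom (suc i))) (#nc-avoiding-fan i 2+i≤1+p))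

  #chordSets : ℕ → ℕ
  #chordSets zero                = 1
  #chordSets (suc zero)          = 1
  #chordSets t@(suc (suc _))     = 2 * #dissections t

  Σℕ< : ℕ → (ℕ → ℕ) → ℕ
  Σℕ< zero    g = 0
  Σℕ< (suc d) g = g 0 + Σℕ< d (λ u → g (suc u))

  Σℕ<-cong : ∀ d g h → (∀ u → u < d → g u ≡ h u) → Σℕ< d g ≡ Σℕ< d h
  Σℕ<-cong zero    g h g≗h = refl
  Σℕ<-cong (suc d) g h g≗h = cong₂ _+_ (g≗h 0 z<s) (Σℕ<-cong d _ _ (λ u u<d → g≗h (suc u) (s<s u<d)))

  Σℕ<-snoc : ∀ d g → Σℕ< (suc d) g ≡ Σℕ< d g + g d
  Σℕ<-snoc zero    g = +-comm (g 0) 0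
  Σℕ<-snoc (suc d) g = trans (cong (g 0 +_) (Σℕ<-snoc d (λ u → g (suc u)))) (sym (+-assoc (g 0) _ _))

  Σℕ<-*ˡ : ∀ d c g → Σℕ< d (λ u → c * g u) ≡ c * Σℕ< d g
  Σℕ<-*ˡ zero    c g = sym (*-zeroʳ c)
  Σℕ<-*ˡ (suc d) c g = trans (cong (c * g 0 +_) (Σℕ<-*ˡ d c (λ u → g (suc u)))) (sym (*-distribˡ-+ c (g 0) _))

  module _ (p : ℕ) where

    #nc-chordsIn0 : ∀ t → t < 2 + p → #nc (chordsIn p 0 t) ≡ #chordSets t
    #nc-chordsIn0 zero          _ = #nc-empty λ z∈ → too-short (∈pairsWith⁻ (Chord? 0 0) z∈)
      where
      too-short : ∀ {z} → ¬ Chord 0 0 z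
      too-short (_ , 2+x≤y , y≤0) = 1+n≰n (≤-trans (≤-trans (s≤s z≤n) 2+x≤y) y≤0)
    #nc-chordsIn0 (suc zero)    _ = #nc-empty λ z∈ → too-short (∈pairsWith⁻ (Chord? 0 1) z∈)
      where
      too-short : ∀ {z} → ¬ Chord 0 1 z
      too-short (_ , 2+x≤y , y≤1) = 1+n≰n (≤-trans (≤-trans (s≤s (s≤s z≤n)) 2+x≤y) y≤1)
    #nc-chordsIn0 t@(suc (suc _)) t<2+p = #nc-chords 0 t (2 + p) t<2+p (s≤s (s≤s z≤n))

    #nc-diagonalsIn : ∀ i → i ≤ suc p → #nc (diagonalsIn p i (suc p)) ≡ #dissections (suc p ∸ i)
    #nc-diagonalsIn i i≤1+p =
      subst (λ b → #nc (pairsWith (Diagonal? i b) (2 + p)) ≡ #dissections (suc p ∸ i)) (m+[n∸m]≡n i≤1+p)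
        (#nc-diagonals i (suc p ∸ i) (2 + p) (subst (_< 2 + p) (sym (m+[n∸m]≡n i≤1+p)) ≤-refl))

    -- peeling the fan chords (i , p+1), (i+1 , p+1), … one at a time
    #nc-fanFrom : ∀ d i → i + d ≡ p →
      #nc (fanFrom p i) ≡ Σℕ< d (λ u → #chordSets (i + u) * #dissections (suc p ∸ (i + u))) + #chordSets p
    #nc-fanFrom zero i refl = begin
      #nc (fanFrom p i)          ≡⟨ cong (λ j → #nc (fanFrom p j)) (sym (+-identityʳ i)) ⟩
      #nc (fanFrom p p)          ≡⟨ #nc-fanFrom-p p ⟩
      #nc (chordsIn p 0 p)       ≡⟨ #nc-chordsIn0 p (m<n⇒m<1+n (n<1+n p)) ⟩
      #chordSets p               ∎
      where open ≡-Reasoning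
    #nc-fanFrom (suc d) i i+1+d≡p = begin
      #nc (fanFrom p i)
        ≡⟨ #nc-fanFrom-step p i 2+i≤1+p ⟩
      #nc (chordsIn p 0 i) * #nc (diagonalsIn p i (suc p)) + #nc (fanFrom p (suc i))
        ≡⟨ cong₂ _+_ (cong₂ _*_ (#nc-chordsIn0 i (≤-trans (n≤1+n (suc i)) (≤-trans 2+i≤1+p (n≤1+n (suc p)))))
                                 (#nc-diagonalsIn i (≤-trans (n≤1+n i) (≤-trans (n≤1+n (suc i)) 2+i≤1+p))))
                     (#nc-fanFrom d (suc i) (trans (sym (+-suc i d)) i+1+d≡p)) ⟩
      term i + (Σℕ< d (λ u → term (suc i + u)) + #chordSets p)
        ≡⟨ +-assoc (term i) _ (#chordSets p) ⟨
      term i + Σℕ< d (λ u → term (suc i + u)) + #chordSets p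
        ≡⟨ cong (λ s → s + #chordSets p)
                (cong₂ _+_ (cong term (sym (+-identityʳ i))) (Σℕ<-cong d _ _ (λ u _ → cong term (sym (+-suc i u))))) ⟩
      Σℕ< (suc d) (λ u → term (i + u)) + #chordSets p ∎
      where
      open ≡-Reasoning
      term : ℕ → ℕ
      term j = #chordSets j * #dissections (suc p ∸ j)
      2+i≤1+p : 2 + i ≤ suc p
      2+i≤1+p = s≤s (subst (suc i ≤_) i+1+d≡p (subst (suc i ≤_) (sym (+-suc i d)) (s≤s (m≤m+n i d))))

  #dissections-recurrence : ∀ q →
    #dissections (2 + q) ≡ Σℕ< q (λ u → #chordSets (suc u) * #dissections (suc q ∸ u)) + #chordSets (suc q)
  #dissections-recurrence q = trans (#dissections≡#nc-fanFrom1 (suc q)) (#nc-fanFrom (suc q) q 1 refl)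

  littleSchröder : ℕ → ℕ
  littleSchröder m = length (dissections (suc m))

  littleSchröder≡#dissections : ∀ k → littleSchröder (suc k) ≡ #dissections (suc k)
  littleSchröder≡#dissections k = length-filterᵇ nonCrossing (subsets (diagonals (2 + k)))

  #dissections≡littleSchröder : ∀ k → 1 ≤ k → #dissections k ≡ littleSchröder k
  #dissections≡littleSchröder (suc k) _ = sym (littleSchröder≡#dissections k)

  schröderConvolution : ℕ → ℕ
  schröderConvolution n = Σℕ< (suc n) (λ k → littleSchröder k * littleSchröder (n ∸ k))

  littleSchröder-recurrence : ∀ q → littleSchröder (2 + q) + littleSchröder (1 + q) ≡ 2 * schröderConvolution (2 + q)
  littleSchröder-recurrence zero       = refl
  littleSchröder-recurrence q@(suc q′) = begin
    s (2 + q) + s (1 + q)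
      ≡⟨ cong (_+ s (1 + q)) (trans (littleSchröder≡#dissections (suc q)) (#dissections-recurrence q)) ⟩
    (1 * A + Σℕ< q′ (λ u → #chordSets (2 + u) * #dissections (q ∸ u))) + 2 * A + s (1 + q)
      ≡⟨ cong₂ (λ x y → (1 * x + y) + 2 * x + s (1 + q)) (sym (littleSchröder≡#dissections q)) chordSets-sum ⟩
    (1 * s (1 + q) + 2 * Σ) + 2 * s (1 + q) + s (1 + q)
      ≡⟨ regroup (s (1 + q)) Σ ⟩
    2 * (s 1 * s (1 + q) + (Σ + s (1 + q) * s 1))
      ≡⟨ cong (2 *_) convolution-split ⟨
    2 * schröderConvolution (2 + q) ∎
    where
    open ≡-Reasoning
    s : ℕ → ℕ
    s = littleSchröder
    A : ℕ
    A = #dissections (suc q)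
    Σ : ℕ
    Σ = Σℕ< q′ (λ u → s (2 + u) * s (q ∸ u))
    chordSets-sum : Σℕ< q′ (λ u → #chordSets (2 + u) * #dissections (q ∸ u)) ≡ 2 * Σ
    chordSets-sum =
      trans (Σℕ<-cong q′ _ (λ u → 2 * (s (2 + u) * s (q ∸ u)))
              (λ u u<q′ → trans (*-assoc 2 (#dissections (2 + u)) (#dissections (q ∸ u)))
                                (cong (2 *_) (cong₂ _*_ (#dissections≡littleSchröder (2 + u) (s≤s z≤n))
                                                        (#dissections≡littleSchröder (q ∸ u) (1≤q∸u u<q′))))))
            (Σℕ<-*ˡ q′ 2 _)
      where
      1≤q∸u : ∀ {u} → u < q′ → 1 ≤ q ∸ u
      1≤q∸u u<q′ = subst (1 ≤_) (sym (+-∸-assoc 1 (<⇒≤ u<q′))) (s≤s z≤n)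
    convolution-split : schröderConvolution (2 + q) ≡ s 1 * s (1 + q) + (Σ + s (1 + q) * s 1)
    convolution-split = begin
      Σℕ< (2 + q) (λ k → s (1 + k) * s (1 + q ∸ k))
        ≡⟨ Σℕ<-snoc (1 + q) (λ k → s (1 + k) * s (1 + q ∸ k)) ⟩
      Σℕ< (1 + q) (λ k → s (1 + k) * s (1 + q ∸ k)) + s (2 + q) * s (1 + q ∸ (1 + q))
        ≡⟨ cong (Σℕ< (1 + q) (λ k → s (1 + k) * s (1 + q ∸ k)) +_)
                (trans (cong (λ n → s (2 + q) * s n) (n∸n≡0 q)) (*-zeroʳ (s (2 + q)))) ⟩
      Σℕ< (1 + q) (λ k → s (1 + k) * s (1 + q ∸ k)) + 0
        ≡⟨ +-identityʳ (Σℕ< (1 + q) (λ k → s (1 + k) * s (1 + q ∸ k))) ⟩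
      s 1 * s (1 + q) + Σℕ< q (λ u → s (2 + u) * s (q ∸ u))
        ≡⟨ cong (s 1 * s (1 + q) +_) (Σℕ<-snoc q′ (λ u → s (2 + u) * s (q ∸ u))) ⟩
      s 1 * s (1 + q) + (Σ + s (1 + q) * s (q ∸ q′))
        ≡⟨ cong (λ n → s 1 * s (1 + q) + (Σ + s (1 + q) * s n)) (m+n∸n≡m 1 q′) ⟩
      s 1 * s (1 + q) + (Σ + s (1 + q) * s 1) ∎
    regroup : ∀ a b → (1 * a + 2 * b) + 2 * a + a ≡ 2 * (1 * a + (b + a * 1))
    regroup = solve 2 (λ a b → (con 1 :* a :+ con 2 :* b) :+ con 2 :* a :+ a := con 2 :* (con 1 :* a :+ (b :+ a :* con 1))) refl
      where open +-*-Solver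

module Reflection (c : ℕ) where

  open import Data.Bool.Base using (Bool; true; false; not; _∧_; _∨_; if_then_else_)
  open import Data.Bool.ListAction using (all; any)
  open import Data.Bool.Properties using (∧-assoc; ∧-comm; ∧-idem; ∧-zeroʳ; ∨-zeroʳ; not-involutive; T?; T-≡)
  open import Function.Bundles using (Equivalence)
  open import Data.List.Base using (List; []; _∷_; _++_; map; concatMap; filterᵇ; length)
  open import Data.List.Membership.Propositional using (_∈_; _∉_)
  open import Data.List.Membership.Propositional.Properties using (∈-++⁻; ∈-filter⁻)
  open import Data.List.Properties using (length-filter; filter-++)
  open import Data.List.Relation.Binary.Subset.Propositional using (_⊆_)
  open import Data.List.Relation.Binary.Permutation.Propositional using (_↭_)
  open import Data.List.Relation.Unary.Any using (here; there)
  open import Data.List.Relation.Unary.Unique.Propositional using (Unique)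
  import Data.List.Relation.Unary.Unique.Propositional.Properties as Unique
  open import Data.List.Relation.Unary.AllPairs using (_∷_)
  open import Data.Nat.Base using (ℕ; suc; _+_; _∸_; _<_; _≤_; s≤s)
  open import Data.Nat.Properties using (m∸n≤m; m∸[m∸n]≡n; ∸-monoʳ-<; ∸-monoʳ-≤; ≰⇒>; <⇒≱; <-irrefl; +-identityʳ; ≤-refl; ≤-<-trans)
  open import Data.Product.Base using (_×_; _,_; proj₁; proj₂; ∃)
  open import Data.Sum.Base using (_⊎_; inj₁; inj₂)
  open import Function.Base using (_∘_)
  open import Relation.Binary.PropositionalEquality
  open Polygon
  open Counting
  open ListTests
  open NonCrossing

  σ : Diag → Diag
  σ = reflectDiag (suc c)

  InRange : Diag → Set
  InRange (i , j) = i ≤ c × j ≤ c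

  σ-inRange : ∀ x → InRange (σ x)
  σ-inRange (i , j) = m∸n≤m c j , m∸n≤m c i

  σ-involutive : ∀ {x} → InRange x → σ (σ x) ≡ x
  σ-involutive (i≤c , j≤c) = cong₂ _,_ (m∸[m∸n]≡n i≤c) (m∸[m∸n]≡n j≤c)

  σ-injective : ∀ {x y} → InRange x → InRange y → σ x ≡ σ y → x ≡ y
  σ-injective x∈ y∈ σx≡σy = trans (sym (σ-involutive x∈)) (trans (cong σ σx≡σy) (σ-involutive y∈))

  private
    c∸-reflects-< : ∀ {x y} → c ∸ x < c ∸ y → y < x
    c∸-reflects-< c∸x<c∸y = ≰⇒> (λ x≤y → <⇒≱ c∸x<c∸y (∸-monoʳ-≤ c x≤y))

  Cross-σ⁻ : ∀ {a b} → Cross (σ a) (σ b) → Cross a b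
  Cross-σ⁻ (inj₁ (p , q , r)) = inj₂ (c∸-reflects-< r , c∸-reflects-< q , c∸-reflects-< p)
  Cross-σ⁻ (inj₂ (p , q , r)) = inj₁ (c∸-reflects-< r , c∸-reflects-< q , c∸-reflects-< p)

  Cross-σ⁺ : ∀ {a b} → InRange a → InRange b → Cross a b → Cross (σ a) (σ b)
  Cross-σ⁺ (a₁≤c , a₂≤c) (b₁≤c , b₂≤c) (inj₁ (p , q , r)) = inj₂ (∸-monoʳ-< r b₂≤c , ∸-monoʳ-< q a₂≤c , ∸-monoʳ-< p b₁≤c)
  Cross-σ⁺ (a₁≤c , a₂≤c) (b₁≤c , b₂≤c) (inj₂ (p , q , r)) = inj₁ (∸-monoʳ-< r a₂≤c , ∸-monoʳ-< q b₂≤c , ∸-monoʳ-< p a₁≤c)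

  crosses-σ : ∀ {a b} → InRange a → InRange b → crosses (σ a) (σ b) ≡ crosses a b
  crosses-σ a∈ b∈ = reflects-≡ (crosses-reflects _ _) (crosses-reflects _ _) Cross-σ⁻ (Cross-σ⁺ a∈ b∈)

  crosses-σ-swap : ∀ {a b} → InRange a → InRange b → crosses a (σ b) ≡ crosses (σ a) b
  crosses-σ-swap {a} {b} a∈ b∈ = trans (sym (crosses-σ a∈ (σ-inRange b))) (cong (crosses (σ a)) (σ-involutive b∈))

  crosses-irrefl : ∀ x → crosses x x ≡ false
  crosses-irrefl x = to-false (crosses-reflects x x) λ { (inj₁ (p , _)) → <-irrefl refl p ; (inj₂ (p , _)) → <-irrefl refl p }

  isFixed : Diag → Bool
  isFixed h = eqDiag (σ h) h

  orbit : Diag → List Diag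
  orbit h = if isFixed h then h ∷ [] else h ∷ σ h ∷ []

  orbits : List Diag → List Diag
  orbits = concatMap orbit

  orbit-fixed : ∀ {h} → isFixed h ≡ true → orbit h ≡ h ∷ []
  orbit-fixed {h} fixed = cong (λ b → if b then h ∷ [] else h ∷ σ h ∷ []) fixed

  orbit-moved : ∀ {h} → isFixed h ≡ false → orbit h ≡ h ∷ σ h ∷ []
  orbit-moved {h} moved = cong (λ b → if b then h ∷ [] else h ∷ σ h ∷ []) moved

  ∈orbit⁻ : ∀ {h x} → x ∈ orbit h → x ≡ h ⊎ x ≡ σ h
  ∈orbit⁻ {h} x∈ with isFixed h
  ∈orbit⁻ (here x≡h)         | true  = inj₁ x≡h
  ∈orbit⁻ (here x≡h)         | false = inj₁ x≡h
  ∈orbit⁻ (there (here x≡σh)) | false = inj₂ x≡σh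

  ∈orbits⁻ : ∀ H {x} → x ∈ orbits H → ∃ λ h → h ∈ H × (x ≡ h ⊎ x ≡ σ h)
  ∈orbits⁻ (h ∷ H) x∈ with ∈-++⁻ (orbit h) x∈
  ... | inj₁ x∈orbit  = h , here refl , ∈orbit⁻ x∈orbit
  ... | inj₂ x∈orbits = let h′ , h′∈H , x≡ = ∈orbits⁻ H x∈orbits in h′ , there h′∈H , x≡

  record Representatives (H : List Diag) : Set where
    field
      inRange    : ∀ {h} → h ∈ H → InRange h
      unique     : Unique H
      onePerOrbit : ∀ {h h′} → h ∈ H → h′ ∈ H → h′ ≡ σ h → h ≡ h′
  open Representatives

  Representatives-tail : ∀ {h H} → Representatives (h ∷ H) → Representatives H
  Representatives-tail R = record
    { inRange     = inRange R ∘ there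
    ; unique      = tail (unique R)
    ; onePerOrbit = λ h∈ h′∈ → onePerOrbit R (there h∈) (there h′∈)
    }
    where
    tail : ∀ {h H} → Unique (h ∷ H) → Unique H
    tail (_ ∷ H!) = H!

  Representatives-filterᵇ : ∀ p {H} → Representatives H → Representatives (filterᵇ p H)
  Representatives-filterᵇ p {H} R = record
    { inRange     = inRange R ∘ ∈H
    ; unique      = Unique.filter⁺ (T? ∘ p) (unique R)
    ; onePerOrbit = λ h∈ h′∈ → onePerOrbit R (∈H h∈) (∈H h′∈)
    }
    where
    ∈H : ∀ {h} → h ∈ filterᵇ p H → h ∈ H
    ∈H h∈ = proj₁ (∈-filter⁻ (T? ∘ p) {xs = H} h∈)

  orbits-inRange : ∀ {H} → Representatives H → ∀ {x} → x ∈ orbits H → InRange x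
  orbits-inRange {H} R x∈ with ∈orbits⁻ H x∈
  ... | h , h∈ , inj₁ refl = inRange R h∈
  ... | h , h∈ , inj₂ refl = σ-inRange h

  orbit-∉orbits : ∀ {h H} → Representatives (h ∷ H) → h ∉ orbits H × σ h ∉ orbits H
  orbit-∉orbits {h} {H} R = h∉ , σh∉
    where
    h∉H : h ∉ H
    h∉H = Unique.Unique[x∷xs]⇒x∉xs (unique R)
    h∉ : h ∉ orbits H
    h∉ h∈ with ∈orbits⁻ H h∈
    ... | h′ , h′∈ , inj₁ refl  = h∉H h′∈
    ... | h′ , h′∈ , inj₂ h≡σh′ = h∉H (subst (_∈ H) (onePerOrbit R (there h′∈) (here refl) h≡σh′) h′∈)
    σh∉ : σ h ∉ orbits H
    σh∉ σh∈ with ∈orbits⁻ H σh∈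
    ... | h′ , h′∈ , inj₁ σh≡h′  = h∉H (subst (_∈ H) (sym (onePerOrbit R (here refl) (there h′∈) (sym σh≡h′))) h′∈)
    ... | h′ , h′∈ , inj₂ σh≡σh′ = h∉H (subst (_∈ H) (sym (σ-injective (inRange R (here refl)) (inRange R (there h′∈)) σh≡σh′)) h′∈)

  filterᵇ-orbit : ∀ (p : Diag → Bool) h → p (σ h) ≡ p h → filterᵇ p (orbit h) ≡ (if p h then orbit h else [])
  filterᵇ-orbit p h p-σ = by-cases (isFixed h) refl (p h) refl
    where
    by-cases : ∀ b → isFixed h ≡ b → ∀ t → p h ≡ t → filterᵇ p (orbit h) ≡ (if t then orbit h else [])
    by-cases true  fixed true  ph = trans (cong (filterᵇ p) (orbit-fixed fixed)) (trans (filterᵇ-accept p [] ph) (sym (orbit-fixed fixed)))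
    by-cases true  fixed false ph = trans (cong (filterᵇ p) (orbit-fixed fixed)) (filterᵇ-reject p [] ph)
    by-cases false moved true  ph =
      trans (cong (filterᵇ p) (orbit-moved moved))
        (trans (filterᵇ-accept p _ ph) (trans (cong (h ∷_) (filterᵇ-accept p [] (trans p-σ ph))) (sym (orbit-moved moved))))
    by-cases false moved false ph =
      trans (cong (filterᵇ p) (orbit-moved moved)) (trans (filterᵇ-reject p _ ph) (filterᵇ-reject p [] (trans p-σ ph)))

  filterᵇ-orbits : ∀ (p : Diag → Bool) H → (∀ h → h ∈ H → p (σ h) ≡ p h) → filterᵇ p (orbits H) ≡ orbits (filterᵇ p H)
  filterᵇ-orbits p []      _   = refl
  filterᵇ-orbits p (h ∷ H) p-σ = begin
    filterᵇ p (orbit h ++ orbits H)                         ≡⟨ filter-++ (T? ∘ p) (orbit h) (orbits H) ⟩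
    filterᵇ p (orbit h) ++ filterᵇ p (orbits H)             ≡⟨ cong₂ _++_ (filterᵇ-orbit p h (p-σ h (here refl)))
                                                                          (filterᵇ-orbits p H (λ x x∈ → p-σ x (there x∈))) ⟩
    (if p h then orbit h else []) ++ orbits (filterᵇ p H)   ≡⟨ orbits-filterᵇ-∷ ⟨
    orbits (filterᵇ p (h ∷ H))                              ∎
    where
    open ≡-Reasoning
    orbits-filterᵇ-∷ : orbits (filterᵇ p (h ∷ H)) ≡ (if p h then orbit h else []) ++ orbits (filterᵇ p H)
    orbits-filterᵇ-∷ with p h
    ... | true  = refl
    ... | false = refl

  good : Diag → Bool
  good h = avoids h (σ h)

  compatible : Diag → Diag → Bool
  compatible h e = avoids h e ∧ avoids (σ h) e

  compatible-σ : ∀ {h e} → InRange h → InRange e → compatible h (σ e) ≡ compatible h e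
  compatible-σ {h} {e} h∈ e∈ =
    trans (cong₂ (λ u v → not u ∧ not v) (crosses-σ-swap h∈ e∈) (crosses-σ h∈ e∈)) (∧-comm (avoids (σ h) e) (avoids h e))

  any-eqDiag-∈ : ∀ {x S} → x ∈ S → any (eqDiag x) S ≡ true
  any-eqDiag-∈ {x} {_ ∷ S} (here refl) = cong (_∨ any (eqDiag x) S) (to-true (eqDiag-reflects x x) refl)
  any-eqDiag-∈ {x} {y ∷ S} (there x∈) = trans (cong (eqDiag x y ∨_) (any-eqDiag-∈ x∈)) (∨-zeroʳ _)

  any-eqDiag-∉ : ∀ {x} S → x ∉ S → any (eqDiag x) S ≡ false
  any-eqDiag-∉     []      _  = refl
  any-eqDiag-∉ {x} (y ∷ S) x∉ =
    trans (cong (_∨ any (eqDiag x) S) (to-false (eqDiag-reflects x y) (x∉ ∘ here))) (any-eqDiag-∉ S (x∉ ∘ there))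

  any-eqDiag-skip : ∀ {x y} S → x ≢ y → any (eqDiag x) (y ∷ S) ≡ any (eqDiag x) S
  any-eqDiag-skip S x≢y = cong (_∨ _) (to-false (eqDiag-reflects _ _) x≢y)

  module _ {h S} (h∈ : InRange h) (S∈ : ∀ {d} → d ∈ S → InRange d) where

    symmetric-fixed : σ h ≡ h → h ∉ S → symmetric (suc c) (h ∷ S) ≡ symmetric (suc c) S
    symmetric-fixed σh≡h h∉S =
      trans (cong (λ b → (b ∨ any (eqDiag (σ h)) S) ∧ all (λ d → any (eqDiag (σ d)) (h ∷ S)) S) (to-true (eqDiag-reflects _ _) σh≡h))
            (all-cong _ _ S (λ d d∈ → any-eqDiag-skip {σ d} {h} S λ σd≡h →
              h∉S (subst (_∈ S) (σ-injective (S∈ d∈) h∈ (trans σd≡h (sym σh≡h))) d∈)))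

    symmetric-pair : h ∉ S → σ h ∉ S → symmetric (suc c) (h ∷ σ h ∷ S) ≡ symmetric (suc c) S
    symmetric-pair h∉S σh∉S =
      trans (cong₂ _∧_ (any-eqDiag-∈ {σ h} {h ∷ σ h ∷ S} (there (here refl)))
                       (cong (_∧ all (λ d → any (eqDiag (σ d)) (h ∷ σ h ∷ S)) S) (any-eqDiag-∈ {σ (σ h)} {h ∷ σ h ∷ S} (here (σ-involutive h∈)))))
            (all-cong _ _ S (λ d d∈ → trans
              (any-eqDiag-skip {σ d} {h} (σ h ∷ S) λ σd≡h → σh∉S (subst (_∈ S) (trans (sym (σ-involutive (S∈ d∈))) (cong σ σd≡h)) d∈))
              (any-eqDiag-skip {σ d} {σ h} S λ σd≡σh → h∉S (subst (_∈ S) (σ-injective (S∈ d∈) h∈ σd≡σh) d∈))))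

  symmetric-lonely : ∀ {h S} → isFixed h ≡ false → σ h ∉ S → symmetric (suc c) (h ∷ S) ≡ false
  symmetric-lonely {h} {S} moved σh∉S =
    cong (_∧ all (λ d → any (eqDiag (σ d)) (h ∷ S)) S) (trans (cong (_∨ any (eqDiag (σ h)) S) moved) (any-eqDiag-∉ S σh∉S))

  symmetric-lonely′ : ∀ {h S} → InRange h → isFixed h ≡ false → h ∉ S → symmetric (suc c) (σ h ∷ S) ≡ false
  symmetric-lonely′ {h} {S} h∈ moved h∉S = symmetric-lonely σh-moved (subst (_∉ S) (sym (σ-involutive h∈)) h∉S)
    where
    σh-moved : isFixed (σ h) ≡ false
    σh-moved = to-false (eqDiag-reflects _ _) λ σσh≡σh →
      from-false (eqDiag-reflects (σ h) h) moved (sym (trans (sym (σ-involutive h∈)) σσh≡σh))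

  symmetricNC : List Diag → Bool
  symmetricNC S = nonCrossing S ∧ symmetric (suc c) S

  symmetricNC-↭ : ∀ {S S′} → S ↭ S′ → symmetricNC S ≡ symmetricNC S′
  symmetricNC-↭ {S} S↭S′ =
    cong₂ _∧_ (nonCrossing-↭ S↭S′) (trans (all-cong _ _ S (λ d _ → any-↭ (eqDiag (σ d)) S↭S′)) (all-↭ _ S↭S′))

  #symmetric : List Diag → ℕ
  #symmetric H = #subsets symmetricNC (orbits H)

  module _ {h H} (R : Representatives (h ∷ H)) where

    private
      h∈ : InRange h
      h∈ = inRange R (here refl)
      X∈ : ∀ {d} → d ∈ orbits H → InRange d
      X∈ = orbits-inRange (Representatives-tail R)
      h∉X : h ∉ orbits H
      h∉X = proj₁ (orbit-∉orbits R)
      σh∉X : σ h ∉ orbits H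
      σh∉X = proj₂ (orbit-∉orbits R)

    compatible-orbits : filterᵇ (compatible h) (orbits H) ≡ orbits (filterᵇ (compatible h) H)
    compatible-orbits = filterᵇ-orbits (compatible h) H (λ e e∈ → compatible-σ h∈ (inRange R (there e∈)))

    symmetricNC-fixed : σ h ≡ h → ∀ S → S ⊆ orbits H → symmetricNC (h ∷ S) ≡ all (compatible h) S ∧ symmetricNC S
    symmetricNC-fixed σh≡h S S⊆X = begin
      (all (avoids h) S ∧ nonCrossing S) ∧ symmetric (suc c) (h ∷ S)
        ≡⟨ cong (nonCrossing (h ∷ S) ∧_) (symmetric-fixed h∈ (X∈ ∘ S⊆X) σh≡h (h∉X ∘ S⊆X)) ⟩
      (all (avoids h) S ∧ nonCrossing S) ∧ symmetric (suc c) S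
        ≡⟨ ∧-assoc (all (avoids h) S) (nonCrossing S) (symmetric (suc c) S) ⟩
      all (avoids h) S ∧ symmetricNC S
        ≡⟨ cong (_∧ symmetricNC S) (all-cong _ _ S λ e _ → trans (sym (∧-idem _)) (cong (λ x → avoids h e ∧ avoids x e) (sym σh≡h))) ⟩
      all (compatible h) S ∧ symmetricNC S ∎
      where open ≡-Reasoning

    symmetricNC-pair : ∀ S → S ⊆ orbits H → symmetricNC (h ∷ σ h ∷ S) ≡ good h ∧ (all (compatible h) S ∧ symmetricNC S)
    symmetricNC-pair S S⊆X = begin
      ((good h ∧ all (avoids h) S) ∧ (all (avoids (σ h)) S ∧ nonCrossing S)) ∧ symmetric (suc c) (h ∷ σ h ∷ S)
        ≡⟨ cong (nonCrossing (h ∷ σ h ∷ S) ∧_) (symmetric-pair h∈ (X∈ ∘ S⊆X) (h∉X ∘ S⊆X) (σh∉X ∘ S⊆X)) ⟩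
      ((good h ∧ all (avoids h) S) ∧ (all (avoids (σ h)) S ∧ nonCrossing S)) ∧ symmetric (suc c) S
        ≡⟨ regroup (good h) (all (avoids h) S) (all (avoids (σ h)) S) (nonCrossing S) (symmetric (suc c) S) ⟩
      good h ∧ ((all (avoids h) S ∧ all (avoids (σ h)) S) ∧ symmetricNC S)
        ≡⟨ cong (λ b → good h ∧ (b ∧ symmetricNC S)) (all-∧ (avoids h) (avoids (σ h)) S) ⟨
      good h ∧ (all (compatible h) S ∧ symmetricNC S) ∎
      where
      open ≡-Reasoning
      regroup : ∀ g a b n s → ((g ∧ a) ∧ (b ∧ n)) ∧ s ≡ g ∧ ((a ∧ b) ∧ (n ∧ s))
      regroup true  true  b n s = ∧-assoc b n s
      regroup true  false b n s = refl
      regroup false a     b n s = refl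

    #compatible : #subsets (λ S → all (compatible h) S ∧ symmetricNC S) (orbits H) ≡ #symmetric (filterᵇ (compatible h) H)
    #compatible = trans (#subsets-all (compatible h) (orbits H) symmetricNC) (cong (#subsets symmetricNC) compatible-orbits)

    #symmetric-∷-fixed : isFixed h ≡ true → #symmetric (h ∷ H) ≡ #symmetric (filterᵇ (compatible h) H) + #symmetric H
    #symmetric-∷-fixed fixed = begin
      #subsets symmetricNC (orbit h ++ orbits H)
        ≡⟨ cong (λ O → #subsets symmetricNC (O ++ orbits H)) (orbit-fixed fixed) ⟩
      #subsets symmetricNC (h ∷ orbits H)
        ≡⟨ #subsets-∷ symmetricNC h (orbits H) ⟩
      #subsets (λ S → symmetricNC (h ∷ S)) (orbits H) + #symmetric H
        ≡⟨ cong (_+ #symmetric H) (trans (#subsets-cong (orbits H) _ _ (symmetricNC-fixed (from-true (eqDiag-reflects _ _) fixed))) #compatible) ⟩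
      #symmetric (filterᵇ (compatible h) H) + #symmetric H ∎
      where open ≡-Reasoning

    #symmetric-∷-moved : isFixed h ≡ false →
      #symmetric (h ∷ H) ≡ (if good h then #symmetric (filterᵇ (compatible h) H) else 0) + #symmetric H
    #symmetric-∷-moved moved = begin
      #subsets symmetricNC (orbit h ++ orbits H)
        ≡⟨ cong (λ O → #subsets symmetricNC (O ++ orbits H)) (orbit-moved moved) ⟩
      #subsets symmetricNC (h ∷ σ h ∷ orbits H)
        ≡⟨ trans (#subsets-∷ symmetricNC h (σ h ∷ orbits H))
                 (cong₂ _+_ (#subsets-∷ _ (σ h) (orbits H)) (#subsets-∷ symmetricNC (σ h) (orbits H))) ⟩
      (#subsets (λ S → symmetricNC (h ∷ σ h ∷ S)) (orbits H) + #subsets (λ S → symmetricNC (h ∷ S)) (orbits H))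
        + (#subsets (λ S → symmetricNC (σ h ∷ S)) (orbits H) + #symmetric H)
        ≡⟨ cong₂ _+_ (cong₂ _+_ both only-h) (cong (_+ #symmetric H) only-σh) ⟩
      ((if good h then #symmetric (filterᵇ (compatible h) H) else 0) + 0) + (0 + #symmetric H)
        ≡⟨ cong (_+ #symmetric H) (+-identityʳ _) ⟩
      (if good h then #symmetric (filterᵇ (compatible h) H) else 0) + #symmetric H ∎
      where
      open ≡-Reasoning
      both : #subsets (λ S → symmetricNC (h ∷ σ h ∷ S)) (orbits H) ≡ (if good h then #symmetric (filterᵇ (compatible h) H) else 0)
      both = trans (#subsets-cong (orbits H) _ _ symmetricNC-pair)
                   (trans (#subsets-if (good h) _ (orbits H)) (cong (λ n → if good h then n else 0) #compatible))
      only-h : #subsets (λ S → symmetricNC (h ∷ S)) (orbits H) ≡ 0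
      only-h = trans (#subsets-cong (orbits H) _ (λ _ → false)
                       (λ S S⊆X → trans (cong (nonCrossing (h ∷ S) ∧_) (symmetric-lonely {h} moved (σh∉X ∘ S⊆X))) (∧-zeroʳ _)))
                     (#subsets-false (orbits H))
      only-σh : #subsets (λ S → symmetricNC (σ h ∷ S)) (orbits H) ≡ 0
      only-σh = trans (#subsets-cong (orbits H) _ (λ _ → false)
                        (λ S S⊆X → trans (cong (nonCrossing (σ h ∷ S) ∧_) (symmetric-lonely′ h∈ moved (h∉X ∘ S⊆X))) (∧-zeroʳ _)))
                      (#subsets-false (orbits H))

  #symmetric-∷ : ∀ {h H} → Representatives (h ∷ H) →
    #symmetric (h ∷ H) ≡ (if good h then #symmetric (filterᵇ (compatible h) H) else 0) + #symmetric H
  #symmetric-∷ {h} {H} R = by-cases (isFixed h) refl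
    where
    by-cases : ∀ b → isFixed h ≡ b →
      #symmetric (h ∷ H) ≡ (if good h then #symmetric (filterᵇ (compatible h) H) else 0) + #symmetric H
    by-cases false moved = #symmetric-∷-moved R moved
    by-cases true  fixed = trans (#symmetric-∷-fixed R fixed)
      (cong (λ b → (if b then #symmetric (filterᵇ (compatible h) H) else 0) + #symmetric H) (sym good-h))
      where
      good-h : good h ≡ true
      good-h = cong not (trans (cong (crosses h) (from-true (eqDiag-reflects _ _) fixed)) (crosses-irrefl h))

  module _ (φ : Diag → Diag) where

    CrossingPreserving : List Diag → Set
    CrossingPreserving H = ∀ {h h′} → h ∈ H → h′ ∈ H → good h ≡ true → good h′ ≡ true →
                           crosses (φ h) (φ h′) ≡ not (compatible h h′)

    private
      bounded : ∀ n {H} → length H < n → Representatives H → CrossingPreserving H →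
                #symmetric H ≡ #nc (map φ (filterᵇ good H))
      bounded n       {[]}    _            _ _  = refl
      bounded (suc n) {h ∷ H} (s≤s |H|<n) R φ-h∷H = by-cases (good h) refl
        where
        open ≡-Reasoning
        G : List Diag
        G = filterᵇ good H
        φ-H : CrossingPreserving H
        φ-H h∈ h′∈ = φ-h∷H (there h∈) (there h′∈)
        tail : #symmetric H ≡ #nc (map φ G)
        tail = bounded n |H|<n (Representatives-tail R) φ-H
        ∈H : ∀ {e} → e ∈ filterᵇ (compatible h) H → e ∈ H
        ∈H e∈ = proj₁ (∈-filter⁻ (T? ∘ compatible h) {xs = H} e∈)
        compatible-part : #symmetric (filterᵇ (compatible h) H) ≡ #nc (map φ (filterᵇ good (filterᵇ (compatible h) H)))
        compatible-part =
          bounded n (≤-<-trans (length-filter (T? ∘ compatible h) H) |H|<n) (Representatives-filterᵇ (compatible h) (Representatives-tail R))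
            (λ h∈ h′∈ → φ-H (∈H h∈) (∈H h′∈))
        by-cases : ∀ b → good h ≡ b → #symmetric (h ∷ H) ≡ #nc (map φ (filterᵇ good (h ∷ H)))
        by-cases false bad = begin
          #symmetric (h ∷ H)
            ≡⟨ #symmetric-∷ R ⟩
          (if good h then #symmetric (filterᵇ (compatible h) H) else 0) + #symmetric H
            ≡⟨ cong (λ b → (if b then #symmetric (filterᵇ (compatible h) H) else 0) + #symmetric H) bad ⟩
          #symmetric H
            ≡⟨ tail ⟩
          #nc (map φ G)
            ≡⟨ cong (λ L → #nc (map φ L)) (filterᵇ-reject good {h} H bad) ⟨
          #nc (map φ (filterᵇ good (h ∷ H))) ∎
        by-cases true ok = begin
          #symmetric (h ∷ H)
            ≡⟨ #symmetric-∷ R ⟩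
          (if good h then #symmetric (filterᵇ (compatible h) H) else 0) + #symmetric H
            ≡⟨ cong (λ b → (if b then #symmetric (filterᵇ (compatible h) H) else 0) + #symmetric H) ok ⟩
          #symmetric (filterᵇ (compatible h) H) + #symmetric H
            ≡⟨ cong₂ _+_ compatible-part tail ⟩
          #nc (map φ (filterᵇ good (filterᵇ (compatible h) H))) + #nc (map φ G)
            ≡⟨ cong (λ L → #nc L + #nc (map φ G)) avoiding-φh ⟨
          #nc (filterᵇ (avoids (φ h)) (map φ G)) + #nc (map φ G)
            ≡⟨ #nc-∷ (φ h) (map φ G) ⟨
          #nc (φ h ∷ map φ G)
            ≡⟨ cong (λ L → #nc (map φ L)) (filterᵇ-accept good {h} H ok) ⟨
          #nc (map φ (filterᵇ good (h ∷ H))) ∎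
          where
          avoiding-φh : filterᵇ (avoids (φ h)) (map φ G) ≡ map φ (filterᵇ good (filterᵇ (compatible h) H))
          avoiding-φh = trans (filterᵇ-map (avoids (φ h)) φ G) (cong (map φ) (trans
            (filterᵇ-cong _ (compatible h) G λ e e∈ → let e∈H , good-e = ∈-filter⁻ (T? ∘ good) {xs = H} e∈ in
              trans (cong not (φ-h∷H (here refl) (there e∈H) ok (Equivalence.to T-≡ good-e))) (not-involutive _))
            (filterᵇ-comm (compatible h) good H)))

    #symmetric≡#nc-map : ∀ {H} → Representatives H → CrossingPreserving H → #symmetric H ≡ #nc (map φ (filterᵇ good H))
    #symmetric≡#nc-map {H} = bounded (suc (length H)) ≤-refl

-- K = ⌊c/2⌋, and the axis of the reflection σ of the polygon 0, …, c passes through c/2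
module Halving (c K : ℕ) (K+K≤c : K Nat.+ K Nat.≤ c) (c≤1+K+K : c Nat.≤ Nat.suc (K Nat.+ K)) where

  open import Data.Bool.Base using (true; false; not; _∧_; _∨_; if_then_else_)
  open import Data.Bool.Properties using (∨-identityʳ; ∨-idem; T?; T-≡)
  open import Data.Empty using (⊥-elim)
  open import Data.List.Base using (List; []; _∷_; map; filterᵇ)
  open import Data.List.Membership.Propositional using (_∈_)
  open import Data.List.Membership.Propositional.Properties using (∈-++⁺ˡ; ∈-++⁺ʳ; ∈-map⁺; ∈-map⁻; ∈-filter⁺; ∈-filter⁻)
  open import Data.List.Relation.Binary.BagAndSetEquality using (∼bag⇒↭)
  open import Data.List.Membership.Propositional.Properties.WithK using (unique∧set⇒bag)
  open import Data.List.Relation.Binary.Subset.Propositional using (_⊆_)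
  open import Data.List.Relation.Unary.All as All using ()
  open import Data.List.Relation.Unary.AllPairs as AllPairs using ()
  open import Data.List.Relation.Unary.Any using (here; there)
  open import Data.List.Relation.Unary.Unique.Propositional using (Unique)
  import Data.List.Relation.Unary.Unique.Propositional.Properties as Unique
  open import Data.Nat.Base
  open import Data.Nat.Properties using (≤ᵇ-reflects-≤)
  open import Data.Nat.Properties
  open import Data.Product.Base using (_×_; _,_; proj₁; proj₂)
  open import Data.Sum.Base using (_⊎_; inj₁; inj₂)
  open import Function.Base using (_∘_)
  open import Function.Bundles using (mk⇔; Equivalence)
  open import Relation.Binary.PropositionalEquality
  open import Relation.Nullary.Decidable using (yes; no; _×-dec_)
  open import Relation.Nullary.Negation using (¬_)
  open import Relation.Unary using (Decidable)
  open Polygon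
  open Counting
  open NonCrossing
  open Chords
  open Reflection c
  open Representatives

  -- of the two diagonals d and σ d, the one with i + j ≤ c (both, if they coincide)
  Representative : Diag → Set
  Representative (i , j) = Diagonal 0 c (i , j) × i + j ≤ c

  Representative? : Decidable Representative
  Representative? (i , j) = Diagonal? 0 c (i , j) ×-dec (i + j ≤? c)

  representatives : List Diag
  representatives = pairsWith Representative? (suc c)

  Diagonal-inRange : ∀ {d} → Diagonal 0 c d → InRange d
  Diagonal-inRange (chord@(_ , _ , j≤c) , _) = Chord⇒≤ chord , j≤c

  Diagonal-σ : ∀ {d} → Diagonal 0 c d → Diagonal 0 c (σ d)
  Diagonal-σ {i , j} ((_ , 2+i≤j , j≤c) , ¬side) = (z≤n , 2+c-j≤c-i , m∸n≤m c i) , ¬σside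
    where
    i≤j : i ≤ j
    i≤j = <⇒≤ (Chord⇒< (z≤n , 2+i≤j , j≤c))
    c-i≡c-j+j-i : c ∸ i ≡ (c ∸ j) + (j ∸ i)
    c-i≡c-j+j-i = trans (cong (_∸ i) (sym (m∸n+n≡m j≤c))) (+-∸-assoc (c ∸ j) i≤j)
    2+c-j≤c-i : 2 + (c ∸ j) ≤ c ∸ i
    2+c-j≤c-i = subst (2 + (c ∸ j) ≤_) (sym c-i≡c-j+j-i)
                  (subst (_≤ (c ∸ j) + (j ∸ i)) (+-comm (c ∸ j) 2) (+-monoʳ-≤ (c ∸ j) (2+≤⇒2≤∸ 2+i≤j)))
    ¬σside : ¬ (c ∸ j ≡ 0 × c ∸ i ≡ c)
    ¬σside (c-j≡0 , c-i≡c) = ¬side (∸-cancelˡ-≡ (≤-trans i≤j j≤c) z≤n c-i≡c , ≤-antisym j≤c (m∸n≡0⇒m≤n c-j≡0))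

  Representative-onePerOrbit : ∀ {h h′} → Representative h → Representative h′ → h′ ≡ σ h → h ≡ h′
  Representative-onePerOrbit {i , j} (D , i+j≤c) (_ , c-j+c-i≤c) refl = sym (cong₂ _,_ c-j≡i c-i≡j)
    where
    i≤c : i ≤ c
    i≤c = proj₁ (Diagonal-inRange D)
    j≤c : j ≤ c
    j≤c = proj₂ (Diagonal-inRange D)
    c-j≤i : c ∸ j ≤ i
    c-j≤i = subst (c ∸ j ≤_) (m∸[m∸n]≡n i≤c) (m+n≤o⇒m≤o∸n (c ∸ j) c-j+c-i≤c)
    c≤i+j : c ≤ i + j
    c≤i+j = subst (_≤ i + j) (m∸n+n≡m j≤c) (+-monoˡ-≤ j c-j≤i)
    c-j≡i : c ∸ j ≡ i
    c-j≡i = ≤-antisym c-j≤i (m+n≤o⇒m≤o∸n i i+j≤c)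
    c-i≡j : c ∸ i ≡ j
    c-i≡j = ≤-antisym (m≤n+o⇒m∸n≤o c i c≤i+j) (m+n≤o⇒m≤o∸n j (subst (_≤ c) (+-comm i j) i+j≤c))

  representatives-Representatives : Representatives representatives
  representatives-Representatives = record
    { inRange     = Diagonal-inRange ∘ proj₁ ∘ ∈pairsWith⁻ Representative?
    ; unique      = pairsWith-unique Representative? (suc c)
    ; onePerOrbit = λ h∈ h′∈ → Representative-onePerOrbit (∈pairsWith⁻ Representative? h∈) (∈pairsWith⁻ Representative? h′∈)
    }

  orbit-unique : ∀ h → Unique (orbit h)
  orbit-unique h = by-cases (isFixed h) refl
    where
    by-cases : ∀ b → isFixed h ≡ b → Unique (orbit h)
    by-cases true  fixed = subst Unique (sym (orbit-fixed fixed)) (All.[] AllPairs.∷ AllPairs.[])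
    by-cases false moved = subst Unique (sym (orbit-moved moved))
      ((from-false (eqDiag-reflects _ _) moved ∘ sym All.∷ All.[]) AllPairs.∷ (All.[] AllPairs.∷ AllPairs.[]))

  orbits-unique : ∀ {H} → Representatives H → Unique (orbits H)
  orbits-unique {[]}    _ = AllPairs.[]
  orbits-unique {h ∷ H} R = Unique.++⁺ (orbit-unique h) (orbits-unique (Representatives-tail R)) disjoint
    where
    disjoint : ∀ {v} → ¬ (v ∈ orbit h × v ∈ orbits H)
    disjoint (v∈orbit , v∈orbits) with ∈orbit⁻ v∈orbit
    ... | inj₁ refl = proj₁ (orbit-∉orbits R) v∈orbits
    ... | inj₂ refl = proj₂ (orbit-∉orbits R) v∈orbits

  ∈orbit⁺ : ∀ {h x} → x ≡ h ⊎ x ≡ σ h → x ∈ orbit h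
  ∈orbit⁺ {h} x≡ = by-cases (isFixed h) refl x≡
    where
    by-cases : ∀ b → isFixed h ≡ b → ∀ {x} → x ≡ h ⊎ x ≡ σ h → x ∈ orbit h
    by-cases true  fixed (inj₁ refl) = subst (h ∈_) (sym (orbit-fixed fixed)) (here refl)
    by-cases true  fixed (inj₂ refl) = subst (σ h ∈_) (sym (orbit-fixed fixed)) (here (from-true (eqDiag-reflects (σ h) h) fixed))
    by-cases false moved (inj₁ refl) = subst (h ∈_) (sym (orbit-moved moved)) (here refl)
    by-cases false moved (inj₂ refl) = subst (σ h ∈_) (sym (orbit-moved moved)) (there (here refl))

  ∈orbits⁺ : ∀ {x h} H → h ∈ H → x ≡ h ⊎ x ≡ σ h → x ∈ orbits H
  ∈orbits⁺ (h ∷ H) (here refl) x≡ = ∈-++⁺ˡ (∈orbit⁺ x≡)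
  ∈orbits⁺ (h ∷ H) (there h∈) x≡ = ∈-++⁺ʳ (orbit h) (∈orbits⁺ H h∈ x≡)

  diagonals⊆orbits : diagonals (suc c) ⊆ orbits representatives
  diagonals⊆orbits {i , j} d∈ with ∈diagonals⁻ d∈ | i + j ≤? c
  ... | D | yes i+j≤c = ∈orbits⁺ representatives (∈pairsWith⁺ Representative? (Chord⇒< (proj₁ D)) (s≤s j≤c) (D , i+j≤c)) (inj₁ refl)
    where
    j≤c : j ≤ c
    j≤c = proj₂ (Diagonal-inRange D)
  ... | D | no  i+j≰c = ∈orbits⁺ representatives σd∈ (inj₂ (sym (σ-involutive (Diagonal-inRange D))))
    where
    σD : Diagonal 0 c (σ (i , j))
    σD = Diagonal-σ D
    i≤c : i ≤ c
    i≤c = proj₁ (Diagonal-inRange D)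
    c-j+c-i≤c : (c ∸ j) + (c ∸ i) ≤ c
    c-j+c-i≤c = m≤o∸n⇒m+n≤o (c ∸ j) (m∸n≤m c i)
      (subst (c ∸ j ≤_) (sym (m∸[m∸n]≡n i≤c)) (m≤n+o⇒m∸n≤o c j (subst (c ≤_) (+-comm i j) (<⇒≤ (≰⇒> i+j≰c)))))
    σd∈ : σ (i , j) ∈ representatives
    σd∈ = ∈pairsWith⁺ Representative? (Chord⇒< (proj₁ σD)) (s≤s (m∸n≤m c i)) (σD , c-j+c-i≤c)

  orbits⊆diagonals : orbits representatives ⊆ diagonals (suc c)
  orbits⊆diagonals x∈ with ∈orbits⁻ representatives x∈
  ... | h , h∈ , inj₁ refl = ∈diagonals⁺ (proj₁ (∈pairsWith⁻ Representative? h∈))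
  ... | h , h∈ , inj₂ refl = ∈diagonals⁺ (Diagonal-σ (proj₁ (∈pairsWith⁻ Representative? h∈)))

  #symmetricNC-diagonals : #subsets symmetricNC (diagonals (suc c)) ≡ #symmetric representatives
  #symmetricNC-diagonals = #subsets-↭ symmetricNC symmetricNC-↭
    (∼bag⇒↭ (unique∧set⇒bag (diagonals-unique c) (orbits-unique representatives-Representatives)
                             (mk⇔ diagonals⊆orbits orbits⊆diagonals)))

  -- a good representative is left of the axis or crosses it as (i , c - i); the latter become chords (i , K+1)
  collapse : Diag → Diag
  collapse (i , j) = if j ≤ᵇ K then (i , j) else (i , suc K)

  collapse-left : ∀ {i j} → j ≤ K → collapse (i , j) ≡ (i , j)
  collapse-left {i} {j} j≤K rewrite to-true (≤ᵇ-reflects-≤ j K) j≤K = refl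

  collapse-axis : ∀ {i j} → K < j → collapse (i , j) ≡ (i , suc K)
  collapse-axis {i} {j} K<j rewrite to-false (≤ᵇ-reflects-≤ j K) (<⇒≱ K<j) = refl

  K≤c : K ≤ c
  K≤c = ≤-trans (m≤m+n K K) K+K≤c

  K≤c∸ : ∀ {j} → j ≤ K → K ≤ c ∸ j
  K≤c∸ j≤K = ≤-trans (m+n≤o⇒m≤o∸n K K+K≤c) (∸-monoʳ-≤ c j≤K)

  axis-fixed : ∀ {i j} → i + j ≡ c → σ (i , j) ≡ (i , j)
  axis-fixed {i} {j} i+j≡c = cong₂ _,_ (trans (cong (_∸ j) (sym i+j≡c)) (m+n∸n≡m i j)) (trans (cong (_∸ i) (sym i+j≡c)) (m+n∸m≡n i j))

  data GoodView (i j : ℕ) : Set where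
    left : j ≤ K → GoodView i j
    axis : i + j ≡ c → K < j → GoodView i j

  goodView : ∀ {i j} → Representative (i , j) → good (i , j) ≡ true → GoodView i j
  goodView {i} {j} (D , i+j≤c) good-h with j ≤? K | i + j ≟ c
  ... | yes j≤K | _         = left j≤K
  ... | no  j≰K | yes i+j≡c = axis i+j≡c (≰⇒> j≰K)
  ... | no  j≰K | no  i+j≢c = ⊥-elim (from-true (avoids-reflects (i , j) (σ (i , j))) good-h (inj₁ (i<c-j , c-j<j , j<c-i)))
    where
    i+j<c : i + j < c
    i+j<c = ≤∧≢⇒< i+j≤c i+j≢c
    i<c-j : i < c ∸ j
    i<c-j = m+n≤o⇒m≤o∸n (suc i) i+j<c
    c-j<j : c ∸ j < j
    c-j<j = +-cancelʳ-< j (c ∸ j) j (subst (_< j + j) (sym (m∸n+n≡m (proj₂ (Diagonal-inRange D))))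
              (≤-<-trans c≤1+K+K (subst (_≤ j + j) (cong suc (+-suc K K)) (+-mono-≤ (≰⇒> j≰K) (≰⇒> j≰K)))))
    j<c-i : j < c ∸ i
    j<c-i = m+n≤o⇒m≤o∸n (suc j) (subst (_≤ c) (cong suc (+-comm i j)) i+j<c)

  not-∧-not : ∀ a b → not (not a ∧ not b) ≡ a ∨ b
  not-∧-not true  b     = refl
  not-∧-not false true  = refl
  not-∧-not false false = refl

  crosses-collapse : ∀ {h h′} → Representative h → Representative h′ → good h ≡ true → good h′ ≡ true →
                     crosses (collapse h) (collapse h′) ≡ not (compatible h h′)
  crosses-collapse {i , j} {i′ , j′} R R′ good-h good-h′ =
    trans (by-views (goodView R good-h) (goodView R′ good-h′)) (sym (not-∧-not (crosses h h′) (crosses (σ h) h′)))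
    where
    h h′ : Diag
    h = (i , j)
    h′ = (i′ , j′)
    i<j′ : i′ < j′
    i<j′ = Chord⇒< (proj₁ (proj₁ R′))
    σh-crosses : i + j ≡ c → crosses (σ h) h′ ≡ crosses h h′
    σh-crosses i+j≡c = cong (λ x → crosses x h′) (axis-fixed i+j≡c)
    σh-crosses′ : i′ + j′ ≡ c → crosses (σ h) h′ ≡ crosses h h′
    σh-crosses′ i′+j′≡c = trans (cong (crosses (σ h)) (sym (axis-fixed i′+j′≡c)))
                                (crosses-σ (Diagonal-inRange (proj₁ R)) (Diagonal-inRange (proj₁ R′)))
    by-views : GoodView i j → GoodView i′ j′ → crosses (collapse h) (collapse h′) ≡ crosses h h′ ∨ crosses (σ h) h′
    by-views (left j≤K) (left j′≤K) =
      trans (cong₂ crosses (collapse-left j≤K) (collapse-left j′≤K)) (sym (trans (cong (crosses h h′ ∨_) σh-avoids) (∨-identityʳ _)))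
      where
      σh-avoids : crosses (σ h) h′ ≡ false
      σh-avoids = to-false (crosses-reflects (σ h) h′) λ
        { (inj₁ (c-j<i′ , _ , _)) → <⇒≱ c-j<i′ (≤-trans (<⇒≤ (≤-trans i<j′ j′≤K)) (K≤c∸ j≤K))
        ; (inj₂ (_ , c-j<j′ , _)) → <⇒≱ c-j<j′ (≤-trans j′≤K (K≤c∸ j≤K)) }
    by-views (left j≤K) (axis i′+j′≡c K<j′) =
      trans (cong₂ crosses (collapse-left j≤K) (collapse-axis K<j′))
            (trans (reflects-≡ (crosses-reflects h (i′ , suc K)) (crosses-reflects h h′) to from)
                   (sym (trans (cong (crosses h h′ ∨_) (σh-crosses′ i′+j′≡c)) (∨-idem _))))
      where
      to : Cross h (i′ , suc K) → Cross h h′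
      to (inj₁ (i<i′ , i′<j , _))  = inj₁ (i<i′ , i′<j , ≤-<-trans j≤K K<j′)
      to (inj₂ (_ , _ , 1+K<j))    = ⊥-elim (<⇒≱ 1+K<j (≤-trans j≤K (n≤1+n K)))
      from : Cross h h′ → Cross h (i′ , suc K)
      from (inj₁ (i<i′ , i′<j , _)) = inj₁ (i<i′ , i′<j , s≤s j≤K)
      from (inj₂ (_ , _ , j′<j))    = ⊥-elim (<⇒≱ j′<j (≤-trans j≤K (<⇒≤ K<j′)))
    by-views (axis i+j≡c K<j) (left j′≤K) =
      trans (cong₂ crosses (collapse-axis K<j) (collapse-left j′≤K))
            (trans (reflects-≡ (crosses-reflects (i , suc K) h′) (crosses-reflects h h′) to from)
                   (sym (trans (cong (crosses h h′ ∨_) (σh-crosses i+j≡c)) (∨-idem _))))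
      where
      to : Cross (i , suc K) h′ → Cross h h′
      to (inj₁ (_ , _ , 1+K<j′))     = ⊥-elim (<⇒≱ 1+K<j′ (≤-trans j′≤K (n≤1+n K)))
      to (inj₂ (i′<i , i<j′ , _))    = inj₂ (i′<i , i<j′ , ≤-<-trans j′≤K K<j)
      from : Cross h h′ → Cross (i , suc K) h′
      from (inj₁ (_ , _ , j<j′))     = ⊥-elim (<⇒≱ j<j′ (≤-trans j′≤K (<⇒≤ K<j)))
      from (inj₂ (i′<i , i<j′ , _))  = inj₂ (i′<i , i<j′ , s≤s j′≤K)
    by-views (axis i+j≡c K<j) (axis i′+j′≡c K<j′) =
      trans (cong₂ crosses (collapse-axis K<j) (collapse-axis K<j′))
            (trans (to-false (crosses-reflects (i , suc K) (i′ , suc K))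
                     λ { (inj₁ (_ , _ , w)) → <-irrefl refl w ; (inj₂ (_ , _ , w)) → <-irrefl refl w })
                   (sym (trans (cong (crosses h h′ ∨_) (σh-crosses i+j≡c)) (trans (∨-idem _) nested))))
      where
      nested : crosses h h′ ≡ false
      nested = to-false (crosses-reflects h h′) λ
        { (inj₁ (i<i′ , _ , j<j′)) → <-irrefl (trans i+j≡c (sym i′+j′≡c)) (+-mono-< i<i′ j<j′)
        ; (inj₂ (i′<i , _ , j′<j)) → <-irrefl (trans i′+j′≡c (sym i+j≡c)) (+-mono-< i′<i j′<j) }

  good-axis : ∀ {i j} → i + j ≡ c → good (i , j) ≡ true
  good-axis {i} {j} i+j≡c = cong not (trans (cong (crosses (i , j)) (axis-fixed i+j≡c)) (crosses-irrefl (i , j)))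

  good-left : ∀ {i j} → Representative (i , j) → j ≤ K → good (i , j) ≡ true
  good-left (_ , i+j≤c) j≤K = to-true (avoids-reflects _ _) λ
    { (inj₁ (_ , c-j<j , _)) → <⇒≱ c-j<j (≤-trans j≤K (K≤c∸ j≤K))
    ; (inj₂ (c-j<i , _ , _)) → <⇒≱ c-j<i (m+n≤o⇒m≤o∸n _ i+j≤c) }

  goodRepresentatives : List Diag
  goodRepresentatives = filterᵇ good representatives

  ∈goodRepresentatives⁻ : ∀ {h} → h ∈ goodRepresentatives → Representative h × good h ≡ true
  ∈goodRepresentatives⁻ h∈ = let h∈R , good-h = ∈-filter⁻ (T? ∘ good) {xs = representatives} h∈ in
    ∈pairsWith⁻ Representative? h∈R , Equivalence.to T-≡ good-h

  ∈goodRepresentatives⁺ : ∀ {i j} → Representative (i , j) → good (i , j) ≡ true → (i , j) ∈ goodRepresentatives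
  ∈goodRepresentatives⁺ R@(D , _) good-h =
    ∈-filter⁺ (T? ∘ good) (∈pairsWith⁺ Representative? (Chord⇒< (proj₁ D)) (s≤s (proj₂ (Diagonal-inRange D))) R)
              (Equivalence.from T-≡ good-h)

  collapse-injective : ∀ {x y} → x ∈ goodRepresentatives → y ∈ goodRepresentatives → collapse x ≡ collapse y → x ≡ y
  collapse-injective {i , j} {i′ , j′} x∈ y∈ eq
    with ∈goodRepresentatives⁻ x∈ | ∈goodRepresentatives⁻ y∈
  ... | R , good-x | R′ , good-y with goodView R good-x | goodView R′ good-y
  ... | left j≤K | left j′≤K = trans (sym (collapse-left j≤K)) (trans eq (collapse-left j′≤K))
  ... | left j≤K | axis _ K<j′ =
    ⊥-elim (1+n≰n (subst (_≤ K) (cong proj₂ (trans (sym (collapse-left j≤K)) (trans eq (collapse-axis K<j′)))) j≤K))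
  ... | axis _ K<j | left j′≤K =
    ⊥-elim (1+n≰n (subst (_≤ K) (cong proj₂ (trans (sym (collapse-left j′≤K)) (trans (sym eq) (collapse-axis K<j)))) j′≤K))
  ... | axis i+j≡c K<j | axis i′+j′≡c K<j′ = cong₂ _,_ i≡i′ (begin
    j             ≡⟨ m+n∸m≡n i j ⟨
    i + j ∸ i     ≡⟨ cong₂ _∸_ (trans i+j≡c (sym i′+j′≡c)) i≡i′ ⟩
    i′ + j′ ∸ i′  ≡⟨ m+n∸m≡n i′ j′ ⟩
    j′            ∎)
    where
    open ≡-Reasoning
    i≡i′ : i ≡ i′
    i≡i′ = cong proj₁ (trans (sym (collapse-axis K<j)) (trans eq (collapse-axis K<j′)))

  unique-map-injectiveOn : ∀ (f : Diag → Diag) {xs} → Unique xs → (∀ {x y} → x ∈ xs → y ∈ xs → f x ≡ f y → x ≡ y) → Unique (map f xs)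
  unique-map-injectiveOn f {[]}     _                     _   = AllPairs.[]
  unique-map-injectiveOn f {x ∷ xs} (x∉xs AllPairs.∷ xs!) inj =
    All.tabulate (λ fy∈ fx≡fy → let y , y∈ , fy≡ = ∈-map⁻ f fy∈ in All.lookup x∉xs y∈ (inj (here refl) (there y∈) (trans fx≡fy fy≡)))
    AllPairs.∷ unique-map-injectiveOn f xs! (λ y∈ z∈ → inj (there y∈) (there z∈))

  collapse-Diagonal : ∀ {i j} → Representative (i , j) → GoodView i j → Diagonal 0 (suc K) (collapse (i , j))
  collapse-Diagonal {i} {j} (((_ , 2+i≤j , _) , _) , _) (left j≤K) =
    subst (Diagonal 0 (suc K)) (sym (collapse-left j≤K))
      ((z≤n , 2+i≤j , m≤n⇒m≤1+n j≤K) , λ (_ , j≡1+K) → 1+n≰n (subst (_≤ K) j≡1+K j≤K))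
  collapse-Diagonal {i} {j} (((_ , 2+i≤j , _) , ¬side) , _) (axis i+j≡c K<j) =
    subst (Diagonal 0 (suc K)) (sym (collapse-axis K<j))
      ((z≤n , s≤s 1+i≤K , ≤-refl) , λ { (refl , _) → ¬side (refl , i+j≡c) })
    where
    half : ∀ {i} → suc (i + i) ≤ K + K → suc i ≤ K
    half {i} 1+2i≤2K = ≰⇒> λ K≤i → <⇒≱ 1+2i≤2K (+-mono-≤ K≤i K≤i)
    1+i≤K : suc i ≤ K
    1+i≤K = half (≤-pred (≤-trans (+-monoˡ-≤ i 2+i≤j) (≤-trans (≤-reflexive (trans (+-comm j i) i+j≡c)) c≤1+K+K)))

  left-Representative : ∀ {x y} → Diagonal 0 (suc K) (x , y) → y ≤ K → Representative (x , y)
  left-Representative {x} {y} (chord@(_ , 2+x≤y , _) , _) y≤K = ((z≤n , 2+x≤y , y≤c) , ¬side) , x+y≤c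
    where
    y≤c : y ≤ c
    y≤c = ≤-trans y≤K K≤c
    x+y≤c : x + y ≤ c
    x+y≤c = ≤-trans (+-mono-≤ (≤-trans (<⇒≤ (Chord⇒< chord)) y≤K) y≤K) K+K≤c
    ¬side : ¬ (x ≡ 0 × y ≡ c)
    ¬side (refl , y≡c) = 1+n≰n (≤-trans (n≤1+n (suc K)) (≤-trans (+-monoˡ-≤ K (≤-trans 2+x≤y y≤K)) (≤-trans K+K≤c (subst (_≤ K) y≡c y≤K))))

  module _ {x} (1≤x : 1 ≤ x) (2+x≤1+K : 2 + x ≤ suc K) where

    private
      1+x≤K : suc x ≤ K
      1+x≤K = ≤-pred 2+x≤1+K
      x≤c : x ≤ c
      x≤c = ≤-trans (≤-trans (n≤1+n x) 1+x≤K) K≤c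

    axis-Representative : Representative (x , c ∸ x)
    axis-Representative = ((z≤n , 2+x≤c-x , m∸n≤m c x) , λ (x≡0 , _) → 1+n≰n (subst (1 ≤_) x≡0 1≤x)) , ≤-reflexive (m+[n∸m]≡n x≤c)
      where
      2+x≤c-x : 2 + x ≤ c ∸ x
      2+x≤c-x = m+n≤o⇒m≤o∸n (2 + x) (≤-trans (subst (_≤ K + K) (cong suc (+-suc x x)) (+-mono-≤ 1+x≤K 1+x≤K)) K+K≤c)

    K<c∸x : K < c ∸ x
    K<c∸x = m+n≤o⇒m≤o∸n (suc K) (≤-trans (subst (_≤ K + K) (+-suc K x) (+-monoʳ-≤ K 1+x≤K)) K+K≤c)

  collapse⊆diagonals : map collapse goodRepresentatives ⊆ diagonals (suc (suc K))
  collapse⊆diagonals z∈ with ∈-map⁻ collapse z∈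
  ... | h , h∈ , refl with ∈goodRepresentatives⁻ h∈
  ...   | R , good-h = ∈diagonals⁺ (collapse-Diagonal R (goodView R good-h))

  diagonals⊆collapse : diagonals (suc (suc K)) ⊆ map collapse goodRepresentatives
  diagonals⊆collapse {x , y} d∈ with ∈diagonals⁻ d∈ | y ≤? K
  ... | D | yes y≤K =
    subst (_∈ map collapse goodRepresentatives) (collapse-left y≤K)
      (∈-map⁺ collapse (∈goodRepresentatives⁺ R (good-left R y≤K)))
    where
    R : Representative (x , y)
    R = left-Representative D y≤K
  ... | D | no y≰K with ≤-antisym (proj₂ (proj₂ (proj₁ D))) (≰⇒> y≰K)
  ...   | refl = axis-∈ D
    where
    axis-∈ : ∀ {x} → Diagonal 0 (suc K) (x , suc K) → (x , suc K) ∈ map collapse goodRepresentatives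
    axis-∈ {zero}  (_ , ¬side)             = ⊥-elim (¬side (refl , refl))
    axis-∈ {suc x} ((_ , 2+x≤1+K , _) , _) =
      subst (_∈ map collapse goodRepresentatives) (collapse-axis (K<c∸x (s≤s z≤n) 2+x≤1+K))
        (∈-map⁺ collapse (∈goodRepresentatives⁺ (axis-Representative (s≤s z≤n) 2+x≤1+K) (good-axis {suc x} {c ∸ suc x} (m+[n∸m]≡n x≤c))))
      where
      x≤c : suc x ≤ c
      x≤c = ≤-trans (≤-pred (≤-trans (n≤1+n _) 2+x≤1+K)) K≤c

  #nc-collapse : #nc (map collapse goodRepresentatives) ≡ #dissections (suc K)
  #nc-collapse =
    #nc-ext (unique-map-injectiveOn collapse (Unique.filter⁺ (T? ∘ good) (pairsWith-unique Representative? (suc c))) collapse-injective)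
            (diagonals-unique (suc K)) collapse⊆diagonals diagonals⊆collapse

  #symmetricNC≡#dissections : #subsets symmetricNC (diagonals (suc c)) ≡ #dissections (suc K)
  #symmetricNC≡#dissections =
    trans #symmetricNC-diagonals
      (trans (#symmetric≡#nc-map collapse representatives-Representatives
               (λ h∈ h′∈ → crosses-collapse (∈pairsWith⁻ Representative? h∈) (∈pairsWith⁻ Representative? h′∈)))
             #nc-collapse)

module ReflectiveCounts where

  open import Data.List.Base using (length; filterᵇ)
  open import Data.Nat.Base
  open import Data.Nat.Properties
  open import Relation.Binary.PropositionalEquality
  open Counting
  open SchröderRecurrence using (littleSchröder; littleSchröder≡#dissections)

  #reflective : ℕ → ℕ
  #reflective n = length (reflDissections n)

  #reflective≡#symmetricNC : ∀ c → #reflective (2 + c) ≡ #subsets (Reflection.symmetricNC (suc c)) (diagonals (2 + c))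
  #reflective≡#symmetricNC c =
    trans (length-filterᵇ (symmetric (2 + c)) (filterᵇ nonCrossing (subsets (diagonals (2 + c)))))
          (count-filterᵇ (symmetric (2 + c)) nonCrossing (subsets (diagonals (2 + c))))

  double : ℕ → ℕ
  double zero    = 0
  double (suc m) = suc (suc (double m))

  double≡+ : ∀ m → double m ≡ m + m
  double≡+ zero    = refl
  double≡+ (suc m) = cong suc (trans (cong suc (double≡+ m)) (sym (+-suc m m)))

  parity-cases : ∀ (P : ℕ → Set) → (∀ k → P (double k)) → (∀ k → P (suc (double k))) → ∀ n → P n
  parity-cases P even odd zero          = even 0
  parity-cases P even odd (suc zero)    = odd 0
  parity-cases P even odd (suc (suc n)) = parity-cases (λ m → P (suc (suc m))) (λ k → even (suc k)) (λ k → odd (suc k)) n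

  #reflective-even : ∀ m → #reflective (double (suc m)) ≡ littleSchröder (suc m)
  #reflective-even m =
    trans (#reflective≡#symmetricNC (double m))
      (trans (Halving.#symmetricNC≡#dissections (suc (double m)) m (≤-trans (≤-reflexive (sym (double≡+ m))) (n≤1+n _))
                                                 (s≤s (≤-reflexive (double≡+ m))))
             (sym (littleSchröder≡#dissections m)))

  #reflective-odd : ∀ m → #reflective (suc (double (suc m))) ≡ littleSchröder (2 + m)
  #reflective-odd m =
    trans (#reflective≡#symmetricNC (suc (double m)))
      (trans (Halving.#symmetricNC≡#dissections (double (suc m)) (suc m) (≤-reflexive (sym (double≡+ (suc m))))
                                                 (≤-trans (≤-reflexive (double≡+ (suc m))) (n≤1+n _)))
             (sym (littleSchröder≡#dissections (suc m))))

module CycleType where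

  open import Data.Bool.Base using (Bool; true; false; not; _∧_; if_then_else_)
  open import Data.Bool.Properties using (∧-identityʳ)
  open import Data.List.Base using ([]; _∷_; length; filterᵇ; upTo)
  open import Data.List.Properties using (upTo-∷ʳ)
  open import Data.Nat.Base
  open import Data.Nat.Properties
  open import Data.Nat.DivMod using (m*n/n≡m)
  open import Function.Base using (_∘′_)
  open import Relation.Binary.PropositionalEquality
  open import Relation.Nullary.Decidable using (yes; no)
  open Polygon using (to-true; to-false; ≡ᵇ-reflects-≡)
  open Counting
  open ReflectiveCounts using (double; double≡+)

  count-upTo-suc : ∀ (p : ℕ → Bool) n → count p (upTo (suc n)) ≡ count p (upTo n) + (if p n then 1 else 0)
  count-upTo-suc p n =
    trans (cong (count p) (sym (upTo-∷ʳ n))) (trans (count-++ p (upTo n) (n ∷ [])) (cong (count p (upTo n) +_) (+-identityʳ _)))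

  count-upTo-cong : ∀ (p q : ℕ → Bool) n → (∀ i → i < n → p i ≡ q i) → count p (upTo n) ≡ count q (upTo n)
  count-upTo-cong p q zero    p≗q = refl
  count-upTo-cong p q (suc n) p≗q =
    trans (count-upTo-suc p n)
      (trans (cong₂ (λ a b → a + (if b then 1 else 0)) (count-upTo-cong p q n (λ i i<n → p≗q i (m<n⇒m<1+n i<n))) (p≗q n ≤-refl))
             (sym (count-upTo-suc q n)))

  count-upTo-none : ∀ (p : ℕ → Bool) n → (∀ i → i < n → p i ≡ false) → count p (upTo n) ≡ 0
  count-upTo-none p n none = trans (count-upTo-cong p (λ _ → false) n none) (all-false n)
    where
    all-false : ∀ n → count (λ _ → false) (upTo n) ≡ 0
    all-false zero    = refl
    all-false (suc n) = trans (count-upTo-suc (λ _ → false) n) (trans (+-identityʳ _) (all-false n))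

  count-upTo-one : ∀ (p : ℕ → Bool) n t → t < n → p t ≡ true → (∀ i → i < n → i ≢ t → p i ≡ false) → count p (upTo n) ≡ 1
  count-upTo-one p (suc n) t t<1+n pt others with t ≟ n
  ... | yes refl = trans (count-upTo-suc p n)
                     (cong₂ (λ a b → a + (if b then 1 else 0))
                            (count-upTo-none p n (λ i i<n → others i (m<n⇒m<1+n i<n) (λ i≡n → <-irrefl i≡n i<n))) pt)
  ... | no  t≢n  = trans (count-upTo-suc p n)
                     (trans (cong₂ (λ a b → a + (if b then 1 else 0))
                              (count-upTo-one p n t (≤∧≢⇒< (≤-pred t<1+n) t≢n) pt (λ i i<n → others i (m<n⇒m<1+n i<n)))
                              (others n ≤-refl (t≢n ∘′ sym)))
                            refl)

  count-upTo-not : ∀ (p : ℕ → Bool) n → count p (upTo n) + count (λ i → not (p i)) (upTo n) ≡ n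
  count-upTo-not p zero = refl
  count-upTo-not p (suc n)
    rewrite count-upTo-suc p n | count-upTo-suc (λ i → not (p i)) n with p n
  ... | true  = trans (cong₂ _+_ (+-comm (count p (upTo n)) 1) (+-identityʳ (count (λ i → not (p i)) (upTo n))))
                      (cong suc (count-upTo-not p n))
  ... | false = trans (cong₂ _+_ (+-identityʳ (count p (upTo n))) (+-comm (count (λ i → not (p i)) (upTo n)) 1))
                      (trans (+-suc (count p (upTo n)) _) (cong suc (count-upTo-not p n)))

  double-injective : ∀ {a b} → double a ≡ double b → a ≡ b
  double-injective {zero}  {zero}  _  = refl
  double-injective {suc a} {suc b} eq = cong suc (double-injective (suc-injective (suc-injective eq)))

  odd≢even : ∀ a b → suc (double a) ≢ double b
  odd≢even zero    (suc b) ()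
  odd≢even (suc a) (suc b) eq = odd≢even a b (suc-injective (suc-injective eq))

  j₁-even : ∀ t → j₁ (double t) ≡ 0
  j₁-even t = trans (length-filterᵇ _ (upTo (double t)))
    (count-upTo-none _ (double t) λ i i<2t → to-false (≡ᵇ-reflects-≡ _ _) (not-fixed t i i<2t))
    where
    not-fixed : ∀ t i → i < double t → double t ∸ 1 ∸ i ≢ i
    not-fixed zero     i ()
    not-fixed (suc t′) i i<2t eq =
      odd≢even t′ i (trans (sym (m∸n+n≡m {suc (double t′)} {i} (≤-pred i<2t))) (trans (cong (_+ i) eq) (sym (double≡+ i))))

  j₁-odd : ∀ t → j₁ (suc (double t)) ≡ 1
  j₁-odd t = trans (length-filterᵇ _ (upTo (suc (double t))))
    (count-upTo-one _ (suc (double t)) t (s≤s (≤-trans (m≤m+n t t) (≤-reflexive (sym (double≡+ t)))))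
      (to-true (≡ᵇ-reflects-≡ _ _) (trans (cong (_∸ t) (double≡+ t)) (m+n∸m≡n t t)))
      (λ i i<n i≢t → to-false (≡ᵇ-reflects-≡ _ _) λ eq →
        i≢t (double-injective (trans (double≡+ i) (trans (cong (_+ i) (sym eq)) (m∸n+n≡m (≤-pred i<n)))))))

  ρ-involutive : ∀ {n i} → i < n → ρ n (ρ n i) ≡ i
  ρ-involutive {suc n} i<n = m∸[m∸n]≡n (≤-pred i<n)

  -- the second test always holds since ρ is an involution
  #non-fixed : ∀ n → length (filterᵇ (λ i → not (ρ n i ≡ᵇ i) ∧ (ρ n (ρ n i) ≡ᵇ i)) (upTo n)) ≡ n ∸ j₁ n
  #non-fixed n = begin
    length (filterᵇ (λ i → not (ρ n i ≡ᵇ i) ∧ (ρ n (ρ n i) ≡ᵇ i)) (upTo n))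
      ≡⟨ length-filterᵇ _ (upTo n) ⟩
    count (λ i → not (ρ n i ≡ᵇ i) ∧ (ρ n (ρ n i) ≡ᵇ i)) (upTo n)
      ≡⟨ count-upTo-cong _ _ n (λ i i<n → trans (cong (not (ρ n i ≡ᵇ i) ∧_) (involutive i<n)) (∧-identityʳ _)) ⟩
    count (λ i → not (ρ n i ≡ᵇ i)) (upTo n)
      ≡⟨ m+n∸m≡n (count (λ i → ρ n i ≡ᵇ i) (upTo n)) _ ⟨
    count (λ i → ρ n i ≡ᵇ i) (upTo n) + count (λ i → not (ρ n i ≡ᵇ i)) (upTo n) ∸ count (λ i → ρ n i ≡ᵇ i) (upTo n)
      ≡⟨ cong₂ _∸_ (count-upTo-not (λ i → ρ n i ≡ᵇ i) n) (sym (length-filterᵇ _ (upTo n))) ⟩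
    n ∸ j₁ n ∎
    where
    open ≡-Reasoning
    involutive : ∀ {i} → i < n → (ρ n (ρ n i) ≡ᵇ i) ≡ true
    involutive i<n = to-true (≡ᵇ-reflects-≡ _ _) (ρ-involutive i<n)

  double/2 : ∀ t → double t / 2 ≡ t
  double/2 t = trans (cong (_/ 2) (trans (double≡+ t) (trans (cong (t +_) (sym (+-identityʳ t))) (*-comm 2 t)))) (m*n/n≡m t 2)

  j₂-even : ∀ t → j₂ (double t) ≡ t
  j₂-even t = trans (cong (_/ 2) (trans (#non-fixed (double t)) (cong (double t ∸_) (j₁-even t)))) (double/2 t)

  j₂-odd : ∀ t → j₂ (suc (double t)) ≡ t
  j₂-odd t = trans (cong (_/ 2) (trans (#non-fixed (suc (double t))) (cong (suc (double t) ∸_) (j₁-odd t)))) (double/2 t)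

module RationalSums where

  open import Data.Integer.Base as ℤ using ()
  import Data.Integer.Properties as ℤ
  open import Data.List.Base using (List; []; _∷_; map; length)
  open import Data.Maybe.Base using (Maybe; just; nothing)
  open import Data.Nat.Base as ℕ using (ℕ; zero; suc; _<_)
  import Data.Nat.Properties as ℕ
  import Data.Nat.Coprimality as Coprimality
  open import Data.Rational.Base using (ℚ; mkℚ; 0ℚ; 1ℚ; _+_; _*_)
  open import Data.Rational.Properties
  open import Relation.Binary.PropositionalEquality
  open import Relation.Nullary.Decidable using (yes; no)
  open import Tactic.RingSolver using (solve-∀)
  open import Tactic.RingSolver.Core.AlmostCommutativeRing using (AlmostCommutativeRing; fromCommutativeRing)
  open SchröderRecurrence using (Σℕ<)

  ℚ-ring : AlmostCommutativeRing _ _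
  ℚ-ring = fromCommutativeRing +-*-commutativeRing isZero
    where
    isZero : ∀ x → Maybe (0ℚ ≡ x)
    isZero x with 0ℚ ≟ x
    ... | yes 0≡x = just 0≡x
    ... | no  _   = nothing

  private
    ℚ+≡mkℚ : ∀ k → ℚ+ k ≡ mkℚ (ℤ.+ k) 0 (Coprimality.sym (Coprimality.1-coprimeTo k))
    ℚ+≡mkℚ k = normalize-coprime (Coprimality.sym (Coprimality.1-coprimeTo k))

  ℚ+-+ : ∀ a b → ℚ+ (a ℕ.+ b) ≡ ℚ+ a + ℚ+ b
  ℚ+-+ a b rewrite ℚ+≡mkℚ a | ℚ+≡mkℚ b =
    sym (cong (ℚ._/ 1) (trans (cong₂ ℤ._+_ (ℤ.*-identityʳ (ℤ.+ a)) (ℤ.*-identityʳ (ℤ.+ b))) (sym (ℤ.pos-+ a b))))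
    where import Data.Rational.Base as ℚ

  ℚ+-* : ∀ a b → ℚ+ (a ℕ.* b) ≡ ℚ+ a * ℚ+ b
  ℚ+-* a b rewrite ℚ+≡mkℚ a | ℚ+≡mkℚ b = sym (cong (ℚ._/ 1) (sym (ℤ.pos-* a b)))
    where import Data.Rational.Base as ℚ

  Σ<-cong : ∀ m g h → (∀ k → k < m → g k ≡ h k) → Σ< m g ≡ Σ< m h
  Σ<-cong zero    g h g≗h = refl
  Σ<-cong (suc m) g h g≗h = cong₂ _+_ (Σ<-cong m g h (λ k k<m → g≗h k (ℕ.m<n⇒m<1+n k<m))) (g≗h m ℕ.≤-refl)

  Σ<-+ : ∀ m g h → Σ< m (λ k → g k + h k) ≡ Σ< m g + Σ< m h
  Σ<-+ zero    g h = refl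
  Σ<-+ (suc m) g h = trans (cong (_+ (g m + h m)) (Σ<-+ m g h)) (middle-swap (Σ< m g) (Σ< m h) (g m) (h m))
    where
    middle-swap : ∀ a b c d → (a + b) + (c + d) ≡ (a + c) + (b + d)
    middle-swap = solve-∀ ℚ-ring

  Σ<-*ˡ : ∀ m c g → Σ< m (λ k → c * g k) ≡ c * Σ< m g
  Σ<-*ˡ zero    c g = sym (*-zeroʳ c)
  Σ<-*ˡ (suc m) c g = trans (cong (_+ c * g m) (Σ<-*ˡ m c g)) (sym (*-distribˡ-+ c (Σ< m g) (g m)))

  Σ<-zero : ∀ m g → (∀ k → k < m → g k ≡ 0ℚ) → Σ< m g ≡ 0ℚ
  Σ<-zero m g g≗0 = trans (Σ<-cong m g (λ _ → 0ℚ) g≗0) (zeros m)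
    where
    zeros : ∀ m → Σ< m (λ _ → 0ℚ) ≡ 0ℚ
    zeros zero    = refl
    zeros (suc m) = cong (_+ 0ℚ) (zeros m)

  Σ<-cons : ∀ m g → Σ< (suc m) g ≡ g 0 + Σ< m (λ k → g (suc k))
  Σ<-cons zero    g = trans (+-identityˡ (g 0)) (sym (+-identityʳ (g 0)))
  Σ<-cons (suc m) g = trans (cong (_+ g (suc m)) (Σ<-cons m g)) (+-assoc (g 0) _ (g (suc m)))

  Σ<-single : ∀ m g k → k < m → (∀ i → i < m → i ≢ k → g i ≡ 0ℚ) → Σ< m g ≡ g k
  Σ<-single (suc m) g k k<1+m others with k ℕ.≟ m
  ... | yes refl = trans (cong (_+ g k) (Σ<-zero k g (λ i i<k → others i (ℕ.m<n⇒m<1+n i<k) (λ i≡k → ℕ.<-irrefl i≡k i<k))))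
                         (+-identityˡ (g k))
  ... | no  k≢m  = trans (cong₂ _+_ (Σ<-single m g k (ℕ.≤∧≢⇒< (ℕ.≤-pred k<1+m) k≢m) (λ i i<m → others i (ℕ.m<n⇒m<1+n i<m)))
                                    (others m ℕ.≤-refl (λ m≡k → k≢m (sym m≡k))))
                         (+-identityʳ (g k))

  ℚ+-Σℕ< : ∀ m g → ℚ+ (Σℕ< m g) ≡ Σ< m (λ k → ℚ+ (g k))
  ℚ+-Σℕ< zero    g = refl
  ℚ+-Σℕ< (suc m) g =
    trans (ℚ+-+ (g 0) _) (trans (cong (ℚ+ (g 0) +_) (ℚ+-Σℕ< m (λ k → g (suc k)))) (sym (Σ<-cons m (λ k → ℚ+ (g k)))))

  sumℚ-const : ∀ {A : Set} (L : List A) x → sumℚ (map (λ _ → x) L) ≡ ℚ+ (length L) * x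
  sumℚ-const []      x = sym (*-zeroˡ x)
  sumℚ-const (_ ∷ L) x =
    trans (cong (x +_) (sumℚ-const L x))
      (trans (cong (_+ ℚ+ (length L) * x) (sym (*-identityˡ x)))
        (trans (sym (*-distribʳ-+ x 1ℚ (ℚ+ (length L)))) (cong (_* x) (sym (ℚ+-+ 1 (length L))))))

module OrientedSeries where

  open import Data.Nat.Base as ℕ using (ℕ; zero; suc; _∸_; _<_)
  import Data.Nat.Properties as ℕ
  open import Data.Product.Base using (_×_; _,_; Σ-syntax)
  open import Data.Rational.Base using (ℚ; 0ℚ; 1ℚ; _+_; _*_; -_; _-_)
  open import Data.Rational.Properties
  open import Relation.Binary.PropositionalEquality
  open import Tactic.RingSolver using (solve-∀)
  open SchröderRecurrence using (littleSchröder; schröderConvolution; littleSchröder-recurrence)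
  open RationalSums

  ⊛-⊖-scale : ∀ A B C D k n →
    ((A ⊖ scale k B) ⊛ (C ⊖ scale k D)) n ≡ (A ⊛ C) n - k * (A ⊛ D) n - k * (B ⊛ C) n + k * k * (B ⊛ D) n
  ⊛-⊖-scale A B C D k n = begin
    Σ< (suc n) (λ i → (A i - k * B i) * (C (n ∸ i) - k * D (n ∸ i)))
      ≡⟨ Σ<-cong (suc n) _ _ (λ i _ → expand (A i) (B i) (C (n ∸ i)) (D (n ∸ i)) k) ⟩
    Σ< (suc n) (λ i → A i * C (n ∸ i) + (- k) * (A i * D (n ∸ i)) + (- k) * (B i * C (n ∸ i)) + k * k * (B i * D (n ∸ i)))
      ≡⟨ trans (Σ<-+ (suc n) _ _) (cong₂ _+_ (trans (Σ<-+ (suc n) _ _) (cong₂ _+_ (trans (Σ<-+ (suc n) _ _)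
                 (cong ((A ⊛ C) n +_) (Σ<-*ˡ (suc n) (- k) _))) (Σ<-*ˡ (suc n) (- k) _))) (Σ<-*ˡ (suc n) (k * k) _)) ⟩
    (A ⊛ C) n + (- k) * (A ⊛ D) n + (- k) * (B ⊛ C) n + k * k * (B ⊛ D) n
      ≡⟨ regroup ((A ⊛ C) n) ((A ⊛ D) n) ((B ⊛ C) n) ((B ⊛ D) n) k ⟩
    (A ⊛ C) n - k * (A ⊛ D) n - k * (B ⊛ C) n + k * k * (B ⊛ D) n ∎
    where
    open ≡-Reasoning
    expand : ∀ a b c d k → (a - k * b) * (c - k * d) ≡ a * c + (- k) * (a * d) + (- k) * (b * c) + k * k * (b * d)
    expand = solve-∀ ℚ-ring
    regroup : ∀ ac ad bc bd k → ac + (- k) * ad + (- k) * bc + k * k * bd ≡ ac - k * ad - k * bc + k * k * bd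
    regroup = solve-∀ ℚ-ring

  s₁-⊛ : ∀ G n → (s₁ ⊛ G) (suc n) ≡ G n
  s₁-⊛ G n = begin
    Σ< (suc (suc n)) (λ k → s₁ k * G (suc n ∸ k))
      ≡⟨ Σ<-cons (suc n) _ ⟩
    0ℚ * G (suc n) + Σ< (suc n) (λ k → s₁ (suc k) * G (n ∸ k))
      ≡⟨ cong₂ _+_ (*-zeroˡ (G (suc n))) (Σ<-cons n _) ⟩
    0ℚ + (1ℚ * G n + Σ< n (λ k → 0ℚ * G (n ∸ suc k)))
      ≡⟨ cong (λ x → 0ℚ + (x + Σ< n (λ k → 0ℚ * G (n ∸ suc k)))) (*-identityˡ (G n)) ⟩
    0ℚ + (G n + Σ< n (λ k → 0ℚ * G (n ∸ suc k)))
      ≡⟨ trans (+-identityˡ _) (cong (G n +_) (Σ<-zero n _ (λ k _ → *-zeroˡ (G (n ∸ suc k))))) ⟩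
    G n + 0ℚ
      ≡⟨ +-identityʳ (G n) ⟩
    G n ∎
    where open ≡-Reasoning

  s₁+1-⊛ : ∀ G n → (s₁+1 ⊛ G) (suc n) ≡ G (suc n) + G n
  s₁+1-⊛ G n =
    trans (Σ<-cons (suc n) _) (cong₂ _+_ (*-identityˡ (G (suc n)))
      (trans (Σ<-cons n _) (trans (cong₂ _+_ (*-identityˡ (G n)) (Σ<-zero n _ (λ k _ → *-zeroˡ (G (n ∸ suc k))))) (+-identityʳ (G n)))))

  ⊛-s₁+1 : ∀ G n → (G ⊛ s₁+1) (suc n) ≡ G (suc n) + G n
  ⊛-s₁+1 G n = begin
    Σ< n (λ k → G k * s₁+1 (suc n ∸ k)) + G n * s₁+1 (suc n ∸ n) + G (suc n) * s₁+1 (suc n ∸ suc n)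
      ≡⟨ cong₂ (λ x y → Σ< n (λ k → G k * s₁+1 (suc n ∸ k)) + G n * s₁+1 x + G (suc n) * s₁+1 y) (ℕ.m+n∸n≡m 1 n) (ℕ.n∸n≡0 n) ⟩
    Σ< n (λ k → G k * s₁+1 (suc n ∸ k)) + G n * 1ℚ + G (suc n) * 1ℚ
      ≡⟨ cong₂ (λ x y → x + G n * 1ℚ + y) (Σ<-zero n _ high) (*-identityʳ (G (suc n))) ⟩
    0ℚ + G n * 1ℚ + G (suc n)
      ≡⟨ trans (cong (_+ G (suc n)) (trans (+-identityˡ _) (*-identityʳ (G n)))) (+-comm (G n) (G (suc n))) ⟩
    G (suc n) + G n ∎
    where
    open ≡-Reasoning
    high : ∀ k → k < n → G k * s₁+1 (suc n ∸ k) ≡ 0ℚ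
    high k k<n = trans (cong (G k *_) (vanishing (suc n ∸ k) 2≤1+n-k)) (*-zeroʳ (G k))
      where
      vanishing : ∀ m → 2 ℕ.≤ m → s₁+1 m ≡ 0ℚ
      vanishing (suc (suc m)) _            = refl
      vanishing (suc zero)    (ℕ.s≤s ())
      2≤1+n-k : 2 ℕ.≤ suc n ∸ k
      2≤1+n-k = ℕ.≤-trans (ℕ.s≤s (ℕ.m<n⇒0<n∸m k<n)) (ℕ.≤-reflexive (sym (ℕ.+-∸-assoc 1 (ℕ.<⇒≤ k<n))))

  F : Series
  F m = ℚ+ (littleSchröder m)

  F⊛F : ∀ n → (F ⊛ F) n ≡ ℚ+ (schröderConvolution n)
  F⊛F n = trans (Σ<-cong (suc n) _ _ (λ k _ → sym (ℚ+-* (littleSchröder k) (littleSchröder (n ∸ k)))))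
                (sym (ℚ+-Σℕ< (suc n) (λ k → littleSchröder k ℕ.* littleSchröder (n ∸ k))))

  F-recurrence : ∀ q → F (suc (suc q)) + F (suc q) ≡ ℚ+ 2 * ℚ+ (schröderConvolution (suc (suc q)))
  F-recurrence q =
    trans (sym (ℚ+-+ (littleSchröder (suc (suc q))) (littleSchröder (suc q))))
      (trans (cong ℚ+ (littleSchröder-recurrence q)) (ℚ+-* 2 (schröderConvolution (suc (suc q)))))

  √P-oo : Series
  √P-oo = s₁+1 ⊖ scale (ℚ+ 4) F

  √P-oo-squared : √P-oo ⊛ √P-oo ≈ P-oo
  √P-oo-squared zero          = refl
  √P-oo-squared (suc zero)    = refl
  √P-oo-squared (suc (suc q)) = begin
    (√P-oo ⊛ √P-oo) n
      ≡⟨ ⊛-⊖-scale s₁+1 F s₁+1 F (ℚ+ 4) n ⟩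
    (s₁+1 ⊛ s₁+1) n - ℚ+ 4 * (s₁+1 ⊛ F) n - ℚ+ 4 * (F ⊛ s₁+1) n + ℚ+ 4 * ℚ+ 4 * (F ⊛ F) n
      ≡⟨ cong₂ (λ x y → x - ℚ+ 4 * y - ℚ+ 4 * (F ⊛ s₁+1) n + ℚ+ 4 * ℚ+ 4 * (F ⊛ F) n)
               (s₁+1-⊛ s₁+1 (suc q)) (trans (s₁+1-⊛ F (suc q)) (F-recurrence q)) ⟩
    (s₁+1 n + s₁+1 (suc q)) - ℚ+ 4 * (ℚ+ 2 * C) - ℚ+ 4 * (F ⊛ s₁+1) n + ℚ+ 4 * ℚ+ 4 * (F ⊛ F) n
      ≡⟨ cong₂ (λ x y → (s₁+1 n + s₁+1 (suc q)) - ℚ+ 4 * (ℚ+ 2 * C) - ℚ+ 4 * x + ℚ+ 4 * ℚ+ 4 * y)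
               (trans (⊛-s₁+1 F (suc q)) (F-recurrence q)) (F⊛F n) ⟩
    (s₁+1 n + s₁+1 (suc q)) - ℚ+ 4 * (ℚ+ 2 * C) - ℚ+ 4 * (ℚ+ 2 * C) + ℚ+ 4 * ℚ+ 4 * C
      ≡⟨ cancel (s₁+1 n + s₁+1 (suc q)) C ⟩
    s₁+1 n + s₁+1 (suc q)
      ≡⟨ low-terms q ⟩
    P-oo n ∎
    where
    open ≡-Reasoning
    n : ℕ
    n = suc (suc q)
    C : ℚ
    C = ℚ+ (schröderConvolution n)
    cancel : ∀ a c → a - ℚ+ 4 * (ℚ+ 2 * c) - ℚ+ 4 * (ℚ+ 2 * c) + ℚ+ 4 * ℚ+ 4 * c ≡ a
    cancel = solve-∀ ℚ-ring
    low-terms : ∀ q → s₁+1 (suc (suc q)) + s₁+1 (suc q) ≡ P-oo (suc (suc q))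
    low-terms zero    = refl
    low-terms (suc q) = refl

  oriented : Σ[ R ∈ Series ] (IsSqrt R P-oo × (Z-Eoo ≈ scale ¼ (s₁ ⊛ (s₁+1 ⊖ R))))
  oriented = √P-oo , (refl , √P-oo-squared) , Z-Eoo≈
    where
    Z-Eoo≈ : Z-Eoo ≈ scale ¼ (s₁ ⊛ (s₁+1 ⊖ √P-oo))
    Z-Eoo≈ zero    = refl
    Z-Eoo≈ (suc n) = sym (begin
      ¼ * (s₁ ⊛ (s₁+1 ⊖ √P-oo)) (suc n)     ≡⟨ cong (¼ *_) (s₁-⊛ (s₁+1 ⊖ √P-oo) n) ⟩
      ¼ * (s₁+1 n - (s₁+1 n - ℚ+ 4 * F n))   ≡⟨ quarter-of-four (s₁+1 n) (F n) ⟩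
      F n                                     ∎)
      where
      open ≡-Reasoning
      quarter-of-four : ∀ e f → ¼ * (e - (e - ℚ+ 4 * f)) ≡ f
      quarter-of-four e f = trans (cong (¼ *_) (e-[e-x]≡x e (ℚ+ 4 * f))) (trans (sym (*-assoc ¼ (ℚ+ 4) f)) (*-identityˡ f))
        where
        e-[e-x]≡x : ∀ e x → e - (e - x) ≡ x
        e-[e-x]≡x = solve-∀ ℚ-ring

module Monomials where

  open import Data.Bool.Base using (true; false; _∧_; if_then_else_)
  open import Data.Empty using (⊥-elim)
  open import Data.List.Base using ([]; _∷_)
  open import Data.Nat.Base as ℕ using (ℕ; suc; _∸_; _≡ᵇ_; _≤_; s≤s)
  import Data.Nat.Properties as ℕ
  open import Data.Product.Base using (_×_; _,_)
  open import Data.Rational.Base using (ℚ; 0ℚ; _+_; _*_)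
  open import Data.Rational.Properties using (*-zeroˡ; *-distribʳ-+; +-identityʳ)
  open import Relation.Binary.PropositionalEquality
  open import Relation.Nullary.Negation using (¬_)
  open Polygon using (from-true; to-true; ≡ᵇ-reflects-≡)
  open RationalSums

  monomial : ℚ → ℕ → ℕ → Series2
  monomial c i₀ j₀ i j = if (i₀ ≡ᵇ i) ∧ (j₀ ≡ᵇ j) then c else 0ℚ

  poly2-monomial : ∀ c i₀ j₀ i j → poly2 ((c , i₀ , j₀) ∷ []) i j ≡ monomial c i₀ j₀ i j
  poly2-monomial c i₀ j₀ i j = +-identityʳ _

  poly2-binomial : ∀ c i₀ j₀ d i₁ j₁ i j →
    poly2 ((c , i₀ , j₀) ∷ (d , i₁ , j₁) ∷ []) i j ≡ monomial c i₀ j₀ i j + monomial d i₁ j₁ i j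
  poly2-binomial c i₀ j₀ d i₁ j₁ i j = cong (monomial c i₀ j₀ i j +_) (+-identityʳ _)

  ⊛₂-congˡ : ∀ P P′ G → P ≈₂ P′ → (P ⊛₂ G) ≈₂ (P′ ⊛₂ G)
  ⊛₂-congˡ P P′ G P≈P′ a b =
    Σ<-cong (suc a) _ _ (λ i _ → Σ<-cong (suc b) _ _ (λ j _ → cong (_* G (a ∸ i) (b ∸ j)) (P≈P′ i j)))

  ⊛₂-distribʳ-+ : ∀ P P′ G a b → ((λ i j → P i j + P′ i j) ⊛₂ G) a b ≡ (P ⊛₂ G) a b + (P′ ⊛₂ G) a b
  ⊛₂-distribʳ-+ P P′ G a b =
    trans (Σ<-cong (suc a) _ _ (λ i _ → trans (Σ<-cong (suc b) _ _ (λ j _ → *-distribʳ-+ (G (a ∸ i) (b ∸ j)) (P i j) (P′ i j)))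
                                              (Σ<-+ (suc b) _ _)))
          (Σ<-+ (suc a) _ _)

  monomial-off : ∀ c i₀ j₀ i j → ¬ (i ≡ i₀ × j ≡ j₀) → monomial c i₀ j₀ i j ≡ 0ℚ
  monomial-off c i₀ j₀ i j i,j≢ with i₀ ≡ᵇ i in i₀≟i | j₀ ≡ᵇ j in j₀≟j
  ... | false | _     = refl
  ... | true  | false = refl
  ... | true  | true  = ⊥-elim (i,j≢ (sym (from-true (≡ᵇ-reflects-≡ i₀ i) i₀≟i) , sym (from-true (≡ᵇ-reflects-≡ j₀ j) j₀≟j)))

  monomial-on : ∀ c i₀ j₀ → monomial c i₀ j₀ i₀ j₀ ≡ c
  monomial-on c i₀ j₀ rewrite to-true (≡ᵇ-reflects-≡ i₀ i₀) refl | to-true (≡ᵇ-reflects-≡ j₀ j₀) refl = refl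

  monomial-⊛₂ : ∀ c i₀ j₀ (G : Series2) a b → i₀ ≤ a → j₀ ≤ b → (monomial c i₀ j₀ ⊛₂ G) a b ≡ c * G (a ∸ i₀) (b ∸ j₀)
  monomial-⊛₂ c i₀ j₀ G a b i₀≤a j₀≤b =
    trans (Σ<-single (suc a) _ i₀ (s≤s i₀≤a) λ i _ i≢i₀ →
             Σ<-zero (suc b) _ (λ j _ → trans (cong (_* G (a ∸ i) (b ∸ j)) (monomial-off c i₀ j₀ i j (λ (i≡i₀ , _) → i≢i₀ i≡i₀)))
                                              (*-zeroˡ (G (a ∸ i) (b ∸ j)))))
      (trans (Σ<-single (suc b) _ j₀ (s≤s j₀≤b) λ j _ j≢j₀ →
                trans (cong (_* G (a ∸ i₀) (b ∸ j)) (monomial-off c i₀ j₀ i₀ j (λ (_ , j≡j₀) → j≢j₀ j≡j₀))) (*-zeroˡ (G (a ∸ i₀) (b ∸ j))))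
             (cong (_* G (a ∸ i₀) (b ∸ j₀)) (monomial-on c i₀ j₀)))

  monomial-⊛₂-outside : ∀ c i₀ j₀ (G : Series2) a b → ¬ (i₀ ≤ a × j₀ ≤ b) → (monomial c i₀ j₀ ⊛₂ G) a b ≡ 0ℚ
  monomial-⊛₂-outside c i₀ j₀ G a b outside = Σ<-zero (suc a) _ (λ i i<1+a → Σ<-zero (suc b) _ (λ j j<1+b →
    trans (cong (_* G (a ∸ i) (b ∸ j)) (monomial-off c i₀ j₀ i j λ { (refl , refl) → outside (ℕ.≤-pred i<1+a , ℕ.≤-pred j<1+b) }))
          (*-zeroˡ (G (a ∸ i) (b ∸ j)))))

module Dilation where

  open import Data.Nat.Base as ℕ using (ℕ; zero; suc; _∸_; _<_; _≤_; z≤n; s≤s)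
  import Data.Nat.Properties as ℕ
  open import Data.Rational.Base using (0ℚ; _+_; _*_)
  open import Data.Rational.Properties using (*-zeroˡ; *-zeroʳ; +-identityʳ)
  open import Relation.Binary.PropositionalEquality
  open ReflectiveCounts using (double; parity-cases)
  open RationalSums

  -- g (s²)
  dilate : Series → Series
  dilate g zero          = g 0
  dilate g (suc zero)    = 0ℚ
  dilate g (suc (suc a)) = dilate (λ k → g (suc k)) a

  dilate-double : ∀ g m → dilate g (double m) ≡ g m
  dilate-double g zero    = refl
  dilate-double g (suc m) = dilate-double (λ k → g (suc k)) m

  dilate-odd : ∀ g m → dilate g (suc (double m)) ≡ 0ℚ
  dilate-odd g zero    = refl
  dilate-odd g (suc m) = dilate-odd (λ k → g (suc k)) m

  dilate-cong : ∀ g h → g ≈ h → dilate g ≈ dilate h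
  dilate-cong g h g≈h zero          = g≈h 0
  dilate-cong g h g≈h (suc zero)    = refl
  dilate-cong g h g≈h (suc (suc a)) = dilate-cong (λ k → g (suc k)) (λ k → h (suc k)) (λ k → g≈h (suc k)) a

  dilate-zero : ∀ g → (∀ k → g k ≡ 0ℚ) → ∀ a → dilate g a ≡ 0ℚ
  dilate-zero g g≈0 a = trans (dilate-cong g (λ _ → 0ℚ) g≈0 a) (zeros a)
    where
    zeros : ∀ a → dilate (λ _ → 0ℚ) a ≡ 0ℚ
    zeros zero          = refl
    zeros (suc zero)    = refl
    zeros (suc (suc a)) = zeros a

  private
    double-∸ : ∀ m t → t ≤ m → double m ∸ double t ≡ double (m ∸ t)
    double-∸ m       zero    _         = refl
    double-∸ (suc m) (suc t) (s≤s t≤m) = double-∸ m t t≤m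

    odd-∸ : ∀ m t → t ≤ m → suc (double m) ∸ double t ≡ suc (double (m ∸ t))
    odd-∸ m       zero    _         = refl
    odd-∸ (suc m) (suc t) (s≤s t≤m) = odd-∸ m t t≤m

    double-≤-odd : ∀ {t m} → double t ≤ suc (double m) → t ≤ m
    double-≤-odd {zero}          _                 = z≤n
    double-≤-odd {suc t} {zero}  (s≤s ())
    double-≤-odd {suc t} {suc m} (s≤s (s≤s 2t≤2m)) = s≤s (double-≤-odd 2t≤2m)

    Σ<-evens : ∀ m (g : ℕ → _) → (∀ t → t < m → g (suc (double t)) ≡ 0ℚ) → Σ< (suc (double m)) g ≡ Σ< (suc m) (λ t → g (double t))
    Σ<-evens zero    g odd≈0 = refl
    Σ<-evens (suc m) g odd≈0 =
      cong (_+ g (double (suc m)))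
        (trans (cong (Σ< (suc (double m)) g +_) (odd≈0 m ℕ.≤-refl))
               (trans (+-identityʳ _) (Σ<-evens m g (λ t t<m → odd≈0 t (ℕ.m<n⇒m<1+n t<m)))))

  dilate-⊛ : ∀ g h → dilate g ⊛ dilate h ≈ dilate (g ⊛ h)
  dilate-⊛ g h = parity-cases (λ a → (dilate g ⊛ dilate h) a ≡ dilate (g ⊛ h) a) even odd
    where
    even : ∀ m → (dilate g ⊛ dilate h) (double m) ≡ dilate (g ⊛ h) (double m)
    even m =
      trans (Σ<-evens m _ (λ t _ → trans (cong (_* dilate h (double m ∸ suc (double t))) (dilate-odd g t))
                                         (*-zeroˡ (dilate h (double m ∸ suc (double t))))))
        (trans (Σ<-cong (suc m) _ _ (λ t t<1+m →
                  cong₂ _*_ (dilate-double g t) (trans (cong (dilate h) (double-∸ m t (ℕ.≤-pred t<1+m))) (dilate-double h (m ∸ t)))))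
               (sym (dilate-double (g ⊛ h) m)))
    odd : ∀ m → (dilate g ⊛ dilate h) (suc (double m)) ≡ dilate (g ⊛ h) (suc (double m))
    odd m = trans (Σ<-zero (suc (suc (double m))) _ (λ i i< → odd-term i (ℕ.≤-pred i<))) (sym (dilate-odd (g ⊛ h) m))
      where
      odd-term : ∀ i → i ≤ suc (double m) → dilate g i * dilate h (suc (double m) ∸ i) ≡ 0ℚ
      odd-term = parity-cases (λ i → i ≤ suc (double m) → dilate g i * dilate h (suc (double m) ∸ i) ≡ 0ℚ)
        (λ t 2t≤ → trans (cong (dilate g (double t) *_) (trans (cong (dilate h) (odd-∸ m t (double-≤-odd 2t≤))) (dilate-odd h (m ∸ t))))
                         (*-zeroʳ (dilate g (double t))))
        (λ t _ → trans (cong (_* dilate h (suc (double m) ∸ suc (double t))) (dilate-odd g t))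
                       (*-zeroˡ (dilate h (double m ∸ double t))))

module ReflectiveSeries where

  open import Data.Bool.Base using (_∧_; if_then_else_)
  open import Data.Bool.Properties using (∧-zeroʳ)
  open import Data.List.Base using ([]; _∷_)
  open import Data.List.Relation.Unary.All using (All; []; _∷_)
  open import Data.Nat.Base as ℕ using (ℕ; zero; suc; _∸_; _≡ᵇ_; _<_; z≤n; s≤s)
  import Data.Nat.Properties as ℕ
  open import Data.Product.Base using (_×_; _,_; proj₂; Σ-syntax)
  open import Data.Rational.Base using (ℚ; 0ℚ; 1ℚ; ½; _+_; _*_; -_; _-_)
  open import Data.Rational.Properties
  open import Relation.Binary.PropositionalEquality
  open import Relation.Nullary.Reflects using (_×-reflects_)
  open import Tactic.RingSolver using (solve-∀)
  open Polygon using (to-true; to-false; ≡ᵇ-reflects-≡)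
  open RationalSums
  open OrientedSeries using (F; √P-oo; √P-oo-squared)
  open Monomials
  open Dilation
  open ReflectiveCounts
  open CycleType

  times-s₁ : Series2 → Series2
  times-s₁ G zero    b = 0ℚ
  times-s₁ G (suc a) b = G a b

  times-s₂ : Series2 → Series2
  times-s₂ G a zero    = 0ℚ
  times-s₂ G a (suc b) = G a b

  monomial-s₁-⊛₂ : ∀ c G → monomial c 1 0 ⊛₂ G ≈₂ (λ a b → c * times-s₁ G a b)
  monomial-s₁-⊛₂ c G zero    b = trans (monomial-⊛₂-outside c 1 0 G 0 b (λ { (() , _) })) (sym (*-zeroʳ c))
  monomial-s₁-⊛₂ c G (suc a) b = monomial-⊛₂ c 1 0 G (suc a) b (s≤s z≤n) z≤n

  monomial-s₂-⊛₂ : ∀ c G → monomial c 0 1 ⊛₂ G ≈₂ (λ a b → c * times-s₂ G a b)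
  monomial-s₂-⊛₂ c G a zero    = trans (monomial-⊛₂-outside c 0 1 G a 0 (λ { (_ , ()) })) (sym (*-zeroʳ c))
  monomial-s₂-⊛₂ c G a (suc b) = monomial-⊛₂ c 0 1 G a (suc b) z≤n (s≤s z≤n)

  poly2-s₂-free : ∀ ts a b → All (λ t → proj₂ (proj₂ t) ≡ 0) ts → poly2 ts a (suc b) ≡ 0ℚ
  poly2-s₂-free []                 a b []           = refl
  poly2-s₂-free ((c , i , _) ∷ ts) a b (refl ∷ j≡0) =
    trans (cong₂ _+_ (cong (λ t → if t then c else 0ℚ) (∧-zeroʳ (i ≡ᵇ a))) (poly2-s₂-free ts a b j≡0)) (+-identityˡ 0ℚ)

  √P⁺ : Series2
  √P⁺ a b = if b ≡ᵇ 0 then dilate √P-oo a else 0ℚ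

  √P⁺-squared : √P⁺ ⊛₂ √P⁺ ≈₂ P⁺
  √P⁺-squared a zero = begin
    Σ< (suc a) (λ i → 0ℚ + dilate √P-oo i * dilate √P-oo (a ∸ i))  ≡⟨ Σ<-cong (suc a) _ _ (λ i _ → +-identityˡ _) ⟩
    (dilate √P-oo ⊛ dilate √P-oo) a                                 ≡⟨ dilate-⊛ √P-oo √P-oo a ⟩
    dilate (√P-oo ⊛ √P-oo) a                                        ≡⟨ dilate-cong _ _ √P-oo-squared a ⟩
    dilate P-oo a                                                   ≡⟨ row a ⟩
    P⁺ a 0                                                          ∎
    where
    open ≡-Reasoning
    row : ∀ a → dilate P-oo a ≡ P⁺ a 0
    row 0 = refl
    row 1 = refl
    row 2 = refl
    row 3 = refl
    row 4 = refl
    row 5 = refl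
    row (suc (suc (suc (suc (suc (suc a)))))) = dilate-zero (λ k → P-oo (3 ℕ.+ k)) (λ k → refl) a
  √P⁺-squared a (suc b) =
    trans (Σ<-zero (suc a) _ (λ i _ → Σ<-zero (suc (suc b)) _ (no-s₂ i)))
          (sym (poly2-s₂-free ((1ℚ , 0 , 0) ∷ (ℚ- 6 , 2 , 0) ∷ (1ℚ , 4 , 0) ∷ []) a b (refl ∷ refl ∷ refl ∷ [])))
    where
    no-s₂ : ∀ i j → j < suc (suc b) → √P⁺ i j * √P⁺ (a ∸ i) (suc b ∸ j) ≡ 0ℚ
    no-s₂ i zero    _ = *-zeroʳ (dilate √P-oo i)
    no-s₂ i (suc j) _ = *-zeroˡ (√P⁺ (a ∸ i) (b ∸ j))

  Z⁺-Coefficient : ℕ → Set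
  Z⁺-Coefficient a = ℚ+ 4 * Z⁺-Eor a 0 ≡ N⁺ (suc a) 0 - (1ℚ * √P⁺ (suc a) 0 + 1ℚ * √P⁺ a 0)

  -- from a = 4 on, N⁺ vanishes and √P-oo k = - 4 F k, while #reflective (2k) = F k and #reflective (2k+1) = F (k+1)
  Z⁺-coefficient-even : ∀ k → Z⁺-Coefficient (double k)
  Z⁺-coefficient-even 0             = refl
  Z⁺-coefficient-even 1             = refl
  Z⁺-coefficient-even (suc (suc k)) = begin
    ℚ+ 4 * ℚ+ (#reflective (double (2 ℕ.+ k)))
      ≡⟨ cong (λ n → ℚ+ 4 * ℚ+ n) (#reflective-even (suc k)) ⟩
    ℚ+ 4 * F (2 ℕ.+ k)
      ≡⟨ x≡0-[0+[0-x]] (ℚ+ 4 * F (2 ℕ.+ k)) ⟩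
    0ℚ - (1ℚ * 0ℚ + 1ℚ * (0ℚ - ℚ+ 4 * F (2 ℕ.+ k)))
      ≡⟨ cong₂ (λ u v → 0ℚ - (1ℚ * u + 1ℚ * v)) (dilate-odd √P-oo (2 ℕ.+ k)) (dilate-double √P-oo (2 ℕ.+ k)) ⟨
    0ℚ - (1ℚ * dilate √P-oo (suc (double (2 ℕ.+ k))) + 1ℚ * dilate √P-oo (double (2 ℕ.+ k))) ∎
    where
    open ≡-Reasoning
    x≡0-[0+[0-x]] : ∀ x → x ≡ 0ℚ - (1ℚ * 0ℚ + 1ℚ * (0ℚ - x))
    x≡0-[0+[0-x]] = solve-∀ ℚ-ring

  Z⁺-coefficient-odd : ∀ k → Z⁺-Coefficient (suc (double k))
  Z⁺-coefficient-odd 0             = refl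
  Z⁺-coefficient-odd 1             = refl
  Z⁺-coefficient-odd (suc (suc k)) = begin
    ℚ+ 4 * ℚ+ (#reflective (suc (double (2 ℕ.+ k))))
      ≡⟨ cong (λ n → ℚ+ 4 * ℚ+ n) (#reflective-odd (suc k)) ⟩
    ℚ+ 4 * F (3 ℕ.+ k)
      ≡⟨ x≡0-[[0-x]+0] (ℚ+ 4 * F (3 ℕ.+ k)) ⟩
    0ℚ - (1ℚ * (0ℚ - ℚ+ 4 * F (3 ℕ.+ k)) + 1ℚ * 0ℚ)
      ≡⟨ cong₂ (λ u v → 0ℚ - (1ℚ * u + 1ℚ * v)) (dilate-double √P-oo (3 ℕ.+ k)) (dilate-odd √P-oo (2 ℕ.+ k)) ⟨
    0ℚ - (1ℚ * dilate √P-oo (double (3 ℕ.+ k)) + 1ℚ * dilate √P-oo (suc (double (2 ℕ.+ k)))) ∎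
    where
    open ≡-Reasoning
    x≡0-[[0-x]+0] : ∀ x → x ≡ 0ℚ - (1ℚ * (0ℚ - x) + 1ℚ * 0ℚ)
    x≡0-[[0-x]+0] = solve-∀ ℚ-ring

  reflective⁺ : Σ[ R ∈ Series2 ] (IsSqrt2 R P⁺ × (4s₁ ⊛₂ Z⁺-Eor ≈₂ N⁺ ⊖₂ one+s₁ ⊛₂ R))
  reflective⁺ = √P⁺ , (refl , √P⁺-squared) , λ a b → begin
    (4s₁ ⊛₂ Z⁺-Eor) a b
      ≡⟨ trans (⊛₂-congˡ _ _ Z⁺-Eor (poly2-monomial (ℚ+ 4) 1 0) a b) (monomial-s₁-⊛₂ (ℚ+ 4) Z⁺-Eor a b) ⟩
    ℚ+ 4 * times-s₁ Z⁺-Eor a b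
      ≡⟨ coefficients a b ⟩
    N⁺ a b - (1ℚ * √P⁺ a b + 1ℚ * times-s₁ √P⁺ a b)
      ≡⟨ cong (λ x → N⁺ a b - x) (one+s₁-⊛₂ {a} {b}) ⟨
    N⁺ a b - (one+s₁ ⊛₂ √P⁺) a b ∎
    where
    open ≡-Reasoning
    one+s₁-⊛₂ : ∀ {a b} → (one+s₁ ⊛₂ √P⁺) a b ≡ 1ℚ * √P⁺ a b + 1ℚ * times-s₁ √P⁺ a b
    one+s₁-⊛₂ {a} {b} =
      trans (⊛₂-congˡ _ _ √P⁺ (poly2-binomial 1ℚ 0 0 1ℚ 1 0) a b)
        (trans (⊛₂-distribʳ-+ (monomial 1ℚ 0 0) (monomial 1ℚ 1 0) √P⁺ a b)
               (cong₂ _+_ (monomial-⊛₂ 1ℚ 0 0 √P⁺ a b z≤n z≤n) (monomial-s₁-⊛₂ 1ℚ √P⁺ a b)))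
    N⁺-s₂-free : ∀ a b → N⁺ a (suc b) ≡ 0ℚ
    N⁺-s₂-free a b = poly2-s₂-free ((1ℚ , 0 , 0) ∷ (1ℚ , 1 , 0) ∷ (ℚ- 3 , 2 , 0) ∷ (1ℚ , 3 , 0) ∷ []) a b (refl ∷ refl ∷ refl ∷ refl ∷ [])
    coefficients : ∀ a b → ℚ+ 4 * times-s₁ Z⁺-Eor a b ≡ N⁺ a b - (1ℚ * √P⁺ a b + 1ℚ * times-s₁ √P⁺ a b)
    coefficients zero    zero    = refl
    coefficients (suc a) zero    = parity-cases Z⁺-Coefficient Z⁺-coefficient-even Z⁺-coefficient-odd a
    coefficients zero    (suc b) = sym (cong (_- (1ℚ * 0ℚ + 0ℚ)) (N⁺-s₂-free 0 b))
    coefficients (suc a) (suc b) = trans (*-zeroʳ (ℚ+ 4)) (sym (cong (_- (1ℚ * 0ℚ + 1ℚ * 0ℚ)) (N⁺-s₂-free (suc a) b)))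

  -- the coefficient of s₁^a s₂^b in Z(Aut D) contributed by the reflection of a dissection with n vertices
  reflectionTerm : ℕ → ℕ → ℕ → ℚ
  reflectionTerm a b n = if (j₁ n ≡ᵇ a) ∧ (j₂ n ≡ᵇ b) then 1ℚ else 0ℚ

  Z⁻-Eor≡Σ : ∀ a b → Z⁻-Eor a b ≡ Σ< (suc (a ℕ.+ 2 ℕ.* b)) (λ n → ℚ+ (#reflective n) * reflectionTerm a b n)
  Z⁻-Eor≡Σ a b = Σ<-cong (suc (a ℕ.+ 2 ℕ.* b)) _ _ (λ n _ → sumℚ-const (reflDissections n) (reflectionTerm a b n))

  reflectionTerm-off : ∀ a b n → (a ≡ 0 → n ≢ double b) → (a ≡ 1 → n ≢ suc (double b)) → reflectionTerm a b n ≡ 0ℚ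
  reflectionTerm-off a b = parity-cases
    (λ n → (a ≡ 0 → n ≢ double b) → (a ≡ 1 → n ≢ suc (double b)) → reflectionTerm a b n ≡ 0ℚ)
    (λ t not-even _ → cong (λ x → if x then 1ℚ else 0ℚ)
      (trans (cong₂ (λ u v → (u ≡ᵇ a) ∧ (v ≡ᵇ b)) (j₁-even t) (j₂-even t))
             (to-false (≡ᵇ-reflects-≡ 0 a ×-reflects ≡ᵇ-reflects-≡ t b) λ (0≡a , t≡b) → not-even (sym 0≡a) (cong double t≡b))))
    (λ t _ not-odd → cong (λ x → if x then 1ℚ else 0ℚ)
      (trans (cong₂ (λ u v → (u ≡ᵇ a) ∧ (v ≡ᵇ b)) (j₁-odd t) (j₂-odd t))
             (to-false (≡ᵇ-reflects-≡ 1 a ×-reflects ≡ᵇ-reflects-≡ t b) λ (1≡a , t≡b) → not-odd (sym 1≡a) (cong (λ t → suc (double t)) t≡b))))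

  reflective-term-off : ∀ a b n → (a ≡ 0 → n ≢ double b) → (a ≡ 1 → n ≢ suc (double b)) →
                        ℚ+ (#reflective n) * reflectionTerm a b n ≡ 0ℚ
  reflective-term-off a b n not-even not-odd =
    trans (cong (ℚ+ (#reflective n) *_) (reflectionTerm-off a b n not-even not-odd)) (*-zeroʳ (ℚ+ (#reflective n)))

  double≡2* : ∀ b → double b ≡ 2 ℕ.* b
  double≡2* b = trans (double≡+ b) (cong (b ℕ.+_) (sym (ℕ.+-identityʳ b)))

  Z⁻-Eor-even : ∀ b → Z⁻-Eor 0 b ≡ ℚ+ (#reflective (double b))
  Z⁻-Eor-even b = begin
    Z⁻-Eor 0 b
      ≡⟨ Z⁻-Eor≡Σ 0 b ⟩
    Σ< (suc (2 ℕ.* b)) (λ n → ℚ+ (#reflective n) * reflectionTerm 0 b n)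
      ≡⟨ Σ<-single _ _ (double b) (s≤s (ℕ.≤-reflexive (double≡2* b)))
           (λ n _ n≢2b → reflective-term-off 0 b n (λ _ → n≢2b) (λ ())) ⟩
    ℚ+ (#reflective (double b)) * reflectionTerm 0 b (double b)
      ≡⟨ cong (λ u → ℚ+ (#reflective (double b)) * (if (u ≡ᵇ 0) ∧ (j₂ (double b) ≡ᵇ b) then 1ℚ else 0ℚ)) (j₁-even b) ⟩
    ℚ+ (#reflective (double b)) * (if j₂ (double b) ≡ᵇ b then 1ℚ else 0ℚ)
      ≡⟨ cong (λ v → ℚ+ (#reflective (double b)) * (if v then 1ℚ else 0ℚ)) (to-true (≡ᵇ-reflects-≡ _ b) (j₂-even b)) ⟩
    ℚ+ (#reflective (double b)) * 1ℚ
      ≡⟨ *-identityʳ _ ⟩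
    ℚ+ (#reflective (double b)) ∎
    where open ≡-Reasoning

  Z⁻-Eor-odd : ∀ b → Z⁻-Eor 1 b ≡ ℚ+ (#reflective (suc (double b)))
  Z⁻-Eor-odd b = begin
    Z⁻-Eor 1 b
      ≡⟨ Z⁻-Eor≡Σ 1 b ⟩
    Σ< (suc (suc (2 ℕ.* b))) (λ n → ℚ+ (#reflective n) * reflectionTerm 1 b n)
      ≡⟨ Σ<-single _ _ (suc (double b)) (s≤s (s≤s (ℕ.≤-reflexive (double≡2* b))))
           (λ n _ n≢1+2b → reflective-term-off 1 b n (λ ()) (λ _ → n≢1+2b)) ⟩
    ℚ+ (#reflective (suc (double b))) * reflectionTerm 1 b (suc (double b))
      ≡⟨ cong (λ u → ℚ+ (#reflective (suc (double b))) * (if (u ≡ᵇ 1) ∧ (j₂ (suc (double b)) ≡ᵇ b) then 1ℚ else 0ℚ)) (j₁-odd b) ⟩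
    ℚ+ (#reflective (suc (double b))) * (if j₂ (suc (double b)) ≡ᵇ b then 1ℚ else 0ℚ)
      ≡⟨ cong (λ v → ℚ+ (#reflective (suc (double b))) * (if v then 1ℚ else 0ℚ)) (to-true (≡ᵇ-reflects-≡ _ b) (j₂-odd b)) ⟩
    ℚ+ (#reflective (suc (double b))) * 1ℚ
      ≡⟨ *-identityʳ _ ⟩
    ℚ+ (#reflective (suc (double b))) ∎
    where open ≡-Reasoning

  Z⁻-Eor-high : ∀ a b → Z⁻-Eor (2 ℕ.+ a) b ≡ 0ℚ
  Z⁻-Eor-high a b = trans (Z⁻-Eor≡Σ (2 ℕ.+ a) b)
    (Σ<-zero (suc (2 ℕ.+ a ℕ.+ 2 ℕ.* b)) (λ n → ℚ+ (#reflective n) * reflectionTerm (2 ℕ.+ a) b n)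
             (λ n _ → reflective-term-off (2 ℕ.+ a) b n (λ ()) (λ ())))

  √P⁻ : Series2
  √P⁻ a b = if a ≡ᵇ 0 then √P-oo b else 0ℚ

  √P⁻-squared : √P⁻ ⊛₂ √P⁻ ≈₂ P⁻
  √P⁻-squared zero    b = trans (+-identityˡ _) (trans (√P-oo-squared b) (column b))
    where
    column : ∀ b → P-oo b ≡ P⁻ 0 b
    column 0 = refl
    column 1 = refl
    column 2 = refl
    column (suc (suc (suc b))) = refl
  √P⁻-squared (suc a) b = Σ<-zero (suc (suc a)) _ no-s₁
    where
    no-s₁ : ∀ i → i < suc (suc a) → Σ< (suc b) (λ j → √P⁻ i j * √P⁻ (suc a ∸ i) (b ∸ j)) ≡ 0ℚ
    no-s₁ zero    _ = Σ<-zero (suc b) _ (λ j _ → *-zeroʳ (√P-oo j))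
    no-s₁ (suc i) _ = Σ<-zero (suc b) _ (λ j _ → *-zeroˡ (√P⁻ (a ∸ i) (b ∸ j)))

  Z⁻-coefficient : ∀ a b → ℚ+ 4 * times-s₂ Z⁻-Eor a b ≡ N⁻ a b - (1ℚ * times-s₂ √P⁻ a b + 1ℚ * times-s₁ √P⁻ a b)
  Z⁻-coefficient zero          zero                = refl
  Z⁻-coefficient zero          (suc zero)          = cong (ℚ+ 4 *_) (Z⁻-Eor-even 0)
  Z⁻-coefficient zero          (suc (suc zero))    = cong (ℚ+ 4 *_) (Z⁻-Eor-even 1)
  Z⁻-coefficient zero          (suc (suc (suc m))) = begin
    ℚ+ 4 * Z⁻-Eor 0 (2 ℕ.+ m)                 ≡⟨ cong (ℚ+ 4 *_) (trans (Z⁻-Eor-even (2 ℕ.+ m)) (cong ℚ+ (#reflective-even (suc m)))) ⟩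
    ℚ+ 4 * F (2 ℕ.+ m)                        ≡⟨ x≡0-[[0-x]+0] (ℚ+ 4 * F (2 ℕ.+ m)) ⟩
    0ℚ - (1ℚ * (0ℚ - ℚ+ 4 * F (2 ℕ.+ m)) + 0ℚ) ∎
    where
    open ≡-Reasoning
    x≡0-[[0-x]+0] : ∀ x → x ≡ 0ℚ - (1ℚ * (0ℚ - x) + 0ℚ)
    x≡0-[[0-x]+0] = solve-∀ ℚ-ring
  Z⁻-coefficient (suc zero)    zero                = refl
  Z⁻-coefficient (suc zero)    (suc zero)          = cong (ℚ+ 4 *_) (Z⁻-Eor-odd 0)
  Z⁻-coefficient (suc zero)    (suc (suc m))       = begin
    ℚ+ 4 * Z⁻-Eor 1 (suc m)                   ≡⟨ cong (ℚ+ 4 *_) (trans (Z⁻-Eor-odd (suc m)) (cong ℚ+ (#reflective-odd m))) ⟩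
    ℚ+ 4 * F (2 ℕ.+ m)                        ≡⟨ x≡0-[0+[0-x]] (ℚ+ 4 * F (2 ℕ.+ m)) ⟩
    0ℚ - (1ℚ * 0ℚ + 1ℚ * (0ℚ - ℚ+ 4 * F (2 ℕ.+ m))) ∎
    where
    open ≡-Reasoning
    x≡0-[0+[0-x]] : ∀ x → x ≡ 0ℚ - (1ℚ * 0ℚ + 1ℚ * (0ℚ - x))
    x≡0-[0+[0-x]] = solve-∀ ℚ-ring
  Z⁻-coefficient (suc (suc a)) zero                = refl
  Z⁻-coefficient (suc (suc a)) (suc b)             = cong (ℚ+ 4 *_) (Z⁻-Eor-high a b)

  reflective⁻ : Σ[ R ∈ Series2 ] (IsSqrt2 R P⁻ × (4s₂ ⊛₂ Z⁻-Eor ≈₂ N⁻ ⊖₂ s₂+s₁ ⊛₂ R))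
  reflective⁻ = √P⁻ , (refl , √P⁻-squared) , λ a b → begin
    (4s₂ ⊛₂ Z⁻-Eor) a b
      ≡⟨ trans (⊛₂-congˡ _ _ Z⁻-Eor (poly2-monomial (ℚ+ 4) 0 1) a b) (monomial-s₂-⊛₂ (ℚ+ 4) Z⁻-Eor a b) ⟩
    ℚ+ 4 * times-s₂ Z⁻-Eor a b
      ≡⟨ Z⁻-coefficient a b ⟩
    N⁻ a b - (1ℚ * times-s₂ √P⁻ a b + 1ℚ * times-s₁ √P⁻ a b)
      ≡⟨ cong (λ x → N⁻ a b - x) (s₂+s₁-⊛₂ {a} {b}) ⟨
    N⁻ a b - (s₂+s₁ ⊛₂ √P⁻) a b ∎
    where
    open ≡-Reasoning
    s₂+s₁-⊛₂ : ∀ {a b} → (s₂+s₁ ⊛₂ √P⁻) a b ≡ 1ℚ * times-s₂ √P⁻ a b + 1ℚ * times-s₁ √P⁻ a b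
    s₂+s₁-⊛₂ {a} {b} =
      trans (⊛₂-congˡ _ _ √P⁻ (poly2-binomial 1ℚ 0 1 1ℚ 1 0) a b)
        (trans (⊛₂-distribʳ-+ (monomial 1ℚ 0 1) (monomial 1ℚ 1 0) √P⁻ a b)
               (cong₂ _+_ (monomial-s₂-⊛₂ 1ℚ √P⁻ a b) (monomial-s₁-⊛₂ 1ℚ √P⁻ a b)))

  Z-Eor≡average : ∀ a b → Z-Eor a b ≡ ½ * (Z⁺-Eor a b + Z⁻-Eor a b)
  Z-Eor≡average a b = begin
    Z-Eor a b
      ≡⟨ Σ<-cong M _ _ (λ n _ → trans (sumℚ-const (reflDissections n) (½ * (identityTerm n + reflectionTerm a b n)))
                                      (distrib (ℚ+ (#reflective n)) (identityTerm n) (reflectionTerm a b n))) ⟩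
    Σ< M (λ n → ½ * (ℚ+ (#reflective n) * identityTerm n + ℚ+ (#reflective n) * reflectionTerm a b n))
      ≡⟨ trans (Σ<-*ˡ M ½ _) (cong (½ *_) (Σ<-+ M _ _)) ⟩
    ½ * (Σ< M (λ n → ℚ+ (#reflective n) * identityTerm n) + Σ< M (λ n → ℚ+ (#reflective n) * reflectionTerm a b n))
      ≡⟨ cong (λ x → ½ * (x + Σ< M (λ n → ℚ+ (#reflective n) * reflectionTerm a b n)))
              (Σ<-single M (λ n → ℚ+ (#reflective n) * identityTerm n) a (s≤s (ℕ.m≤m+n a (2 ℕ.* b))) off) ⟩
    ½ * (ℚ+ (#reflective a) * identityTerm a + Σ< M (λ n → ℚ+ (#reflective n) * reflectionTerm a b n))
      ≡⟨ cong₂ (λ x y → ½ * (x + y)) (identity-part b) (sym (Z⁻-Eor≡Σ a b)) ⟩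
    ½ * (Z⁺-Eor a b + Z⁻-Eor a b) ∎
    where
    open ≡-Reasoning
    M : ℕ
    M = suc (a ℕ.+ 2 ℕ.* b)
    identityTerm : ℕ → ℚ
    identityTerm n = if (n ≡ᵇ a) ∧ (b ≡ᵇ 0) then 1ℚ else 0ℚ
    distrib : ∀ r x y → r * (½ * (x + y)) ≡ ½ * (r * x + r * y)
    distrib = solve-∀ ℚ-ring
    off : ∀ n → n < M → n ≢ a → ℚ+ (#reflective n) * identityTerm n ≡ 0ℚ
    off n _ n≢a = trans (cong (λ t → ℚ+ (#reflective n) * (if t ∧ (b ≡ᵇ 0) then 1ℚ else 0ℚ)) (to-false (≡ᵇ-reflects-≡ n a) n≢a))
                        (*-zeroʳ (ℚ+ (#reflective n)))
    identity-part : ∀ b → ℚ+ (#reflective a) * (if (a ≡ᵇ a) ∧ (b ≡ᵇ 0) then 1ℚ else 0ℚ) ≡ Z⁺-Eor a b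
    identity-part b = trans (cong (λ t → ℚ+ (#reflective a) * (if t ∧ (b ≡ᵇ 0) then 1ℚ else 0ℚ)) (to-true (≡ᵇ-reflects-≡ a a) refl))
                            (by-b b)
      where
      by-b : ∀ b → ℚ+ (#reflective a) * (if b ≡ᵇ 0 then 1ℚ else 0ℚ) ≡ Z⁺-Eor a b
      by-b zero    = *-identityʳ (ℚ+ (#reflective a))
      by-b (suc _) = *-zeroʳ (ℚ+ (#reflective a))

open import Data.Product.Base using (_×_; Σ-syntax; _,_)
open import Data.Rational.Base using (½; _+_; _*_)
open import Relation.Binary.PropositionalEquality using (_≡_)

lemma3 :
    -- Z(E_o^o) = (s₁/4) (s₁ + 1 - √(s₁² - 6s₁ + 1))
    (Σ[ R ∈ Series ] (IsSqrt R P-oo × (Z-Eoo ≈ scale ¼ (s₁ ⊛ (s₁+1 ⊖ R)))))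
    -- Z(E_o^r) = ½ (Z⁺ + Z⁻)
    × (∀ a b → Z-Eor a b ≡ ½ * (Z⁺-Eor a b + Z⁻-Eor a b))
    -- 4 s₁ Z⁺ = 1 + s₁ - 3s₁² + s₁³ - (1 + s₁) √(s₁⁴ - 6s₁² + 1)
    × (Σ[ R ∈ Series2 ] (IsSqrt2 R P⁺ × (4s₁ ⊛₂ Z⁺-Eor ≈₂ N⁺ ⊖₂ one+s₁ ⊛₂ R)))
    -- 4 s₂ Z⁻ = s₂² - 3s₁s₂ + s₂ + s₁ - (s₂ + s₁) √(s₂² - 6s₂ + 1)
    × (Σ[ R ∈ Series2 ] (IsSqrt2 R P⁻ × (4s₂ ⊛₂ Z⁻-Eor ≈₂ N⁻ ⊖₂ s₂+s₁ ⊛₂ R)))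
lemma3 = OrientedSeries.oriented
       , ReflectiveSeries.Z-Eor≡average
       , ReflectiveSeries.reflective⁺
       , ReflectiveSeries.reflective⁻
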